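{- Let $\mathcal{M}$ be a finite unitary magma and $m:=\#\mathcal{M}$. The Hilbert series $\mathcal{H}^!(t):=\sum_{n\ge1}\dim\mathrm{NC}\mathcal{M}^!(n)\,t^n$ of the Koszul dual $\mathrm{NC}\mathcal{M}^!$ of $\mathrm{NC}\mathcal{M}$ satisfies $$t+(m-1)t^2+(2m^2t-3mt+2t-1)\mathcal{H}^!(t)+(m^3-2m^2+2m-1)\mathcal{H}^!(t)^2=0.$$
   Context: $\mathbb{K}$ is a field of characteristic zero. A unitary magma $\mathcal{M}$ is a set with binary operation $\star$ and two-sided unit $1_\mathcal{M}$. For $n\ge1$, an $\mathcal{M}$-clique of arity $n$ labels each arc $(x,y)$, $1\le x<y\le n+1$, of a polygon with vertices $1,\dots,n+1$ by an element of $\mathcal{M}$; base $(1,n+1)$ (label $\mathfrak{p}_0$), edges $(i,i+1)$ (labels $\mathfrak{p}_i$); a unique clique in arity 1. Solid: label $\neq1_\mathcal{M}$; noncrossing: no two solid diagonals $(x,y),(x',y')$ with $x<x'<y<y'$ or $x'<x<y'<y$. $\mathfrak{p}\circ_i\mathfrak{q}$ glues the base of $\mathfrak{q}$ (arity $m'$) onto the $i$th edge of $\mathfrak{p}$, arcs keep labels with the obvious vertex shifts, the common arc $(i,i+m')$ gets $\mathfrak{p}_i\star\mathfrak{q}_0$, other arcs $1_\mathcal{M}$; $\mathrm{NC}\mathcal{M}$ is the operad spanned by noncrossing cliques. $\mathrm{NC}\mathcal{M}$ is binary and quadratic (generated by its arity-2 elements with quadratic relations), and $\mathrm{NC}\mathcal{M}^!$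 denotes its Koszul dual in the sense of Ginzburg–Kapranov. -}

module Defs where

open import Level using (Level; _⊔_) renaming (suc to lsuc)
open import Data.Nat as ℕ using (ℕ; zero; suc)
open import Data.Fin using (Fin)
import Data.Fin.Properties as FinP
open import Data.Product using (Σ; _×_; _,_; proj₁; proj₂)
open import Data.Product.Properties using (≡-dec)
open import Data.List using (List; []; _∷_; map; upTo)
open import Data.Bool using (if_then_else_)
open import Data.Integer as Int using (ℤ; +_)
import Data.List as L
open import Relation.Nullary using (¬_; Dec; yes; no)
open import Relation.Nullary.Decidable using (⌊_⌋)
open import Relation.Binary.PropositionalEquality using (_≡_; refl; cong; cong₂)
open import Algebra.Bundles using (CommutativeRing)
open import Algebra.Core using (Op₂)

natCast : ∀ {c ℓ} (R : CommutativeRing c ℓ) → ℕ → CommutativeRing.Carrier R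
natCast R zero    = CommutativeRing.0# R
natCast R (suc n) = CommutativeRing._+_ R (CommutativeRing.1# R) (natCast R n)

record CharZeroField c ℓ : Set (lsuc (c ⊔ ℓ)) where
  field
    cring      : CommutativeRing c ℓ
  open CommutativeRing cring
  field
    nontrivial : ¬ (1# ≈ 0#)
    inverse    : ∀ x → ¬ (x ≈ 0#) → Σ Carrier λ y → (x * y) ≈ 1#
    charZero   : ∀ n → natCast cring n ≈ 0# → n ≡ 0

-- The magma M is (up to isomorphism) a magma structure on Fin m.
-- Generators of NC M (and, via the dual basis, of the Koszul dual):
-- the arity-2 cliques (triangles), given by (p0 , p1 , p2) =
-- (label of base (1,3), label of edge (1,2), label of edge (2,3)).

Gen : ℕ → Set
Gen m = Fin m × Fin m × Fin m

-- Basis of the free nonsymmetric operad on binary generators Gen m: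
-- planar binary trees with internal nodes labelled by generators.
-- node g l r  =  (g ∘₂ r) ∘₁ l  (l grafted on input 1, r on input 2).
data Tree (m : ℕ) : Set where
  leaf : Tree m
  node : Gen m → Tree m → Tree m → Tree m

leaves : ∀ {m} → Tree m → ℕ
leaves leaf         = 1
leaves (node g l r) = leaves l ℕ.+ leaves r

_≟G_ : ∀ {m} (x y : Gen m) → Dec (x ≡ y)
_≟G_ = ≡-dec FinP._≟_ (≡-dec FinP._≟_ FinP._≟_)

node-inj : ∀ {m} {g g' : Gen m} {l l' r r'} → node g l r ≡ node g' l' r' →
           (g ≡ g') × (l ≡ l') × (r ≡ r')
node-inj refl = refl , refl , refl

_≟T_ : ∀ {m} (x y : Tree m) → Dec (x ≡ y)
leaf ≟T leaf = yes refl
leaf ≟T node _ _ _ = no λ ()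
node _ _ _ ≟T leaf = no λ ()
node g l r ≟T node g' l' r' with g ≟G g' | l ≟T l' | r ≟T r'
... | yes refl | yes refl | yes refl = yes refl
... | no ¬p | _ | _ = no λ eq → ¬p (proj₁ (node-inj eq))
... | yes _ | no ¬p | _ = no λ eq → ¬p (proj₁ (proj₂ (node-inj eq)))
... | yes _ | yes _ | no ¬p = no λ eq → ¬p (proj₂ (proj₂ (node-inj eq)))

data Ctx (m : ℕ) : Set where
  hole : Ctx m
  inL  : Gen m → Ctx m → Tree m → Ctx m
  inR  : Gen m → Tree m → Ctx m → Ctx m

fill : ∀ {m} → Ctx m → Tree m → Tree m
fill hole        t = t
fill (inL g C r) t = node g (fill C t) r
fill (inR g l C) t = node g l (fill C t)

-- Basis of the arity-3 component of the free operad: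
-- L g h = g ∘₁ h ,  R g h = g ∘₂ h.
data T3 (m : ℕ) : Set where
  L : Gen m → Gen m → T3 m
  R : Gen m → Gen m → T3 m

inst : ∀ {m} → T3 m → Tree m → Tree m → Tree m → Tree m
inst (L g h) a b c = node g (node h a b) c
inst (R g h) a b c = node g a (node h b c)

-- Cliques of arity 3 (squares 1,2,3,4), labels of the arcs in the order
-- (1,2) , (2,3) , (3,4) , (1,3) , (2,4) , (1,4).
Clique3 : ℕ → Set
Clique3 m = Fin m × Fin m × Fin m × Fin m × Fin m × Fin m

_≟C_ : ∀ {m} (x y : Clique3 m) → Dec (x ≡ y)
_≟C_ = ≡-dec FinP._≟_ (≡-dec FinP._≟_ (≡-dec FinP._≟_
         (≡-dec FinP._≟_ (≡-dec FinP._≟_ FinP._≟_))))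

-- The evaluation map F(E)(3) → NC M(3) on basis elements:
-- the clique compositions p ∘₁ q and p ∘₂ q of two triangles.
module _ {m : ℕ} (_⋆_ : Op₂ (Fin m)) (e : Fin m) where
  compose3 : T3 m → Clique3 m
  compose3 (L (p0 , p1 , p2) (q0 , q1 , q2)) =
    q1 , q2 , p2 , (p1 ⋆ q0) , e , p0
  compose3 (R (p0 , p1 , p2) (q0 , q1 , q2)) =
    p1 , q1 , q2 , e , (p2 ⋆ q0) , p0

-- Linear algebra over the field: the Koszul dual NC M ^! = F(E^∨)/(R^⊥)

module Koszul {c ℓ} (F : CharZeroField c ℓ) {m : ℕ}
              (_⋆_ : Op₂ (Fin m)) (e : Fin m) where
  open CharZeroField F
  open CommutativeRing cring

  sumFin : (n : ℕ) → (Fin n → Carrier) → Carrier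
  sumFin zero    f = 0#
  sumFin (suc n) f = f Fin.zero + sumFin n (λ i → f (Fin.suc i))
    where import Data.Fin as Fin

  sumList : List Carrier → Carrier
  sumList = L.foldr _+_ 0#

  sumGen : (Gen m → Carrier) → Carrier
  sumGen f = sumFin m λ a → sumFin m λ b → sumFin m λ c' → f (a , b , c')

  sumT3 : (T3 m → Carrier) → Carrier
  sumT3 f = sumGen λ g → sumGen λ h → f (L g h) + f (R g h)

  -- vectors of F(E)(3) (resp. F(E^∨)(3)) in the (dual) basis T3 m
  V3 : Set c
  V3 = T3 m → Carrier

  -- R = kernel of F(E)(3) → NC M(3)
  InR : V3 → Set ℓ
  InR r = ∀ (k : Clique3 m) →
    sumT3 (λ q → if ⌊ compose3 _⋆_ e q ≟C k ⌋ then r q else 0#) ≈ 0#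

  -- the pairing F(E^∨)(3) ⊗ F(E)(3) → K, with the sign on ∘₂
  pair : V3 → V3 → Carrier
  pair r w = sumGen λ g → sumGen λ h →
    (r (L g h) * w (L g h)) - (r (R g h) * w (R g h))

  InRperp : V3 → Set (c ⊔ ℓ)
  InRperp w = ∀ r → InR r → pair r w ≈ 0#

  -- vectors of the free operad F(E^∨), as functions on the tree basis
  Vect : Set c
  Vect = Tree m → Carrier

  δ : Tree m → Vect
  δ T T' = if ⌊ T ≟T T' ⌋ then 1# else 0#

  -- generators of the operadic ideal (R^⊥) in arity n:
  -- an element w ∈ R^⊥ inserted in a context, with subtrees on its leaves
  record IdealGen (n : ℕ) : Set (c ⊔ ℓ) where
    field
      ctx   : Ctx m
      a b d : Tree m
      w     : V3
      perp  : InRperp w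
      arity : ∀ q → leaves (fill ctx (inst q a b d)) ≡ n

    vec : Vect
    vec T = sumT3 λ q → w q * δ (fill ctx (inst q a b d)) T

  InIdeal : ℕ → Vect → Set (c ⊔ ℓ)
  InIdeal n x = Σ (List (Carrier × IdealGen n)) λ gs →
    ∀ T → x T ≈ sumList (map (λ p → proj₁ p * IdealGen.vec (proj₂ p) T) gs)

  comb : ∀ {k} → (Fin k → Carrier) → (Fin k → Vect) → Vect
  comb {k} κ v T = sumFin k λ i → κ i * v i T

  -- dim NC M^!(n) = k : the quotient F(E^∨)(n) / (R^⊥)(n) has a basis of
  -- k elements (classes of vectors v i of F(E^∨)(n)).
  IsDim : ℕ → ℕ → Set (c ⊔ ℓ)
  IsDim n k = Σ (Fin k → Vect) λ v →
      (∀ i T → ¬ (leaves T ≡ n) → v i T ≈ 0#)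
    × (∀ (κ : Fin k → Carrier) → InIdeal n (comb κ v) → ∀ i → κ i ≈ 0#)
    × (∀ T → leaves T ≡ n → Σ (Fin k → Carrier) λ κ →
         InIdeal n (λ T' → δ T T' - comb κ v T'))

-- The Hilbert series identity, coefficientwise in ℤ.
-- H(t) = Σ_{n ≥ 1} d n t^n.

module Hilbert (m : ℕ) (d : ℕ → ℕ) where
  open Int using (_+_; _-_; _*_)

  H : ℕ → ℤ
  H zero    = + 0
  H (suc n) = + d (suc n)

  mz : ℤ
  mz = + m

  tc : ℕ → ℤ
  tc 1 = + 1
  tc 2 = mz - + 1
  tc _ = + 0

  tH : ℕ → ℤ
  tH zero    = + 0
  tH (suc n) = H n

  H² : ℕ → ℤ
  H² n = L.foldr _+_ (+ 0) (map (λ i → H i * H (n ℕ.∸ i)) (upTo (suc n)))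

  coeff : ℕ → ℤ
  coeff n = tc n
          + ((+ 2 * mz * mz - + 3 * mz + + 2) * tH n - H n)
          + (mz * mz * mz - + 2 * mz * mz + + 2 * mz - + 1) * H² n

  HilbertEq : Set
  HilbertEq = ∀ n → coeff n ≡ + 0

{-# OPTIONS --safe #-}
module Submission where

open import Defs
open import Data.Nat as ℕ using (ℕ; zero; suc; _≤_)
open import Data.Fin using (Fin; toℕ)
open import Data.Product using (Σ; _×_; _,_)
open import Relation.Binary.PropositionalEquality as ≡ using (_≡_)
open import Relation.Nullary using (¬_)
open import Function using (_∘_)
open import Algebra.Core using (Op₂)
open import Algebra.Structures using (IsUnitalMagma)

-- NC𝓜^! is the free operad on the triangles modulo the ideal generated by R^⊥, and R^⊥ is spanned
-- by the signed indicators of the fibres of the composition map (p , q) ↦ p ∘ᵢ q.  In each fibre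
-- take as leading term the left comb whose inner triangle has base label 1, or the right comb
-- whose inner base is 1 while the outer edge is not.  Rewriting leading terms modulo the ideal
-- terminates (the left weight or the number of unit-rooted children drops), so the normal trees,
-- those without such patterns, span.  They are also independent: a normal tree is determined by
-- its root label and its forest of solid subtrees, and the functional reading off that forest is
-- compatible with grafting, kills every fibre relation, and is unitriangular on normal trees with
-- respect to the number of solid subtrees.  Counting normal trees by their root label gives
-- a(n) = Σ m (m ℓᵢ ℓⱼ + ℓᵢ aⱼ) over i + j = n, with ℓ = [n = 1] + (m − 1) a and dimension ℓ + a;
-- in series form H − t = (t + (m − 1) H) ((m − 1) t + (m² − m + 1) H), which is the stated identity.

module Trees where
  open import Data.Nat using (ℕ; _+_; _≤_; s≤s; z≤n)
  open import Data.Fin using (Fin)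
  open import Data.List using (List; []; _∷_)
  import Data.List.Properties as List
  import Data.Fin as Fin
  open import Data.Maybe using (Maybe; just; nothing)
  import Data.Nat.Properties as ℕP
  open import Data.Product using (_×_; _,_; proj₁; proj₂)
  open import Data.Product.Properties using (≡-dec)
  open import Relation.Nullary using (yes; no)
  import Relation.Nullary.Decidable as Dec
  open import Relation.Binary using (DecidableEquality)

  module _ {m : ℕ} where

    _≟T3_ : DecidableEquality (T3 m)
    L g h ≟T3 L g′ h′ = Dec.map′ (λ { ≡.refl → ≡.refl }) (λ { ≡.refl → ≡.refl }) (≡-dec _≟G_ _≟G_ (g , h) (g′ , h′))
    R g h ≟T3 R g′ h′ = Dec.map′ (λ { ≡.refl → ≡.refl }) (λ { ≡.refl → ≡.refl }) (≡-dec _≟G_ _≟G_ (g , h) (g′ , h′))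
    L _ _ ≟T3 R _ _   = no λ ()
    R _ _ ≟T3 L _ _   = no λ ()

    leaves≥1 : (T : Tree m) → 1 ≤ leaves T
    leaves≥1 leaf         = s≤s z≤n
    leaves≥1 (node g l r) = ℕP.≤-trans (leaves≥1 l) (ℕP.m≤m+n _ _)

    leaves-inst : ∀ q q′ (a b d : Tree m) → leaves (inst q a b d) ≡ leaves (inst q′ a b d)
    leaves-inst q q′ a b d = ≡.trans (sum-of-three q) (≡.sym (sum-of-three q′))
      where
      sum-of-three : ∀ q → leaves (inst q a b d) ≡ leaves a + (leaves b + leaves d)
      sum-of-three (L g h) = ℕP.+-assoc (leaves a) _ _
      sum-of-three (R g h) = ≡.refl

    leaves-fill : ∀ C {X Y : Tree m} → leaves X ≡ leaves Y → leaves (fill C X) ≡ leaves (fill C Y)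
    leaves-fill hole        eq = eq
    leaves-fill (inL g C r) eq = ≡.cong (_+ leaves r) (leaves-fill C eq)
    leaves-fill (inR g l C) eq = ≡.cong (leaves l +_) (leaves-fill C eq)

    rootLabel : Tree m → Maybe (Fin m)
    rootLabel leaf                   = nothing
    rootLabel (node (r , _ , _) _ _) = just r

  -- A normal tree hanging from an edge labelled p, seen from its parent: leafS p is a leaf,
  -- nodeS p r F a node with root label r ≠ e whose children, with unit-rooted right children
  -- flattened into their parent, form the forest F.
  data Schema (m : ℕ) : Set where
    leafS : Fin m → Schema m
    nodeS : Fin m → Fin m → List (Schema m) → Schema m

  Forest : ℕ → Set
  Forest m = List (Schema m)

  module _ {m : ℕ} where

    private
      leafS-injective : ∀ {a b : Fin m} → leafS a ≡ leafS b → a ≡ b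
      leafS-injective ≡.refl = ≡.refl

      nodeS-injective : ∀ {a b a′ b′ : Fin m} {G G′} → nodeS a b G ≡ nodeS a′ b′ G′ → a ≡ a′ × b ≡ b′ × G ≡ G′
      nodeS-injective ≡.refl = ≡.refl , ≡.refl , ≡.refl

    infix 4 _≟S_ _≟F_

    mutual
      _≟S_ : DecidableEquality (Schema m)
      leafS a ≟S leafS b = Dec.map′ (≡.cong leafS) leafS-injective (a Fin.≟ b)
      leafS _ ≟S nodeS _ _ _ = no λ ()
      nodeS _ _ _ ≟S leafS _ = no λ ()
      nodeS a b G ≟S nodeS a′ b′ G′ with a Fin.≟ a′ | b Fin.≟ b′ | G ≟F G′
      ... | yes ≡.refl | yes ≡.refl | yes ≡.refl = yes ≡.refl
      ... | no a≢a′ | _ | _ = no λ eq → a≢a′ (proj₁ (nodeS-injective eq))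
      ... | yes _ | no b≢b′ | _ = no λ eq → b≢b′ (proj₁ (proj₂ (nodeS-injective eq)))
      ... | yes _ | yes _ | no G≢G′ = no λ eq → G≢G′ (proj₂ (proj₂ (nodeS-injective eq)))

      _≟F_ : DecidableEquality (Forest m)
      [] ≟F [] = yes ≡.refl
      [] ≟F (_ ∷ _) = no λ ()
      (_ ∷ _) ≟F [] = no λ ()
      (x ∷ xs) ≟F (y ∷ ys) with x ≟S y | xs ≟F ys
      ... | yes ≡.refl | yes ≡.refl = yes ≡.refl
      ... | no x≢y | _ = no λ eq → x≢y (List.∷-injectiveˡ eq)
      ... | yes _ | no xs≢ys = no λ eq → xs≢ys (List.∷-injectiveʳ eq)

module FiniteSets where
  open import Data.Nat using (ℕ; zero; suc; _+_; _*_)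
  import Data.Nat.Properties as ℕP
  open import Data.Fin using (Fin)
  import Data.Fin as Fin
  import Data.Fin.Properties as FinP
  open import Data.Empty using (⊥)
  open import Data.Unit using (⊤)
  open import Data.Sum using (_⊎_; inj₁; inj₂)
  open import Function.Bundles using (_↔_; mk↔ₛ′; Inverse)
  open import Function.Properties.Inverse using (↔-trans)
  open import Function.Construct.Identity using (↔-id)
  open import Data.Sum.Function.Propositional using (_⊎-↔_)
  open import Data.Product.Function.NonDependent.Propositional using (_×-↔_)
  open import Data.Product.Function.Dependent.Propositional using (Σ-↔)
  open import Relation.Binary.PropositionalEquality using (refl)
  open import Algebra.Properties.Semiring.Sum ℕP.+-*-semiring public using (sum)

  record FiniteSet : Set₁ where
    field
      El    : Set
      size  : ℕ
      index : Fin size ↔ El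
  open FiniteSet public

  ∅ : FiniteSet
  ∅ = record { El = ⊥ ; size = 0 ; index = FinP.0↔⊥ }

  point : FiniteSet
  point = record { El = ⊤ ; size = 1 ; index = FinP.1↔⊤ }

  finite : ℕ → FiniteSet
  finite k = record { El = Fin k ; size = k ; index = ↔-id _ }

  _⊎ˢ_ : FiniteSet → FiniteSet → FiniteSet
  A ⊎ˢ B = record { El = El A ⊎ El B ; size = size A + size B ; index = ↔-trans FinP.+↔⊎ (index A ⊎-↔ index B) }

  _×ˢ_ : FiniteSet → FiniteSet → FiniteSet
  A ×ˢ B = record { El = El A × El B ; size = size A * size B ; index = ↔-trans FinP.*↔× (index A ×-↔ index B) }

  private
    Σ-suc↔ : ∀ {k} (B : Fin (suc k) → Set) → (B Fin.zero ⊎ Σ (Fin k) (λ i → B (Fin.suc i))) ↔ Σ (Fin (suc k)) B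
    Σ-suc↔ B = mk↔ₛ′ to from to∘from from∘to
      where
      to : _ → _
      to (inj₁ x)       = Fin.zero , x
      to (inj₂ (i , x)) = Fin.suc i , x
      from : _ → _
      from (Fin.zero , x)  = inj₁ x
      from (Fin.suc i , x) = inj₂ (i , x)
      to∘from : ∀ p → to (from p) Relation.Binary.PropositionalEquality.≡ p
      to∘from (Fin.zero , x)  = refl
      to∘from (Fin.suc i , x) = refl
      from∘to : ∀ u → from (to u) Relation.Binary.PropositionalEquality.≡ u
      from∘to (inj₁ x) = refl
      from∘to (inj₂ y) = refl

    Fin-sum↔ : ∀ k (s : Fin k → ℕ) → Fin (sum s) ↔ Σ (Fin k) (λ i → Fin (s i))
    Fin-sum↔ zero    s = mk↔ₛ′ (λ ()) (λ ()) (λ ()) (λ ())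
    Fin-sum↔ (suc k) s = ↔-trans FinP.+↔⊎ (↔-trans (↔-id _ ⊎-↔ Fin-sum↔ k (λ i → s (Fin.suc i))) (Σ-suc↔ (λ i → Fin (s i))))

  Σˢ : (k : ℕ) → (Fin k → FiniteSet) → FiniteSet
  Σˢ k B = record
    { El    = Σ (Fin k) (λ i → El (B i))
    ; size  = sum (λ i → size (B i))
    ; index = ↔-trans (Fin-sum↔ k (λ i → size (B i))) (Σ-↔ (↔-id _) (index (B _)))
    }

module Codes (m′ : ℕ) where
  open import Data.Nat using (ℕ)

  open import Data.Nat using (zero; suc; _∸_)
  open import Data.Fin using (toℕ)
  open FiniteSets

  private
    m = suc m′

  leafSet : ℕ → FiniteSet
  leafSet 1 = point
  leafSet _ = ∅

  -- Codes of the normal trees with n leaves: Rooted for those with a prescribed root label, NonUnit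
  -- for the leaf and the trees whose root label is one of the m′ labels ≠ e.
  mutual
    Rooted : (fuel n : ℕ) → FiniteSet
    Rooted zero       n = ∅
    Rooted (suc fuel) n = Σˢ (suc n) λ i → finite m ×ˢ
      ((finite m ×ˢ (NonUnit fuel (toℕ i) ×ˢ NonUnit fuel (n ∸ toℕ i))) ⊎ˢ (NonUnit fuel (toℕ i) ×ˢ Rooted fuel (n ∸ toℕ i)))

    NonUnit : (fuel n : ℕ) → FiniteSet
    NonUnit fuel n = leafSet n ⊎ˢ (finite m′ ×ˢ Rooted fuel n)

  Normals : ℕ → FiniteSet
  Normals n = NonUnit n n ⊎ˢ Rooted n n

module Linear {c ℓ} (K : CharZeroField c ℓ) {m : ℕ} (_⋆_ : Op₂ (Fin m)) (e : Fin m) where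
  open import Data.Nat using (ℕ; zero; suc)
  open import Data.Fin using (Fin)

  open import Level using (_⊔_)
  import Data.Fin as Fin
  open import Data.Fin using (_≟_)
  import Data.Fin.Properties as FinP
  open import Data.Bool using (if_then_else_)
  open import Data.List using (List; []; _∷_; _++_; map)
  open import Data.Product using (_×_; _,_; proj₁; proj₂)
  open import Relation.Nullary using (¬_; Dec; yes; no; contradiction)
  open import Relation.Nullary.Decidable using (⌊_⌋)
  open import Relation.Binary using (DecidableEquality)
  open import Data.Product.Properties using (≡-dec)
  open import Algebra.Bundles using (CommutativeRing)
  open Trees

  open CharZeroField K using (cring)
  open CommutativeRing cring public
  open Koszul K _⋆_ e public
  open import Algebra.Properties.Ring ring public
    using (-‿distribˡ-*; -‿distribʳ-*; -‿involutive; -0#≈0#; -‿+-comm; -1*x≈-x; x[y-z]≈xy-xz; [y-z]x≈yx-zx)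
  open import Algebra.Properties.CommutativeSemigroup *-commutativeSemigroup public
    using () renaming (x∙yz≈y∙xz to *-exchange)
  open import Algebra.Properties.CommutativeSemigroup +-commutativeSemigroup public
    using () renaming (interchange to +-interchange)
  open import Algebra.Properties.Semiring.Sum semiring
    using (sum; sum-cong-≋; ∑-distrib-+; *-distribˡ-sum)
  open import Relation.Binary.Reasoning.Setoid setoid public

  ≡⇒≈ : ∀ {x y} → x ≡ y → x ≈ y
  ≡⇒≈ ≡.refl = refl

  𝟙 : ∀ {a} {A : Set a} → Dec A → Carrier
  𝟙 d = if ⌊ d ⌋ then 1# else 0#

  module _ {a} {A : Set a} where

    𝟙-yes : (d : Dec A) → A → 𝟙 d ≈ 1#
    𝟙-yes (yes _) _ = refl
    𝟙-yes (no ¬x) x = contradiction x ¬x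

    𝟙-no : (d : Dec A) → ¬ A → 𝟙 d ≈ 0#
    𝟙-no (yes x) ¬x = contradiction x ¬x
    𝟙-no (no _)  _  = refl

    𝟙-cong : ∀ {b} {B : Set b} (d : Dec A) (d′ : Dec B) → (A → B) → (B → A) → 𝟙 d ≈ 𝟙 d′
    𝟙-cong d d′ f g with d′
    ... | yes y = 𝟙-yes d (g y)
    ... | no ¬y = 𝟙-no d (λ x → ¬y (f x))

  𝟙-sym : ∀ {a} {A : Set a} (_≟_ : DecidableEquality A) x y → 𝟙 (x ≟ y) ≈ 𝟙 (y ≟ x)
  𝟙-sym _≟_ x y = 𝟙-cong (x ≟ y) (y ≟ x) ≡.sym ≡.sym

  𝟙-pair : ∀ {a b} {A : Set a} {B : Set b} {x x′ : A} {y y′ : B} (d : Dec ((x , y) ≡ (x′ , y′)))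
           (d₁ : Dec (x ≡ x′)) (d₂ : Dec (y ≡ y′)) → 𝟙 d ≈ 𝟙 d₁ * 𝟙 d₂
  𝟙-pair d (yes ≡.refl) (yes ≡.refl) = trans (𝟙-yes d ≡.refl) (sym (*-identityˡ 1#))
  𝟙-pair d (yes _)      (no y≢y′)    = trans (𝟙-no d (λ eq → y≢y′ (≡.cong proj₂ eq))) (sym (zeroʳ _))
  𝟙-pair d (no x≢x′)    _            = trans (𝟙-no d (λ eq → x≢x′ (≡.cong proj₁ eq))) (sym (zeroˡ _))

  if-then-0 : ∀ {a} {A : Set a} (d : Dec A) x → (if ⌊ d ⌋ then x else 0#) ≈ 𝟙 d * x
  if-then-0 (yes _) x = sym (*-identityˡ x)
  if-then-0 (no _)  x = sym (zeroˡ x)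

  record IsLinear {A : Set} (S : (A → Carrier) → Carrier) : Set (c ⊔ ℓ) where
    field
      cong  : ∀ {f g} → (∀ x → f x ≈ g x) → S f ≈ S g
      +-hom : ∀ f g → S (λ x → f x + g x) ≈ S f + S g
      *-hom : ∀ a f → S (λ x → a * f x) ≈ a * S f

    zero-hom : ∀ {f} → (∀ x → f x ≈ 0#) → S f ≈ 0#
    zero-hom {f} f≈0 = begin
      S f                  ≈⟨ cong (λ x → trans (f≈0 x) (sym (zeroˡ 0#))) ⟩
      S (λ x → 0# * 0#)    ≈⟨ *-hom 0# (λ _ → 0#) ⟩
      0# * S (λ _ → 0#)    ≈⟨ zeroˡ _ ⟩
      0#                   ∎

    *ʳ-hom : ∀ a f → S (λ x → f x * a) ≈ S f * a
    *ʳ-hom a f = trans (cong (λ x → *-comm (f x) a)) (trans (*-hom a f) (*-comm a (S f)))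

    -‿hom : ∀ f → S (λ x → - f x) ≈ - S f
    -‿hom f = trans (cong (λ x → sym (-1*x≈-x (f x)))) (trans (*-hom (- 1#) f) (-1*x≈-x (S f)))

    sub-hom : ∀ f g → S (λ x → f x - g x) ≈ S f - S g
    sub-hom f g = trans (+-hom f (λ x → - g x)) (+-congˡ (-‿hom g))
  open IsLinear public

  eval-linear : ∀ {A : Set} (x : A) → IsLinear (λ f → f x)
  eval-linear x = record { cong = λ f≈g → f≈g x ; +-hom = λ _ _ → refl ; *-hom = λ _ _ → refl }

  +-linear : ∀ {A : Set} {S S′ : (A → Carrier) → Carrier} → IsLinear S → IsLinear S′ → IsLinear (λ f → S f + S′ f)
  +-linear S S′ = record
    { cong  = λ f≈g → +-cong (cong S f≈g) (cong S′ f≈g)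
    ; +-hom = λ f g → trans (+-cong (+-hom S f g) (+-hom S′ f g)) (+-interchange _ _ _ _)
    ; *-hom = λ a f → trans (+-cong (*-hom S a f) (*-hom S′ a f)) (sym (distribˡ a _ _))
    }

  ∘-linear : ∀ {A B : Set} {S : (A → Carrier) → Carrier} {T : A → (B → Carrier) → Carrier} →
             IsLinear S → (∀ x → IsLinear (T x)) → IsLinear (λ f → S (λ x → T x f))
  ∘-linear S T = record
    { cong  = λ f≈g → cong S (λ x → cong (T x) f≈g)
    ; +-hom = λ f g → trans (cong S (λ x → +-hom (T x) f g)) (+-hom S _ _)
    ; *-hom = λ a f → trans (cong S (λ x → *-hom (T x) a f)) (*-hom S a _)
    }

  precomp-linear : ∀ {A B : Set} {S : (A → Carrier) → Carrier} → IsLinear S → (h : A → B) →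
                   IsLinear (λ (f : B → Carrier) → S (λ x → f (h x)))
  precomp-linear S h = record
    { cong = λ f≈g → cong S (λ x → f≈g (h x)) ; +-hom = λ f g → +-hom S _ _ ; *-hom = λ a f → *-hom S a _ }

  scale-linear : ∀ {A : Set} {S : (A → Carrier) → Carrier} → IsLinear S → (w : A → Carrier) → IsLinear (λ f → S (λ x → w x * f x))
  scale-linear S w = record
    { cong  = λ f≈g → cong S (λ x → *-congˡ (f≈g x))
    ; +-hom = λ f g → trans (cong S (λ x → distribˡ (w x) _ _)) (+-hom S _ _)
    ; *-hom = λ a f → trans (cong S (λ x → *-exchange (w x) a (f x))) (*-hom S a _)
    }

  sumFin≡sum : ∀ n f → sumFin n f ≡ sum f
  sumFin≡sum zero    f = ≡.refl
  sumFin≡sum (suc n) f = ≡.cong (f Fin.zero +_) (sumFin≡sum n (λ i → f (Fin.suc i)))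

  sumFin-linear : ∀ n → IsLinear (sumFin n)
  sumFin-linear n = record { cong = cong′ ; +-hom = +-hom′ ; *-hom = *-hom′ }
    where
    cong′ : ∀ {f g} → (∀ i → f i ≈ g i) → sumFin n f ≈ sumFin n g
    cong′ {f} {g} f≈g rewrite sumFin≡sum n f | sumFin≡sum n g = sum-cong-≋ f≈g
    +-hom′ : ∀ f g → sumFin n (λ i → f i + g i) ≈ sumFin n f + sumFin n g
    +-hom′ f g rewrite sumFin≡sum n (λ i → f i + g i) | sumFin≡sum n f | sumFin≡sum n g = ∑-distrib-+ f g
    *-hom′ : ∀ a f → sumFin n (λ i → a * f i) ≈ a * sumFin n f
    *-hom′ a f rewrite sumFin≡sum n (λ i → a * f i) | sumFin≡sum n f = sym (*-distribˡ-sum a f)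

  sumGen-linear : IsLinear sumGen
  sumGen-linear = ∘-linear (sumFin-linear m) λ a → ∘-linear (sumFin-linear m) λ b →
                  precomp-linear (sumFin-linear m) (λ c′ → a , b , c′)

  sumT3-linear : IsLinear sumT3
  sumT3-linear = ∘-linear sumGen-linear λ g → ∘-linear sumGen-linear λ h →
                 +-linear (eval-linear (L g h)) (eval-linear (R g h))

  sumFin-commute : ∀ {A : Set} {T : (A → Carrier) → Carrier} → IsLinear T →
                   ∀ n (f : Fin n → A → Carrier) → T (λ y → sumFin n (λ i → f i y)) ≈ sumFin n (λ i → T (f i))
  sumFin-commute T zero    f = zero-hom T (λ _ → refl)
  sumFin-commute T (suc n) f = trans (+-hom T _ _) (+-congˡ (sumFin-commute T n (λ i → f (Fin.suc i))))

  sumGen-commute : ∀ {A : Set} {T : (A → Carrier) → Carrier} → IsLinear T →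
                   ∀ (f : Gen m → A → Carrier) → T (λ y → sumGen (λ g → f g y)) ≈ sumGen (λ g → T (f g))
  sumGen-commute T f =
    trans (sumFin-commute T m _) (cong (sumFin-linear m) λ a →
    trans (sumFin-commute T m _) (cong (sumFin-linear m) λ b → sumFin-commute T m _))

  sumT3-commute : ∀ {A : Set} {T : (A → Carrier) → Carrier} → IsLinear T →
                  ∀ (f : T3 m → A → Carrier) → T (λ y → sumT3 (λ q → f q y)) ≈ sumT3 (λ q → T (f q))
  sumT3-commute T f =
    trans (sumGen-commute T _) (cong sumGen-linear λ g →
    trans (sumGen-commute T _) (cong sumGen-linear λ h → +-hom T _ _))

  sumFin-δ : ∀ n (a : Fin n) (f : Fin n → Carrier) → sumFin n (λ i → 𝟙 (i ≟ a) * f i) ≈ f a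
  sumFin-δ (suc n) Fin.zero f = begin
    1# * f Fin.zero + sumFin n (λ i → 0# * f (Fin.suc i)) ≈⟨ +-cong (*-identityˡ _) (zero-hom (sumFin-linear n) (λ _ → zeroˡ _)) ⟩
    f Fin.zero + 0#                                       ≈⟨ +-identityʳ _ ⟩
    f Fin.zero                                            ∎
  sumFin-δ (suc n) (Fin.suc a) f = begin
    0# * f Fin.zero + sumFin n (λ i → 𝟙 (Fin.suc i ≟ Fin.suc a) * f (Fin.suc i))
      ≈⟨ +-cong (zeroˡ _) (cong (sumFin-linear n) λ i → *-congʳ (𝟙-cong (Fin.suc i ≟ Fin.suc a) (i ≟ a) FinP.suc-injective (≡.cong Fin.suc))) ⟩
    0# + sumFin n (λ i → 𝟙 (i ≟ a) * f (Fin.suc i))  ≈⟨ +-identityˡ _ ⟩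
    sumFin n (λ i → 𝟙 (i ≟ a) * f (Fin.suc i))       ≈⟨ sumFin-δ n a (λ i → f (Fin.suc i)) ⟩
    f (Fin.suc a)                                          ∎

  sumGen-δ : ∀ g₀ (f : Gen m → Carrier) → sumGen (λ g → 𝟙 (g ≟G g₀) * f g) ≈ f g₀
  sumGen-δ (a₀ , b₀ , c₀) f = begin
    sumGen (λ g → 𝟙 (g ≟G (a₀ , b₀ , c₀)) * f g)
      ≈⟨ cong sumGen-linear (λ (a , b , c′) → trans (*-congʳ (𝟙-gen a b c′)) (trans (*-assoc _ _ _) (*-congˡ (*-assoc _ _ _)))) ⟩
    sumFin m (λ a → sumFin m (λ b → sumFin m (λ c′ → 𝟙 (a ≟ a₀) * (𝟙 (b ≟ b₀) * (𝟙 (c′ ≟ c₀) * f (a , b , c′))))))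
      ≈⟨ cong (sumFin-linear m) (λ a → *-hom sumFin²-linear _ (λ (b , c′) → 𝟙 (b ≟ b₀) * (𝟙 (c′ ≟ c₀) * f (a , b , c′)))) ⟩
    sumFin m (λ a → 𝟙 (a ≟ a₀) * sumFin m (λ b → sumFin m (λ c′ → 𝟙 (b ≟ b₀) * (𝟙 (c′ ≟ c₀) * f (a , b , c′)))))
      ≈⟨ sumFin-δ m a₀ _ ⟩
    sumFin m (λ b → sumFin m (λ c′ → 𝟙 (b ≟ b₀) * (𝟙 (c′ ≟ c₀) * f (a₀ , b , c′))))
      ≈⟨ cong (sumFin-linear m) (λ b → *-hom (sumFin-linear m) _ _) ⟩
    sumFin m (λ b → 𝟙 (b ≟ b₀) * sumFin m (λ c′ → 𝟙 (c′ ≟ c₀) * f (a₀ , b , c′)))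
      ≈⟨ sumFin-δ m b₀ _ ⟩
    sumFin m (λ c′ → 𝟙 (c′ ≟ c₀) * f (a₀ , b₀ , c′))
      ≈⟨ sumFin-δ m c₀ _ ⟩
    f (a₀ , b₀ , c₀) ∎
    where
    𝟙-gen : ∀ a b c′ → 𝟙 ((a , b , c′) ≟G (a₀ , b₀ , c₀)) ≈ 𝟙 (a ≟ a₀) * (𝟙 (b ≟ b₀) * 𝟙 (c′ ≟ c₀))
    𝟙-gen a b c′ = trans (𝟙-pair ((a , b , c′) ≟G (a₀ , b₀ , c₀)) (a ≟ a₀) ((b , c′) ≟P (b₀ , c₀)))
                         (*-congˡ (𝟙-pair ((b , c′) ≟P (b₀ , c₀)) (b ≟ b₀) (c′ ≟ c₀)))
      where _≟P_ = ≡-dec _≟_ _≟_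
    sumFin²-linear : IsLinear (λ (F : Fin m × Fin m → Carrier) → sumFin m (λ b → sumFin m (λ c′ → F (b , c′))))
    sumFin²-linear = ∘-linear (sumFin-linear m) λ b → precomp-linear (sumFin-linear m) (b ,_)

  sumGen²-δ : ∀ g₀ h₀ (F : Gen m → Gen m → Carrier) →
              sumGen (λ g → sumGen (λ h → (𝟙 (g ≟G g₀) * 𝟙 (h ≟G h₀)) * F g h)) ≈ F g₀ h₀
  sumGen²-δ g₀ h₀ F = begin
    sumGen (λ g → sumGen (λ h → (𝟙 (g ≟G g₀) * 𝟙 (h ≟G h₀)) * F g h))
      ≈⟨ cong sumGen-linear (λ g → trans (cong sumGen-linear λ h → *-assoc _ _ _) (*-hom sumGen-linear _ _)) ⟩
    sumGen (λ g → 𝟙 (g ≟G g₀) * sumGen (λ h → 𝟙 (h ≟G h₀) * F g h))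
      ≈⟨ trans (sumGen-δ g₀ _) (sumGen-δ h₀ _) ⟩
    F g₀ h₀ ∎

  𝟙-L : ∀ (g h g′ h′ : Gen m) → 𝟙 (L g h ≟T3 L g′ h′) ≈ 𝟙 (g ≟G g′) * 𝟙 (h ≟G h′)
  𝟙-L g h g′ h′ = trans (𝟙-cong (L g h ≟T3 L g′ h′) d (λ { ≡.refl → ≡.refl }) (λ { ≡.refl → ≡.refl })) (𝟙-pair d (g ≟G g′) (h ≟G h′))
    where d = ≡-dec _≟G_ _≟G_ (g , h) (g′ , h′)

  𝟙-R : ∀ (g h g′ h′ : Gen m) → 𝟙 (R g h ≟T3 R g′ h′) ≈ 𝟙 (g ≟G g′) * 𝟙 (h ≟G h′)
  𝟙-R g h g′ h′ = trans (𝟙-cong (R g h ≟T3 R g′ h′) d (λ { ≡.refl → ≡.refl }) (λ { ≡.refl → ≡.refl })) (𝟙-pair d (g ≟G g′) (h ≟G h′))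
    where d = ≡-dec _≟G_ _≟G_ (g , h) (g′ , h′)

  sumGen²-linear : IsLinear (λ (F : Gen m × Gen m → Carrier) → sumGen (λ g → sumGen (λ h → F (g , h))))
  sumGen²-linear = ∘-linear sumGen-linear λ g → precomp-linear sumGen-linear (g ,_)

  sumT3-split : ∀ f → sumT3 f ≈ sumGen (λ g → sumGen (λ h → f (L g h))) + sumGen (λ g → sumGen (λ h → f (R g h)))
  sumT3-split f = +-hom sumGen²-linear (λ (g , h) → f (L g h)) (λ (g , h) → f (R g h))

  sumT3-δ : ∀ q₀ (f : T3 m → Carrier) → sumT3 (λ q → 𝟙 (q ≟T3 q₀) * f q) ≈ f q₀
  sumT3-δ (L g₀ h₀) f = begin
    sumT3 (λ q → 𝟙 (q ≟T3 L g₀ h₀) * f q)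
      ≈⟨ sumT3-split (λ q → 𝟙 (q ≟T3 L g₀ h₀) * f q) ⟩
    sumGen (λ g → sumGen (λ h → 𝟙 (L g h ≟T3 L g₀ h₀) * f (L g h))) + sumGen (λ g → sumGen (λ h → 0# * f (R g h)))
      ≈⟨ +-cong (cong sumGen-linear λ g → cong sumGen-linear λ h → *-congʳ (𝟙-L g h g₀ h₀))
                (zero-hom sumGen²-linear (λ _ → zeroˡ _)) ⟩
    sumGen (λ g → sumGen (λ h → (𝟙 (g ≟G g₀) * 𝟙 (h ≟G h₀)) * f (L g h))) + 0#
      ≈⟨ trans (+-identityʳ _) (sumGen²-δ g₀ h₀ (λ g h → f (L g h))) ⟩
    f (L g₀ h₀) ∎
  sumT3-δ (R g₀ h₀) f = begin
    sumT3 (λ q → 𝟙 (q ≟T3 R g₀ h₀) * f q)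
      ≈⟨ sumT3-split (λ q → 𝟙 (q ≟T3 R g₀ h₀) * f q) ⟩
    sumGen (λ g → sumGen (λ h → 0# * f (L g h))) + sumGen (λ g → sumGen (λ h → 𝟙 (R g h ≟T3 R g₀ h₀) * f (R g h)))
      ≈⟨ +-cong (zero-hom sumGen²-linear (λ _ → zeroˡ _))
                (cong sumGen-linear λ g → cong sumGen-linear λ h → *-congʳ (𝟙-R g h g₀ h₀)) ⟩
    0# + sumGen (λ g → sumGen (λ h → (𝟙 (g ≟G g₀) * 𝟙 (h ≟G h₀)) * f (R g h)))
      ≈⟨ trans (+-identityˡ _) (sumGen²-δ g₀ h₀ (λ g h → f (R g h))) ⟩
    f (R g₀ h₀) ∎

  comb-linear : ∀ {k} (v : Fin k → Vect) T → IsLinear (λ κ → comb κ v T)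
  comb-linear {k} v T = record
    { cong  = λ κ≈κ′ → cong (sumFin-linear k) (λ i → *-congʳ (κ≈κ′ i))
    ; +-hom = λ κ κ′ → trans (cong (sumFin-linear k) (λ i → distribʳ _ _ _)) (+-hom (sumFin-linear k) _ _)
    ; *-hom = λ a κ → trans (cong (sumFin-linear k) (λ i → *-assoc _ _ _)) (*-hom (sumFin-linear k) a _)
    }

  module _ {n : ℕ} where

    ⟦_⟧ : List (Carrier × IdealGen n) → Vect
    ⟦ gs ⟧ T = sumList (map (λ (κ , G) → κ * IdealGen.vec G T) gs)

    ⟦⟧-++ : ∀ gs hs T → ⟦ gs ++ hs ⟧ T ≈ ⟦ gs ⟧ T + ⟦ hs ⟧ T
    ⟦⟧-++ []       hs T = sym (+-identityˡ _)
    ⟦⟧-++ (g ∷ gs) hs T = trans (+-congˡ (⟦⟧-++ gs hs T)) (sym (+-assoc _ _ _))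

    scale : Carrier → List (Carrier × IdealGen n) → List (Carrier × IdealGen n)
    scale a = map (λ (κ , G) → a * κ , G)

    ⟦⟧-scale : ∀ a gs T → ⟦ scale a gs ⟧ T ≈ a * ⟦ gs ⟧ T
    ⟦⟧-scale a []       T = sym (zeroʳ a)
    ⟦⟧-scale a (g ∷ gs) T = trans (+-cong (*-assoc _ _ _) (⟦⟧-scale a gs T)) (sym (distribˡ a _ _))

    ideal-resp : ∀ {x y : Vect} → (∀ T → x T ≈ y T) → InIdeal n y → InIdeal n x
    ideal-resp x≈y (gs , y≈gs) = gs , λ T → trans (x≈y T) (y≈gs T)

    ideal-0 : ∀ {x : Vect} → (∀ T → x T ≈ 0#) → InIdeal n x
    ideal-0 x≈0 = [] , x≈0

    ideal-+ : ∀ {x y : Vect} → InIdeal n x → InIdeal n y → InIdeal n (λ T → x T + y T)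
    ideal-+ (gs , x≈gs) (hs , y≈hs) = gs ++ hs , λ T → trans (+-cong (x≈gs T) (y≈hs T)) (sym (⟦⟧-++ gs hs T))

    ideal-* : ∀ {x : Vect} a → InIdeal n x → InIdeal n (λ T → a * x T)
    ideal-* a (gs , x≈gs) = scale a gs , λ T → trans (*-congˡ (x≈gs T)) (sym (⟦⟧-scale a gs T))

    ideal-gen : ∀ G → InIdeal n (IdealGen.vec G)
    ideal-gen G = (1# , G) ∷ [] , λ T → sym (trans (+-identityʳ _) (*-identityˡ _))

    ideal-sumFin : ∀ k (xs : Fin k → Vect) → (∀ i → InIdeal n (xs i)) → InIdeal n (λ T → sumFin k (λ i → xs i T))
    ideal-sumFin zero    xs xs∈I = ideal-0 (λ _ → refl)
    ideal-sumFin (suc k) xs xs∈I = ideal-+ (xs∈I Fin.zero) (ideal-sumFin k (λ i → xs (Fin.suc i)) (λ i → xs∈I (Fin.suc i)))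

    ideal-sumT3 : ∀ (xs : T3 m → Vect) → (∀ q → InIdeal n (xs q)) → InIdeal n (λ T → sumT3 (λ q → xs q T))
    ideal-sumT3 xs xs∈I = sumGen′ _ λ g → sumGen′ _ λ h → ideal-+ (xs∈I (L g h)) (xs∈I (R g h))
      where
      sumGen′ : ∀ (ys : Gen m → Vect) → (∀ g → InIdeal n (ys g)) → InIdeal n (λ T → sumGen (λ g → ys g T))
      sumGen′ ys ys∈I = ideal-sumFin m _ λ a → ideal-sumFin m _ λ b → ideal-sumFin m _ λ c′ → ys∈I (a , b , c′)

    linear-kills-ideal : ∀ {Λ : Vect → Carrier} → IsLinear Λ → (∀ G → Λ (IdealGen.vec G) ≈ 0#) →
                         ∀ {x} → InIdeal n x → Λ x ≈ 0#
    linear-kills-ideal {Λ} Λ-lin Λ-gen (gs , x≈gs) = trans (cong Λ-lin x≈gs) (kills gs)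
      where
      kills : ∀ gs → Λ ⟦ gs ⟧ ≈ 0#
      kills []             = zero-hom Λ-lin (λ _ → refl)
      kills ((κ , G) ∷ gs) = begin
        Λ (λ T → κ * IdealGen.vec G T + ⟦ gs ⟧ T) ≈⟨ +-hom Λ-lin _ _ ⟩
        Λ (λ T → κ * IdealGen.vec G T) + Λ ⟦ gs ⟧  ≈⟨ +-cong (trans (*-hom Λ-lin κ _) (trans (*-congˡ (Λ-gen G)) (zeroʳ κ))) (kills gs) ⟩
        0# + 0#                                    ≈⟨ +-identityʳ 0# ⟩
        0#                                         ∎

module Relations {c ℓ} (K : CharZeroField c ℓ) {m : ℕ} (_⋆_ : Op₂ (Fin m)) (e : Fin m) where
  open import Data.Nat using (ℕ)
  open import Data.Fin using (Fin)

  open import Data.Fin using (_≟_)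
  open import Data.Product using (_×_; _,_)
  open import Data.Product.Properties using (≡-dec)
  open import Relation.Nullary using (yes; no)
  open import Relation.Nullary.Decidable using (⌊_⌋)
  open import Data.Bool using (if_then_else_)
  open Linear K _⋆_ e
  open import Algebra.Solver.CommutativeMonoid *-commutativeMonoid using (solve; _⊕_; _⊜_)

  compose : T3 m → Clique3 m
  compose = compose3 _⋆_ e

  sign : T3 m → Carrier
  sign (L _ _) = 1#
  sign (R _ _) = - 1#

  sign²≈1 : ∀ q → sign q * sign q ≈ 1#
  sign²≈1 (L _ _) = *-identityˡ 1#
  sign²≈1 (R _ _) = trans (sym (-‿distribˡ-* 1# (- 1#))) (trans (-‿cong (*-identityˡ (- 1#))) (-‿involutive 1#))

  fibreSign : Clique3 m → T3 m → Carrier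
  fibreSign k q = 𝟙 (compose q ≟C k) * sign q

  fibreSum : Clique3 m → (T3 m → Carrier) → Carrier
  fibreSum k f = sumT3 (λ q → fibreSign k q * f q)

  fibreSum-linear : ∀ k → IsLinear (fibreSum k)
  fibreSum-linear k = scale-linear sumT3-linear (fibreSign k)

  fibreSum-cong : ∀ k {f g} → (∀ q → compose q ≡ k → f q ≈ g q) → fibreSum k f ≈ fibreSum k g
  fibreSum-cong k {f} {g} f≈g = cong sumT3-linear on-fibre
    where
    on-fibre : ∀ q → fibreSign k q * f q ≈ fibreSign k q * g q
    on-fibre q with compose q ≟C k
    ... | yes q∈k = *-congˡ (f≈g q q∈k)
    ... | no  _   = trans (*-congʳ (zeroˡ _)) (trans (zeroˡ _) (sym (trans (*-congʳ (zeroˡ _)) (zeroˡ _))))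

  pair≈sumT3 : ∀ r w → pair r w ≈ sumT3 (λ q → sign q * (r q * w q))
  pair≈sumT3 r w = cong sumGen-linear λ g → cong sumGen-linear λ h →
    +-cong (sym (*-identityˡ _)) (sym (-1*x≈-x _))

  fibreSign-perp : ∀ σ k → InRperp (λ q → σ * fibreSign k q)
  fibreSign-perp σ k r r∈R = begin
    pair r (λ q → σ * fibreSign k q)
      ≈⟨ pair≈sumT3 r (λ q → σ * fibreSign k q) ⟩
    sumT3 (λ q → sign q * (r q * (σ * (𝟙 (compose q ≟C k) * sign q))))
      ≈⟨ cong sumT3-linear (λ q → trans (rearrange (sign q) (r q) σ (𝟙 (compose q ≟C k)))
                                    (trans (*-congˡ (*-congʳ (sign²≈1 q))) (*-congˡ (trans (*-identityˡ _) (sym (if-then-0 _ _)))))) ⟩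
    sumT3 (λ q → σ * (if ⌊ compose q ≟C k ⌋ then r q else 0#))
      ≈⟨ *-hom sumT3-linear σ (λ q → if ⌊ compose q ≟C k ⌋ then r q else 0#) ⟩
    σ * sumT3 (λ q → if ⌊ compose q ≟C k ⌋ then r q else 0#)
      ≈⟨ *-congˡ (r∈R k) ⟩
    σ * 0#
      ≈⟨ zeroʳ σ ⟩
    0# ∎
    where
    rearrange : ∀ s x y i → s * (x * (y * (i * s))) ≈ y * ((s * s) * (i * x))
    rearrange = solve 4 (λ s x y i → s ⊕ (x ⊕ (y ⊕ (i ⊕ s))) ⊜ y ⊕ ((s ⊕ s) ⊕ (i ⊕ x))) refl

  -- Twisted by the sign, a family that is balanced on every fibre lies in R.
  R⊥-annihilates-balanced : ∀ φ → (∀ k → fibreSum k φ ≈ 0#) → ∀ w → InRperp w → sumT3 (λ q → w q * φ q) ≈ 0#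
  R⊥-annihilates-balanced φ balanced w w∈R⊥ = begin
    sumT3 (λ q → w q * φ q)
      ≈⟨ cong sumT3-linear (λ q → trans (sym (*-identityˡ _)) (trans (*-congʳ (sym (sign²≈1 q))) (rearrange (sign q) (w q) (φ q)))) ⟩
    sumT3 (λ q → sign q * (r q * w q))
      ≈⟨ pair≈sumT3 r w ⟨
    pair r w
      ≈⟨ w∈R⊥ r r∈R ⟩
    0# ∎
    where
    r : V3
    r q = sign q * φ q
    rearrange : ∀ s x y → (s * s) * (x * y) ≈ s * ((s * y) * x)
    rearrange = solve 3 (λ s x y → (s ⊕ s) ⊕ (x ⊕ y) ⊜ s ⊕ ((s ⊕ y) ⊕ x)) refl
    r∈R : InR r
    r∈R k = trans (cong sumT3-linear (λ q → trans (if-then-0 (compose q ≟C k) (r q)) (sym (*-assoc _ _ _)))) (balanced k)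

  Σm : (Fin m → Carrier) → Carrier
  Σm = sumFin m

  Σm-linear : IsLinear Σm
  Σm-linear = sumFin-linear m

  Σ⋆ : Fin m → (Fin m × Fin m → Carrier) → Carrier
  Σ⋆ z f = Σm (λ x → Σm (λ y → 𝟙 (x ⋆ y ≟ z) * f (x , y)))

  Σ⋆-linear : ∀ z → IsLinear (Σ⋆ z)
  Σ⋆-linear z = ∘-linear Σm-linear λ x → precomp-linear (scale-linear Σm-linear (λ y → 𝟙 (x ⋆ y ≟ z))) (x ,_)

  𝟙-clique : ∀ (a₁ a₂ a₃ a₄ a₅ a₆ b₁ b₂ b₃ b₄ b₅ b₆ : Fin m) →
    𝟙 ((a₁ , a₂ , a₃ , a₄ , a₅ , a₆) ≟C (b₁ , b₂ , b₃ , b₄ , b₅ , b₆)) ≈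
    𝟙 (a₁ ≟ b₁) * (𝟙 (a₂ ≟ b₂) * (𝟙 (a₃ ≟ b₃) * (𝟙 (a₄ ≟ b₄) * (𝟙 (a₅ ≟ b₅) * 𝟙 (a₆ ≟ b₆)))))
  𝟙-clique a₁ a₂ a₃ a₄ a₅ a₆ b₁ b₂ b₃ b₄ b₅ b₆ =
    trans (𝟙-pair (d₅ _ _) (a₁ ≟ b₁) (d₄ _ _)) (*-congˡ
    (trans (𝟙-pair (d₄ _ _) (a₂ ≟ b₂) (d₃ _ _)) (*-congˡ
    (trans (𝟙-pair (d₃ _ _) (a₃ ≟ b₃) (d₂ _ _)) (*-congˡ
    (trans (𝟙-pair (d₂ _ _) (a₄ ≟ b₄) (d₁ _ _)) (*-congˡ
    (𝟙-pair (d₁ _ _) (a₅ ≟ b₅) (a₆ ≟ b₆)))))))))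
    where
    d₁ = ≡-dec _≟_ _≟_
    d₂ = ≡-dec _≟_ d₁
    d₃ = ≡-dec _≟_ d₂
    d₄ = ≡-dec _≟_ d₃
    d₅ = ≡-dec _≟_ d₄

  δ-outer₁ : ∀ a (F : Fin m → Fin m → Carrier) → Σm (λ i → Σm (λ j → 𝟙 (i ≟ a) * F i j)) ≈ Σm (F a)
  δ-outer₁ a F = trans (cong Σm-linear (λ i → *-hom Σm-linear _ (F i))) (sumFin-δ m a _)

  δ-outer₂ : ∀ a (F : Fin m → Fin m → Fin m → Carrier) →
             Σm (λ i → Σm (λ j → Σm (λ k → 𝟙 (i ≟ a) * F i j k))) ≈ Σm (λ j → Σm (F a j))
  δ-outer₂ a F = trans (cong Σm-linear (λ i → trans (cong Σm-linear (λ j → *-hom Σm-linear _ (F i j))) (*-hom Σm-linear _ _)))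
                       (sumFin-δ m a _)

  δ-pair : ∀ a b (F : Fin m → Fin m → Carrier) → Σm (λ i → Σm (λ j → 𝟙 (i ≟ a) * (𝟙 (j ≟ b) * F i j))) ≈ F a b
  δ-pair a b F = trans (δ-outer₁ a _) (sumFin-δ m b (F a))

  Σm²-*-hom : ∀ x (F : Fin m → Fin m → Carrier) → Σm (λ i → Σm (λ j → x * F i j)) ≈ x * Σm (λ i → Σm (F i))
  Σm²-*-hom x F = trans (cong Σm-linear (λ i → *-hom Σm-linear x (F i))) (*-hom Σm-linear x _)

  private
    reorder : ∀ a b c′ d e′ f g → (a * (b * (c′ * (d * (e′ * f))))) * g ≈ a * (b * (c′ * (f * (e′ * (d * g)))))
    reorder = solve 7 (λ a b c d e f g → (a ⊕ (b ⊕ (c ⊕ (d ⊕ (e ⊕ f))))) ⊕ g ⊜ a ⊕ (b ⊕ (c ⊕ (f ⊕ (e ⊕ (d ⊕ g)))))) refl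

    reorder′ : ∀ a b c′ d e′ f g → (a * (b * (c′ * (d * (e′ * f))))) * g ≈ b * (c′ * (a * (f * (d * (e′ * g)))))
    reorder′ = solve 7 (λ a b c d e f g → (a ⊕ (b ⊕ (c ⊕ (d ⊕ (e ⊕ f))))) ⊕ g ⊜ b ⊕ (c ⊕ (a ⊕ (f ⊕ (d ⊕ (e ⊕ g)))))) refl

  fibre-L : ∀ k₁ k₂ k₃ k₄ k₅ k₆ (F : Gen m → Gen m → Carrier) →
    sumGen (λ g → sumGen (λ h → 𝟙 (compose (L g h) ≟C (k₁ , k₂ , k₃ , k₄ , k₅ , k₆)) * F g h))
    ≈ 𝟙 (e ≟ k₅) * Σ⋆ k₄ (λ (x , y) → F (k₆ , x , k₃) (y , k₁ , k₂))
  fibre-L k₁ k₂ k₃ k₄ k₅ k₆ F = begin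
    Σm (λ p₀ → Σm (λ p₁ → Σm (λ p₂ → Σm (λ q₀ → Σm (λ q₁ → Σm (λ q₂ →
      𝟙 (compose (L (p₀ , p₁ , p₂) (q₀ , q₁ , q₂)) ≟C (k₁ , k₂ , k₃ , k₄ , k₅ , k₆)) * F (p₀ , p₁ , p₂) (q₀ , q₁ , q₂)))))))
      ≈⟨ cong Σm-linear (λ p₀ → cong Σm-linear λ p₁ → cong Σm-linear λ p₂ → cong Σm-linear λ q₀ →
           trans (cong Σm-linear λ q₁ → cong Σm-linear λ q₂ →
                    trans (*-congʳ (𝟙-clique q₁ q₂ p₂ (p₁ ⋆ q₀) e p₀ k₁ k₂ k₃ k₄ k₅ k₆)) (reorder _ _ _ _ _ _ _))
                 (δ-pair k₁ k₂ _)) ⟩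
    Σm (λ p₀ → Σm (λ p₁ → Σm (λ p₂ → Σm (λ q₀ →
      𝟙 (p₂ ≟ k₃) * (𝟙 (p₀ ≟ k₆) * (𝟙 (e ≟ k₅) * (𝟙 (p₁ ⋆ q₀ ≟ k₄) * F (p₀ , p₁ , p₂) (q₀ , k₁ , k₂))))))))
      ≈⟨ cong Σm-linear (λ p₀ → cong Σm-linear λ p₁ → δ-outer₁ k₃ _) ⟩
    Σm (λ p₀ → Σm (λ p₁ → Σm (λ q₀ → 𝟙 (p₀ ≟ k₆) * (𝟙 (e ≟ k₅) * (𝟙 (p₁ ⋆ q₀ ≟ k₄) * F (p₀ , p₁ , k₃) (q₀ , k₁ , k₂))))))
      ≈⟨ δ-outer₂ k₆ _ ⟩
    Σm (λ p₁ → Σm (λ q₀ → 𝟙 (e ≟ k₅) * (𝟙 (p₁ ⋆ q₀ ≟ k₄) * F (k₆ , p₁ , k₃) (q₀ , k₁ , k₂))))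
      ≈⟨ Σm²-*-hom _ _ ⟩
    𝟙 (e ≟ k₅) * Σ⋆ k₄ (λ (x , y) → F (k₆ , x , k₃) (y , k₁ , k₂)) ∎

  fibre-R : ∀ k₁ k₂ k₃ k₄ k₅ k₆ (F : Gen m → Gen m → Carrier) →
    sumGen (λ g → sumGen (λ h → 𝟙 (compose (R g h) ≟C (k₁ , k₂ , k₃ , k₄ , k₅ , k₆)) * F g h))
    ≈ 𝟙 (e ≟ k₄) * Σ⋆ k₅ (λ (x , y) → F (k₆ , k₁ , x) (y , k₂ , k₃))
  fibre-R k₁ k₂ k₃ k₄ k₅ k₆ F = begin
    Σm (λ p₀ → Σm (λ p₁ → Σm (λ p₂ → Σm (λ q₀ → Σm (λ q₁ → Σm (λ q₂ →
      𝟙 (compose (R (p₀ , p₁ , p₂) (q₀ , q₁ , q₂)) ≟C (k₁ , k₂ , k₃ , k₄ , k₅ , k₆)) * F (p₀ , p₁ , p₂) (q₀ , q₁ , q₂)))))))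
      ≈⟨ cong Σm-linear (λ p₀ → cong Σm-linear λ p₁ → cong Σm-linear λ p₂ → cong Σm-linear λ q₀ →
           trans (cong Σm-linear λ q₁ → cong Σm-linear λ q₂ →
                    trans (*-congʳ (𝟙-clique p₁ q₁ q₂ e (p₂ ⋆ q₀) p₀ k₁ k₂ k₃ k₄ k₅ k₆)) (reorder′ _ _ _ _ _ _ _))
                 (δ-pair k₂ k₃ _)) ⟩
    Σm (λ p₀ → Σm (λ p₁ → Σm (λ p₂ → Σm (λ q₀ →
      𝟙 (p₁ ≟ k₁) * (𝟙 (p₀ ≟ k₆) * (𝟙 (e ≟ k₄) * (𝟙 (p₂ ⋆ q₀ ≟ k₅) * F (p₀ , p₁ , p₂) (q₀ , k₂ , k₃))))))))
      ≈⟨ cong Σm-linear (λ p₀ → δ-outer₂ k₁ _) ⟩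
    Σm (λ p₀ → Σm (λ p₂ → Σm (λ q₀ → 𝟙 (p₀ ≟ k₆) * (𝟙 (e ≟ k₄) * (𝟙 (p₂ ⋆ q₀ ≟ k₅) * F (p₀ , k₁ , p₂) (q₀ , k₂ , k₃))))))
      ≈⟨ δ-outer₂ k₆ _ ⟩
    Σm (λ p₂ → Σm (λ q₀ → 𝟙 (e ≟ k₄) * (𝟙 (p₂ ⋆ q₀ ≟ k₅) * F (k₆ , k₁ , p₂) (q₀ , k₂ , k₃))))
      ≈⟨ Σm²-*-hom _ _ ⟩
    𝟙 (e ≟ k₄) * Σ⋆ k₅ (λ (x , y) → F (k₆ , k₁ , x) (y , k₂ , k₃)) ∎

  fibreSum-decompose : ∀ k₁ k₂ k₃ k₄ k₅ k₆ f → fibreSum (k₁ , k₂ , k₃ , k₄ , k₅ , k₆) f ≈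
    𝟙 (e ≟ k₅) * Σ⋆ k₄ (λ (x , y) → f (L (k₆ , x , k₃) (y , k₁ , k₂)))
    - 𝟙 (e ≟ k₄) * Σ⋆ k₅ (λ (x , y) → f (R (k₆ , k₁ , x) (y , k₂ , k₃)))
  fibreSum-decompose k₁ k₂ k₃ k₄ k₅ k₆ f = begin
    fibreSum k f
      ≈⟨ sumT3-split (λ q → fibreSign k q * f q) ⟩
    sumGen (λ g → sumGen (λ h → fibreSign k (L g h) * f (L g h))) + sumGen (λ g → sumGen (λ h → fibreSign k (R g h) * f (R g h)))
      ≈⟨ +-cong (cong sumGen-linear λ g → cong sumGen-linear λ h → *-congʳ (*-identityʳ _))
                (cong sumGen-linear λ g → cong sumGen-linear λ h → trans (*-congʳ (sym (-‿distribʳ-* _ 1#)))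
                                                                   (trans (sym (-‿distribˡ-* _ _)) (-‿cong (*-congʳ (*-identityʳ _))))) ⟩
    sumGen (λ g → sumGen (λ h → 𝟙 (compose (L g h) ≟C k) * f (L g h))) + sumGen (λ g → sumGen (λ h → - (𝟙 (compose (R g h) ≟C k) * f (R g h))))
      ≈⟨ +-cong (fibre-L k₁ k₂ k₃ k₄ k₅ k₆ (λ g h → f (L g h)))
                (trans (-‿hom sumGen²-linear (λ (g , h) → 𝟙 (compose (R g h) ≟C k) * f (R g h)))
                       (-‿cong (fibre-R k₁ k₂ k₃ k₄ k₅ k₆ (λ g h → f (R g h))))) ⟩
    𝟙 (e ≟ k₅) * Σ⋆ k₄ (λ (x , y) → f (L (k₆ , x , k₃) (y , k₁ , k₂)))
    - 𝟙 (e ≟ k₄) * Σ⋆ k₅ (λ (x , y) → f (R (k₆ , k₁ , x) (y , k₂ , k₃))) ∎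
    where k = (k₁ , k₂ , k₃ , k₄ , k₅ , k₆)

module NormalForms {m : ℕ} (e : Fin m) where
  open import Data.Nat using (ℕ)
  open import Data.Fin using (Fin)
  open import Relation.Binary.PropositionalEquality using (_≡_)

  open import Data.Nat using (suc; _+_; _<_)
  import Data.Nat.Properties as ℕP
  open import Data.Fin using (_≟_)
  open import Data.Maybe using (Maybe; just)
  open import Data.List using ([]; _∷_; _++_)
  open import Data.Bool using (if_then_else_)
  open import Relation.Nullary.Decidable using (⌊_⌋)
  import Data.Maybe.Properties as MaybeP
  open import Data.Product using (Σ; _×_; _,_; proj₁; proj₂)
  open import Function using (_on_; _∘_)
  open import Relation.Nullary using (¬_; Dec; yes; no; ¬?; _×-dec_; _→-dec_; contradiction)
  open import Relation.Binary.PropositionalEquality as ≡ using (refl; cong; cong₂)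
  open import Induction.WellFounded using (WellFounded)
  import Relation.Binary.Construct.On as On
  open import Data.Product.Relation.Binary.Lex.Strict using (×-Lex; ×-wellFounded)
  open import Data.Nat.Induction using (<-wellFounded)
  open Trees

  UnitRoot : Tree m → Set
  UnitRoot T = rootLabel T ≡ just e

  unitRoot? : ∀ T → Dec (UnitRoot T)
  unitRoot? T = MaybeP.≡-dec _≟_ (rootLabel T) (just e)

  data Normal : Tree m → Set where
    leaf : Normal leaf
    node : ∀ {p₀ p₁ p₂ l r} → ¬ UnitRoot l → (UnitRoot r → p₂ ≡ e) → Normal l → Normal r →
           Normal (node (p₀ , p₁ , p₂) l r)

  normal? : ∀ T → Dec (Normal T)
  normal? leaf = yes leaf
  normal? (node (p₀ , p₁ , p₂) l r)
    with ¬? (unitRoot? l) | unitRoot? r →-dec (p₂ ≟ e) | normal? l | normal? r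
  ... | yes okₗ | yes okᵣ | yes nₗ | yes nᵣ = yes (node okₗ okᵣ nₗ nᵣ)
  ... | no ¬okₗ | _       | _      | _      = no λ { (node okₗ _ _ _) → ¬okₗ okₗ }
  ... | yes _   | no ¬okᵣ | _      | _      = no λ { (node _ okᵣ _ _) → ¬okᵣ okᵣ }
  ... | yes _   | yes _   | no ¬nₗ | _      = no λ { (node _ _ nₗ _) → ¬nₗ nₗ }
  ... | yes _   | yes _   | yes _  | no ¬nᵣ = no λ { (node _ _ _ nᵣ) → ¬nᵣ nᵣ }

  data Lead : T3 m → Set where
    lead-L : ∀ g q₁ q₂ → Lead (L g (e , q₁ , q₂))
    lead-R : ∀ p₀ p₁ p₂ q₁ q₂ → ¬ p₂ ≡ e → Lead (R (p₀ , p₁ , p₂) (e , q₁ , q₂))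

  record Redex (T : Tree m) : Set where
    constructor redex
    field
      ctx   : Ctx m
      a b d : Tree m
      q     : T3 m
      lead  : Lead q
      focus : T ≡ fill ctx (inst q a b d)

  private
    redex-L : ∀ g l r → UnitRoot l → Redex (node g l r)
    redex-L g (node (.e , q₁ , q₂) a b) r refl = redex hole a b r (L g (e , q₁ , q₂)) (lead-L g q₁ q₂) refl

    redex-R : ∀ p₀ p₁ p₂ l r → ¬ (UnitRoot r → p₂ ≡ e) → Redex (node (p₀ , p₁ , p₂) l r)
    redex-R p₀ p₁ p₂ l leaf                        ¬ok = contradiction (λ ()) ¬ok
    redex-R p₀ p₁ p₂ l (node (r₀ , q₁ , q₂) b d) ¬ok with r₀ ≟ e
    ... | yes refl = redex hole l b d (R (p₀ , p₁ , p₂) (e , q₁ , q₂)) (lead-R p₀ p₁ p₂ q₁ q₂ λ p₂≡e → ¬ok λ _ → p₂≡e) refl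
    ... | no r₀≢e  = contradiction (λ { refl → contradiction refl r₀≢e }) ¬ok

    redex-inL : ∀ g {l} r → Redex l → Redex (node g l r)
    redex-inL g r (redex C a b d q ld eq) = redex (inL g C r) a b d q ld (cong (λ t → node g t r) eq)

    redex-inR : ∀ g l {r} → Redex r → Redex (node g l r)
    redex-inR g l (redex C a b d q ld eq) = redex (inR g l C) a b d q ld (cong (node g l) eq)

  find-redex : ∀ T → ¬ Normal T → Redex T
  find-redex leaf ¬n = contradiction leaf ¬n
  find-redex (node (p₀ , p₁ , p₂) l r) ¬n
    with unitRoot? l | unitRoot? r →-dec (p₂ ≟ e) | normal? l | normal? r
  ... | yes u  | _       | _      | _      = redex-L _ l r u
  ... | no ¬u  | no ¬okᵣ | _      | _      = redex-R p₀ p₁ p₂ l r ¬okᵣ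
  ... | no ¬u  | yes okᵣ | no ¬nₗ | _      = redex-inL _ r (find-redex l ¬nₗ)
  ... | no ¬u  | yes okᵣ | yes nₗ | no ¬nᵣ = redex-inR _ l (find-redex r ¬nᵣ)
  ... | no ¬u  | yes okᵣ | yes nₗ | yes nᵣ = contradiction (node ¬u okᵣ nₗ nᵣ) ¬n

  leftWeight : Tree m → ℕ
  leftWeight leaf         = 0
  leftWeight (node g l r) = leftWeight l + leftWeight r + leaves l

  defect : ∀ {A : Set} → Dec A → ℕ
  defect (yes _) = 1
  defect (no _)  = 0

  violations : Tree m → ℕ
  violations leaf                      = 0
  violations (node (_ , _ , p₂) l r) =
    (defect (unitRoot? l) + defect (unitRoot? r ×-dec ¬? (p₂ ≟ e))) + (violations l + violations r)

  _≺_ : Tree m → Tree m → Set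
  _≺_ = ×-Lex _≡_ _<_ _<_ on (λ T → leftWeight T , violations T)

  ≺-wellFounded : WellFounded _≺_
  ≺-wellFounded = On.wellFounded (λ T → leftWeight T , violations T) (×-wellFounded <-wellFounded <-wellFounded)

  module _ {X Y : Tree m} (same-leaves : leaves X ≡ leaves Y) where

    leftWeight-fill-< : ∀ C → leftWeight X < leftWeight Y → leftWeight (fill C X) < leftWeight (fill C Y)
    leftWeight-fill-< hole        lt = lt
    leftWeight-fill-< (inL g C r) lt rewrite leaves-fill C {X} {Y} same-leaves =
      ℕP.+-monoˡ-< (leaves (fill C Y)) (ℕP.+-monoˡ-< (leftWeight r) (leftWeight-fill-< C lt))
    leftWeight-fill-< (inR g l C) lt = ℕP.+-monoˡ-< (leaves l) (ℕP.+-monoʳ-< (leftWeight l) (leftWeight-fill-< C lt))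

    leftWeight-fill-≡ : ∀ C → leftWeight X ≡ leftWeight Y → leftWeight (fill C X) ≡ leftWeight (fill C Y)
    leftWeight-fill-≡ hole        eq = eq
    leftWeight-fill-≡ (inL g C r) eq = ≡.cong₂ (λ u v → u + leftWeight r + v) (leftWeight-fill-≡ C eq) (leaves-fill C {X} {Y} same-leaves)
    leftWeight-fill-≡ (inR g l C) eq = cong (λ u → leftWeight l + u + leaves l) (leftWeight-fill-≡ C eq)

  module _ {X Y : Tree m} (same-root : rootLabel X ≡ rootLabel Y) where

    private
      rootLabel-fill : ∀ C → rootLabel (fill C X) ≡ rootLabel (fill C Y)
      rootLabel-fill hole        = same-root
      rootLabel-fill (inL _ _ _) = refl
      rootLabel-fill (inR _ _ _) = refl

      unitDefect : Maybe (Fin m) → ℕ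
      unitDefect z = defect (MaybeP.≡-dec _≟_ z (just e))

      rightDefect : Fin m → Maybe (Fin m) → ℕ
      rightDefect p₂ z = defect (MaybeP.≡-dec _≟_ z (just e) ×-dec ¬? (p₂ ≟ e))

    violations-fill-< : ∀ C → violations X < violations Y → violations (fill C X) < violations (fill C Y)
    violations-fill-< hole lt = lt
    violations-fill-< (inL (_ , _ , p₂) C r) lt
      rewrite cong unitDefect (rootLabel-fill C) =
      ℕP.+-monoʳ-< (unitDefect (rootLabel (fill C Y)) + rightDefect p₂ (rootLabel r)) (ℕP.+-monoˡ-< (violations r) (violations-fill-< C lt))
    violations-fill-< (inR (_ , _ , p₂) l C) lt
      rewrite cong (rightDefect p₂) (rootLabel-fill C) =
      ℕP.+-monoʳ-< (unitDefect (rootLabel l) + rightDefect p₂ (rootLabel (fill C Y))) (ℕP.+-monoʳ-< (violations l) (violations-fill-< C lt))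

  mutual
    forest : Tree m → Forest m
    forest leaf                      = []
    forest (node (_ , p₁ , p₂) l r) = branch l p₁ ++ branch r p₂

    branch : Tree m → Fin m → Forest m
    branch leaf                       p = leafS p ∷ []
    branch T@(node (r , _ , _) _ _) p = if ⌊ r ≟ e ⌋ then forest T else nodeS p r (forest T) ∷ []

  branch-solid : ∀ {r₀ q₁ q₂} l r p → ¬ r₀ ≡ e → branch (node (r₀ , q₁ , q₂) l r) p ≡ nodeS p r₀ (forest (node (r₀ , q₁ , q₂) l r)) ∷ []
  branch-solid {r₀} l r p r₀≢e with r₀ ≟ e
  ... | yes r₀≡e = contradiction r₀≡e r₀≢e
  ... | no _     = refl

  solidCount : Forest m → ℕ
  solidCount []                = 0
  solidCount (leafS _ ∷ F)     = solidCount F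
  solidCount (nodeS _ _ G ∷ F) = suc (solidCount G + solidCount F)

  solidCount-++ : ∀ F₁ F₂ → solidCount (F₁ ++ F₂) ≡ solidCount F₁ + solidCount F₂
  solidCount-++ []                 F₂ = refl
  solidCount-++ (leafS _ ∷ F₁)     F₂ = solidCount-++ F₁ F₂
  solidCount-++ (nodeS _ _ G ∷ F₁) F₂ = cong suc (≡.trans (cong (solidCount G +_) (solidCount-++ F₁ F₂)) (≡.sym (ℕP.+-assoc (solidCount G) _ _)))

  mutual
    decode : Fin m → Forest m → Tree m
    decode ρ []      = leaf
    decode ρ (x ∷ F) = node (ρ , proj₂ (decodeChild x) , proj₂ (decodeRight F)) (proj₁ (decodeChild x)) (proj₁ (decodeRight F))

    decodeChild : Schema m → Tree m × Fin m
    decodeChild (leafS p)     = leaf , p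
    decodeChild (nodeS p r G) = decode r G , p

    decodeRight : Forest m → Tree m × Fin m
    decodeRight []                = leaf , e
    decodeRight (y ∷ [])          = decodeChild y
    decodeRight F@(_ ∷ _ ∷ _)     = decode e F , e

  private
    branch-nonempty : ∀ Y p → Σ (Schema m) λ y → Σ (Forest m) λ ys → branch Y p ≡ y ∷ ys
    branch-nonempty leaf p = _ , _ , refl
    branch-nonempty (node (r₀ , q₁ , q₂) l r) p with r₀ ≟ e
    ... | yes _ = let y , ys , eq = branch-nonempty l q₁ in y , ys ++ branch r q₂ , cong (_++ branch r q₂) eq
    ... | no _  = _ , _ , refl

  mutual
    decode-forest : ∀ {g l r} → Normal (node g l r) → decode (proj₁ g) (forest (node g l r)) ≡ node g l r
    decode-forest {p₀ , p₁ , p₂} {l} {r} (node ¬uₗ okᵣ nₗ nᵣ) with decode-left l p₁ nₗ ¬uₗ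
    ... | x , branchₗ≡x , decode-x rewrite branchₗ≡x =
      ≡.cong₂ (λ (l′ , p₁′) (r′ , p₂′) → node (p₀ , p₁′ , p₂′) l′ r′) decode-x (decode-right r p₂ nᵣ okᵣ)

    decode-left : ∀ l p → Normal l → ¬ UnitRoot l → Σ (Schema m) λ x → branch l p ≡ x ∷ [] × decodeChild x ≡ (l , p)
    decode-left leaf                     p _ _  = leafS p , refl , refl
    decode-left (node (r₀ , q₁ , q₂) a b) p n ¬u =
      nodeS p r₀ (forest (node (r₀ , q₁ , q₂) a b)) , branch-solid a b p (¬u ∘ cong just) , cong (_, p) (decode-forest n)

    decode-right : ∀ r p → Normal r → (UnitRoot r → p ≡ e) → decodeRight (branch r p) ≡ (r , p)
    decode-right leaf p _ _ = refl
    decode-right (node (r₀ , q₁ , q₂) a b) p n ok with r₀ ≟ e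
    ... | no _ = cong (_, p) (decode-forest n)
    ... | yes refl with ok refl | n
    ...   | refl | node ¬uₐ _ nₐ _ with decode-left a q₁ nₐ ¬uₐ | branch-nonempty b q₂
    ...     | x , branchₐ≡x , _ | z , zs , branch-b≡z∷zs
      rewrite branchₐ≡x | branch-b≡z∷zs =
      ≡.subst (λ F → (decode e F , e) ≡ (node (e , q₁ , q₂) a b , e))
              (cong₂ (λ u v → u ++ v) branchₐ≡x branch-b≡z∷zs) (cong (_, e) (decode-forest n))

module Rewriting {m : ℕ} (_⋆_ : Op₂ (Fin m)) (e : Fin m) (⋆-identityʳ : ∀ x → x ⋆ e ≡ x) where
  open import Data.Nat using (ℕ)
  open import Data.Fin using (Fin)
  open import Relation.Binary.PropositionalEquality using (_≡_)

  open import Data.Nat using (_+_; _<_; s≤s; z≤n)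
  import Data.Nat.Properties as ℕP
  open import Data.Fin using (_≟_)
  open import Data.Maybe using (just)
  open import Data.Product using (_×_; _,_)
  open import Data.Sum using (inj₁; inj₂)
  open import Relation.Nullary using (¬_; Dec; yes; no; ¬?; _×-dec_; contradiction)
  open import Relation.Binary.PropositionalEquality as ≡ using (refl; cong)
  open Trees
  open NormalForms e

  private
    defect-yes : ∀ {A : Set} (d : Dec A) → A → defect d ≡ 1
    defect-yes (yes _) _ = refl
    defect-yes (no ¬a) a = contradiction a ¬a

    defect-no : ∀ {A : Set} (d : Dec A) → ¬ A → defect d ≡ 0
    defect-no (yes a) ¬a = contradiction a ¬a
    defect-no (no _)  _  = refl

    clique-≡ : ∀ {a₁ a₂ a₃ a₄ a₅ a₆ b₁ b₂ b₃ b₄ b₅ b₆ : Fin m} →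
               _≡_ {A = Clique3 m} (a₁ , a₂ , a₃ , a₄ , a₅ , a₆) (b₁ , b₂ , b₃ , b₄ , b₅ , b₆) →
               a₁ ≡ b₁ × a₂ ≡ b₂ × a₃ ≡ b₃ × a₄ ≡ b₄ × a₅ ≡ b₅ × a₆ ≡ b₆
    clique-≡ refl = refl , refl , refl , refl , refl , refl

    just≢ : ∀ {x} → ¬ x ≡ e → ¬ just x ≡ just e
    just≢ x≢e refl = x≢e refl

    leftWeight-R<L : ∀ g h g′ h′ (a b d : Tree m) → leftWeight (inst (R g h) a b d) < leftWeight (inst (L g′ h′) a b d)
    leftWeight-R<L g h g′ h′ a b d =
      ≡.subst (leftWeight a + (leftWeight b + leftWeight d + leaves b) + leaves a <_) (≡.sym (shift (leftWeight a) (leftWeight b) (leftWeight d) (leaves a) (leaves b)))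
              (ℕP.m<m+n _ (leaves≥1 a))
      where
      open import Data.Nat.Tactic.RingSolver using (solve-∀)
      shift : ∀ x y z u v → x + y + u + z + (u + v) ≡ x + (y + z + v) + u + u
      shift = solve-∀

  -- Replacing the leading term by another member of its fibre either turns a left comb into a right
  -- comb (leftWeight drops) or keeps the shape and makes the unit-rooted child non-unit (violations drop).
  decrease : ∀ {q₀} → Lead q₀ → ∀ q → compose3 _⋆_ e q ≡ compose3 _⋆_ e q₀ → ¬ q ≡ q₀ →
             ∀ C a b d → fill C (inst q a b d) ≺ fill C (inst q₀ a b d)
  decrease (lead-L (p₀ , p₁ , p₂) q₁ q₂) (L (g₀ , g₁ , g₂) (h₀ , h₁ , h₂)) eq q≢q₀ C a b d
    with clique-≡ eq
  ... | refl , refl , refl , g₁⋆h₀≡p₁⋆e , _ , refl =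
    inj₂ (leftWeight-fill-≡ refl C refl , violations-fill-< refl C fewer)
    where
    h₀≢e : ¬ h₀ ≡ e
    h₀≢e refl = q≢q₀ (cong (λ z → L (p₀ , z , p₂) (e , q₁ , q₂))
                           (≡.trans (≡.sym (⋆-identityʳ g₁)) (≡.trans g₁⋆h₀≡p₁⋆e (⋆-identityʳ p₁))))
    fewer : violations (inst (L (p₀ , g₁ , p₂) (h₀ , q₁ , q₂)) a b d) < violations (inst (L (p₀ , p₁ , p₂) (e , q₁ , q₂)) a b d)
    fewer rewrite defect-no (unitRoot? (node (h₀ , q₁ , q₂) a b)) (just≢ h₀≢e)
                | defect-yes (unitRoot? (node (e , q₁ , q₂) a b)) refl = ℕP.n<1+n _
  decrease (lead-L g q₁ q₂) (R g′ h′) eq q≢q₀ C a b d =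
    inj₁ (leftWeight-fill-< (leaves-inst (R g′ h′) (L g (e , q₁ , q₂)) a b d) C
                            (leftWeight-R<L g′ h′ g (e , q₁ , q₂) a b d))
  decrease (lead-R p₀ p₁ p₂ q₁ q₂ p₂≢e) (L (g₀ , g₁ , g₂) (h₀ , h₁ , h₂)) eq q≢q₀ C a b d
    with clique-≡ eq
  ... | _ , _ , _ , _ , e≡p₂⋆e , _ = contradiction (≡.trans (≡.sym (⋆-identityʳ p₂)) (≡.sym e≡p₂⋆e)) p₂≢e
  decrease (lead-R p₀ p₁ p₂ q₁ q₂ p₂≢e) (R (g₀ , g₁ , g₂) (h₀ , h₁ , h₂)) eq q≢q₀ C a b d
    with clique-≡ eq
  ... | refl , refl , refl , _ , g₂⋆h₀≡p₂⋆e , refl =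
    inj₂ (leftWeight-fill-≡ refl C refl , violations-fill-< refl C fewer)
    where
    h₀≢e : ¬ h₀ ≡ e
    h₀≢e refl = q≢q₀ (cong (λ z → R (p₀ , p₁ , z) (e , q₁ , q₂))
                           (≡.trans (≡.sym (⋆-identityʳ g₂)) (≡.trans g₂⋆h₀≡p₂⋆e (⋆-identityʳ p₂))))
    fewer : violations (inst (R (p₀ , p₁ , g₂) (h₀ , q₁ , q₂)) a b d) < violations (inst (R (p₀ , p₁ , p₂) (e , q₁ , q₂)) a b d)
    fewer rewrite defect-no (unitRoot? (node (h₀ , q₁ , q₂) b d) ×-dec ¬? (g₂ ≟ e)) (λ (u , _) → just≢ h₀≢e u)
                | defect-yes (unitRoot? (node (e , q₁ , q₂) b d) ×-dec ¬? (p₂ ≟ e)) (refl , p₂≢e) =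
      ℕP.+-monoˡ-< (violations a + violations (node (h₀ , q₁ , q₂) b d)) (ℕP.+-monoʳ-< (defect (unitRoot? a)) (s≤s z≤n))

module Spanning {c ℓ} (K : CharZeroField c ℓ) {m : ℕ} (_⋆_ : Op₂ (Fin m)) (e : Fin m)
   (⋆-identityʳ : ∀ x → x ⋆ e ≡ x) (n k : ℕ) (basis : Fin k → Tree m)
   (basis-complete : ∀ T → NormalForms.Normal e T → leaves T ≡ n → Σ (Fin k) λ i → basis i ≡ T) where
  open import Data.Nat using (ℕ)
  open import Data.Fin using (Fin)
  open import Data.Product using (Σ)
  open import Relation.Binary.PropositionalEquality using (_≡_)

  open import Data.Fin using (_≟_)
  import Level
  open import Data.Product using (_,_; proj₁; proj₂)
  open import Data.Sum using (_⊎_; inj₁; inj₂)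
  open import Relation.Nullary using (¬_; Dec; yes; no)
  open import Relation.Binary.PropositionalEquality as ≡ using ()
  open import Induction.WellFounded using (Acc; acc)
  open Trees
  open Linear K _⋆_ e
  open Relations K _⋆_ e
  open NormalForms e
  open Rewriting _⋆_ e ⋆-identityʳ

  v : Fin k → Vect
  v i = δ (basis i)

  InSpan : Tree m → Set (c Level.⊔ ℓ)
  InSpan T = Σ (Fin k → Carrier) λ κ → InIdeal n (λ T′ → δ T T′ - comb κ v T′)

  normal-inSpan : ∀ T → Normal T → leaves T ≡ n → InSpan T
  normal-inSpan T nT lT with basis-complete T nT lT
  ... | i , ≡.refl = (λ j → 𝟙 (j ≟ i)) ,
    ideal-0 (λ T′ → trans (+-congˡ (-‿cong (sumFin-δ k i (λ j → v j T′)))) (-‿inverseʳ _))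

  module _ (C : Ctx m) (a b d : Tree m) (q₀ : T3 m) where

    private
      X : T3 m → Tree m
      X q = fill C (inst q a b d)

      w : V3
      w q = sign q₀ * fibreSign (compose q₀) q

      w-q₀ : w q₀ ≈ 1#
      w-q₀ = trans (*-congˡ (*-congʳ (𝟙-yes (compose q₀ ≟C compose q₀) ≡.refl))) (trans (*-congˡ (*-identityˡ _)) (sign²≈1 q₀))

      γ : T3 m → Carrier
      γ q = 𝟙 (q ≟T3 q₀) * w q - w q

      γ≈0 : ∀ q → q ≡ q₀ ⊎ ¬ compose q ≡ compose q₀ → γ q ≈ 0#
      γ≈0 q (inj₁ ≡.refl) = trans (+-congʳ (trans (*-congʳ (𝟙-yes (q ≟T3 q) ≡.refl)) (*-identityˡ _))) (-‿inverseʳ _)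
      γ≈0 q (inj₂ q∉k)  = trans (+-cong (trans (*-congˡ w≈0) (zeroʳ _)) (trans (-‿cong w≈0) -0#≈0#)) (+-identityʳ 0#)
        where w≈0 = trans (*-congˡ (trans (*-congʳ (𝟙-no (compose q ≟C compose q₀) q∉k)) (zeroˡ _))) (zeroʳ _)

      γ-w : ∀ q D → w q * D + γ q * D ≈ 𝟙 (q ≟T3 q₀) * (w q * D)
      γ-w q D = begin
        w q * D + (𝟙 (q ≟T3 q₀) * w q - w q) * D ≈⟨ +-congˡ (distribʳ D _ _) ⟩
        w q * D + (𝟙 (q ≟T3 q₀) * w q * D + - w q * D) ≈⟨ +-congˡ (+-comm _ _) ⟩
        w q * D + (- w q * D + 𝟙 (q ≟T3 q₀) * w q * D) ≈⟨ +-assoc _ _ _ ⟨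
        (w q * D + - w q * D) + 𝟙 (q ≟T3 q₀) * w q * D ≈⟨ +-congʳ (trans (sym (distribʳ D _ _)) (trans (*-congʳ (-‿inverseʳ _)) (zeroˡ D))) ⟩
        0# + 𝟙 (q ≟T3 q₀) * w q * D                    ≈⟨ trans (+-identityˡ _) (*-assoc _ _ _) ⟩
        𝟙 (q ≟T3 q₀) * (w q * D) ∎

      zero-approx : ∀ {x} → x ≈ 0# → ∀ T → Σ (Fin k → Carrier) λ κ → InIdeal n (λ T′ → x * (δ T T′ - comb κ v T′))
      zero-approx x≈0 T = (λ _ → 0#) , ideal-0 (λ T′ → trans (*-congʳ x≈0) (zeroˡ _))

    relation-inSpan : leaves (X q₀) ≡ n → (∀ q → compose q ≡ compose q₀ → ¬ q ≡ q₀ → InSpan (X q)) → InSpan (X q₀)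
    relation-inSpan lX ih = κ , ideal-resp (λ T′ → sym (rewrite-q₀ T′)) (ideal-+ (ideal-gen G) (ideal-sumT3 _ λ q → proj₂ (approx q)))
      where
      G : IdealGen n
      G = record { ctx = C ; a = a ; b = b ; d = d ; w = w ; perp = fibreSign-perp (sign q₀) (compose q₀)
                 ; arity = λ q → ≡.trans (leaves-fill C (leaves-inst q q₀ a b d)) lX }

      approx : ∀ q → Σ (Fin k → Carrier) λ κ → InIdeal n (λ T′ → γ q * (δ (X q) T′ - comb κ v T′))
      approx q = by-cases (q ≟T3 q₀) (compose q ≟C compose q₀)
        where
        by-cases : Dec (q ≡ q₀) → Dec (compose q ≡ compose q₀) →
                   Σ (Fin k → Carrier) λ κ → InIdeal n (λ T′ → γ q * (δ (X q) T′ - comb κ v T′))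
        by-cases (yes q≡q₀) _         = zero-approx (γ≈0 q (inj₁ q≡q₀)) (X q)
        by-cases (no _)     (no q∉k)  = zero-approx (γ≈0 q (inj₂ q∉k)) (X q)
        by-cases (no q≢q₀)  (yes q∈k) = let κ′ , I′ = ih q q∈k q≢q₀ in κ′ , ideal-* (γ q) I′

      κ : Fin k → Carrier
      κ j = sumT3 (λ q → γ q * proj₁ (approx q) j)

      rewrite-q₀ : ∀ T′ → IdealGen.vec G T′ + sumT3 (λ q → γ q * (δ (X q) T′ - comb (proj₁ (approx q)) v T′))
                          ≈ δ (X q₀) T′ - comb κ v T′
      rewrite-q₀ T′ = begin
        sumT3 (λ q → w q * D q) + sumT3 (λ q → γ q * (D q - E q))
          ≈⟨ +-congˡ (trans (cong sumT3-linear (λ q → x[y-z]≈xy-xz (γ q) (D q) (E q))) (sub-hom sumT3-linear (λ q → γ q * D q) (λ q → γ q * E q))) ⟩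
        sumT3 (λ q → w q * D q) + (sumT3 (λ q → γ q * D q) - sumT3 (λ q → γ q * E q))
          ≈⟨ +-assoc _ _ _ ⟨
        (sumT3 (λ q → w q * D q) + sumT3 (λ q → γ q * D q)) - sumT3 (λ q → γ q * E q)
          ≈⟨ +-cong (trans (sym (+-hom sumT3-linear (λ q → w q * D q) (λ q → γ q * D q))) (trans (cong sumT3-linear (λ q → γ-w q (D q))) (sumT3-δ q₀ (λ q → w q * D q))))
                    (-‿cong combκ) ⟩
        w q₀ * D q₀ - comb κ v T′
          ≈⟨ +-congʳ (trans (*-congʳ w-q₀) (*-identityˡ _)) ⟩
        D q₀ - comb κ v T′ ∎
        where
        D E : T3 m → Carrier
        D q = δ (X q) T′
        E q = comb (proj₁ (approx q)) v T′
        combκ : sumT3 (λ q → γ q * E q) ≈ comb κ v T′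
        combκ = sym (trans (sumT3-commute (comb-linear v T′) (λ q j → γ q * proj₁ (approx q) j))
                           (cong sumT3-linear (λ q → *-hom (comb-linear v T′) (γ q) (proj₁ (approx q)))))

  span : ∀ T → leaves T ≡ n → InSpan T
  span T = go T (≺-wellFounded T)
    where
    go : ∀ T → Acc _≺_ T → leaves T ≡ n → InSpan T
    go T (acc smaller) lT with normal? T
    ... | yes nT = normal-inSpan T nT lT
    ... | no ¬nT with find-redex T ¬nT
    ...   | redex C a b d q₀ lead ≡.refl = relation-inSpan C a b d q₀ lT λ q q∈k q≢q₀ →
      go _ (smaller (decrease lead q q∈k q≢q₀ C a b d))
           (≡.trans (leaves-fill C (leaves-inst q q₀ a b d)) lT)

module TreeSums {c ℓ} (K : CharZeroField c ℓ) {m : ℕ} (_⋆_ : Op₂ (Fin m)) (e : Fin m) where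
  open import Data.Nat using (ℕ)
  open import Data.Fin using (Fin)

  open import Data.Nat as ℕ using (zero; suc; _∸_; _≤_)
  import Data.Nat.Properties as ℕP
  open import Data.Fin using (toℕ)
  open import Data.Product using (proj₁; proj₂)
  open import Relation.Nullary using (¬_; Dec; yes; no; contradiction)
  open Trees
  open Linear K _⋆_ e

  leafTerm : ℕ → (Tree m → Carrier) → Carrier
  leafTerm 1 f = f leaf
  leafTerm _ f = 0#

  -- Sum of f over the trees with n leaves; it misses none of them once fuel ≥ n (treeSum-δ).
  treeSum : (fuel n : ℕ) → (Tree m → Carrier) → Carrier
  treeSum zero        n f = 0#
  treeSum (suc fuel) n f = leafTerm n f + sumFin n λ i → sumGen λ g →
    treeSum fuel (toℕ i) λ l → treeSum fuel (n ∸ toℕ i) λ r → f (node g l r)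

  leafTerm-linear : ∀ n → IsLinear (leafTerm n)
  leafTerm-linear 1             = eval-linear leaf
  leafTerm-linear zero          = record { cong = λ _ → refl ; +-hom = λ _ _ → sym (+-identityʳ 0#) ; *-hom = λ a _ → sym (zeroʳ a) }
  leafTerm-linear (suc (suc n)) = record { cong = λ _ → refl ; +-hom = λ _ _ → sym (+-identityʳ 0#) ; *-hom = λ a _ → sym (zeroʳ a) }

  treeSum-linear : ∀ fuel n → IsLinear (treeSum fuel n)
  treeSum-linear zero n = record { cong = λ _ → refl ; +-hom = λ _ _ → sym (+-identityʳ 0#) ; *-hom = λ a _ → sym (zeroʳ a) }
  treeSum-linear (suc fuel) n = +-linear (leafTerm-linear n)
    (∘-linear (sumFin-linear n) λ i → ∘-linear sumGen-linear λ g →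
     ∘-linear (treeSum-linear fuel (toℕ i)) λ l → precomp-linear (treeSum-linear fuel (n ∸ toℕ i)) (node g l))

  δ-node : ∀ g₀ l₀ r₀ g l r → δ (node g₀ l₀ r₀) (node g l r) ≈ 𝟙 (g₀ ≟G g) * (δ l₀ l * δ r₀ r)
  δ-node g₀ l₀ r₀ g l r = by-cases (g₀ ≟G g) (l₀ ≟T l) (r₀ ≟T r)
    where
    d = node g₀ l₀ r₀ ≟T node g l r
    by-cases : (dg : Dec (g₀ ≡ g)) (dl : Dec (l₀ ≡ l)) (dr : Dec (r₀ ≡ r)) → 𝟙 d ≈ 𝟙 dg * (𝟙 dl * 𝟙 dr)
    by-cases (yes ≡.refl) (yes ≡.refl) (yes ≡.refl) = trans (𝟙-yes d ≡.refl) (sym (trans (*-identityˡ _) (*-identityˡ _)))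
    by-cases (no g₀≢g) _ _ = trans (𝟙-no d λ eq → g₀≢g (proj₁ (node-inj eq))) (sym (zeroˡ _))
    by-cases (yes _) (no l₀≢l) _ = trans (𝟙-no d λ eq → l₀≢l (proj₁ (proj₂ (node-inj eq)))) (sym (trans (*-identityˡ _) (zeroˡ _)))
    by-cases (yes _) (yes _) (no r₀≢r) = trans (𝟙-no d λ eq → r₀≢r (proj₂ (proj₂ (node-inj eq)))) (sym (trans (*-identityˡ _) (zeroʳ _)))

  sumFin-split-δ : ∀ n a b → 1 ≤ b → ∀ X →
    sumFin n (λ i → 𝟙 (a ℕ.≟ toℕ i) * (𝟙 (b ℕ.≟ n ∸ toℕ i) * X)) ≈ 𝟙 (a ℕ.+ b ℕ.≟ n) * X
  sumFin-split-δ zero a b 1≤b X = sym (trans (*-congʳ (𝟙-no (a ℕ.+ b ℕ.≟ 0) a+b≢0)) (zeroˡ X))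
    where
    a+b≢0 : ¬ a ℕ.+ b ≡ 0
    a+b≢0 eq = ℕP.<⇒≢ (ℕP.<-≤-trans 1≤b (ℕP.m≤n+m b a)) (≡.sym eq)
  sumFin-split-δ (suc n) zero b 1≤b X =
    trans (+-cong (*-identityˡ _) (zero-hom (sumFin-linear n) (λ _ → zeroˡ _))) (+-identityʳ _)
  sumFin-split-δ (suc n) (suc a) b 1≤b X = begin
    0# * _ + sumFin n (λ i → 𝟙 (suc a ℕ.≟ suc (toℕ i)) * (𝟙 (b ℕ.≟ n ∸ toℕ i) * X))
      ≈⟨ trans (+-cong (zeroˡ _) (cong (sumFin-linear n) λ i → *-congʳ (𝟙-cong (suc a ℕ.≟ suc (toℕ i)) (a ℕ.≟ toℕ i) ℕP.suc-injective (≡.cong suc))))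
               (+-identityˡ _) ⟩
    sumFin n (λ i → 𝟙 (a ℕ.≟ toℕ i) * (𝟙 (b ℕ.≟ n ∸ toℕ i) * X))
      ≈⟨ sumFin-split-δ n a b 1≤b X ⟩
    𝟙 (a ℕ.+ b ℕ.≟ n) * X
      ≈⟨ *-congʳ (𝟙-cong (a ℕ.+ b ℕ.≟ n) (suc a ℕ.+ b ℕ.≟ suc n) (≡.cong suc) ℕP.suc-injective) ⟩
    𝟙 (suc a ℕ.+ b ℕ.≟ suc n) * X ∎

  treeSum-δ : ∀ fuel n T₀ (f : Tree m → Carrier) → leaves T₀ ≤ fuel →
              treeSum fuel n (λ T → δ T₀ T * f T) ≈ 𝟙 (leaves T₀ ℕ.≟ n) * f T₀
  treeSum-δ zero n T₀ f le = contradiction le (ℕP.<⇒≱ (leaves≥1 T₀))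
  treeSum-δ (suc fuel) n leaf f le =
    trans (+-congˡ (zero-hom (sumFin-linear n) λ i → zero-hom sumGen-linear λ g →
                    zero-hom (treeSum-linear fuel (toℕ i)) λ l → zero-hom (treeSum-linear fuel (n ∸ toℕ i)) λ r → zeroˡ _))
          (trans (+-identityʳ _) (at-leaf n))
    where
    at-leaf : ∀ n → leafTerm n (λ T → δ leaf T * f T) ≈ 𝟙 (1 ℕ.≟ n) * f leaf
    at-leaf zero          = sym (zeroˡ _)
    at-leaf 1             = refl
    at-leaf (suc (suc n)) = sym (zeroˡ _)
  treeSum-δ (suc fuel) n (node g₀ l₀ r₀) f le =
    trans (+-cong (at-leaf n) (trans (cong (sumFin-linear n) split)
                  (sumFin-split-δ n (leaves l₀) (leaves r₀) (leaves≥1 r₀) (f (node g₀ l₀ r₀)))))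
          (+-identityˡ _)
    where
    at-leaf : ∀ n → leafTerm n (λ T → δ (node g₀ l₀ r₀) T * f T) ≈ 0#
    at-leaf zero          = refl
    at-leaf 1             = zeroˡ _
    at-leaf (suc (suc n)) = refl
    l₀≤fuel : leaves l₀ ≤ fuel
    l₀≤fuel = ℕP.≤-pred (ℕP.<-≤-trans (ℕP.m<m+n (leaves l₀) (leaves≥1 r₀)) le)
    r₀≤fuel : leaves r₀ ≤ fuel
    r₀≤fuel = ℕP.≤-pred (ℕP.<-≤-trans (ℕP.m<n+m (leaves r₀) (leaves≥1 l₀)) le)
    split : ∀ i → sumGen (λ g → treeSum fuel (toℕ i) λ l → treeSum fuel (n ∸ toℕ i) λ r → δ (node g₀ l₀ r₀) (node g l r) * f (node g l r))
                ≈ 𝟙 (leaves l₀ ℕ.≟ toℕ i) * (𝟙 (leaves r₀ ℕ.≟ n ∸ toℕ i) * f (node g₀ l₀ r₀))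
    split i = begin
      sumGen (λ g → treeSum fuel (toℕ i) λ l → treeSum fuel (n ∸ toℕ i) λ r → δ (node g₀ l₀ r₀) (node g l r) * f (node g l r))
        ≈⟨ cong sumGen-linear (λ g → trans (cong (treeSum-linear fuel (toℕ i)) λ l → trans (cong (treeSum-linear fuel (n ∸ toℕ i)) λ r →
               trans (*-congʳ (δ-node g₀ l₀ r₀ g l r)) (trans (*-assoc _ _ _) (*-congˡ (*-assoc _ _ _))))
             (trans (*-hom (treeSum-linear fuel (n ∸ toℕ i)) _ _) (*-congˡ (*-hom (treeSum-linear fuel (n ∸ toℕ i)) _ _))))
             (*-hom (treeSum-linear fuel (toℕ i)) _ _)) ⟩
      sumGen (λ g → 𝟙 (g₀ ≟G g) * treeSum fuel (toℕ i) λ l → δ l₀ l * treeSum fuel (n ∸ toℕ i) λ r → δ r₀ r * f (node g l r))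
        ≈⟨ cong sumGen-linear (λ g → *-congˡ (trans (cong (treeSum-linear fuel (toℕ i)) λ l → *-congˡ (treeSum-δ fuel (n ∸ toℕ i) r₀ _ r₀≤fuel))
                                                    (treeSum-δ fuel (toℕ i) l₀ _ l₀≤fuel))) ⟩
      sumGen (λ g → 𝟙 (g₀ ≟G g) * (𝟙 (leaves l₀ ℕ.≟ toℕ i) * (𝟙 (leaves r₀ ℕ.≟ n ∸ toℕ i) * f (node g l₀ r₀))))
        ≈⟨ trans (cong sumGen-linear λ g → *-congʳ (𝟙-sym _≟G_ g₀ g)) (sumGen-δ g₀ _) ⟩
      𝟙 (leaves l₀ ℕ.≟ toℕ i) * (𝟙 (leaves r₀ ℕ.≟ n ∸ toℕ i) * f (node g₀ l₀ r₀)) ∎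

module Functionals {c ℓ} (K : CharZeroField c ℓ) {m : ℕ} (_⋆_ : Op₂ (Fin m)) (e : Fin m)
   (⋆-identityʳ : ∀ x → x ⋆ e ≡ x) where
  open import Data.Nat as ℕ using (ℕ)
  import Data.Nat.Properties as ℕP
  open import Data.Fin using (Fin)
  open import Relation.Binary.PropositionalEquality using (_≡_)

  open import Data.Fin using (_≟_)

  open import Data.List using ([]; _∷_)
  open import Data.Maybe using (just)
  open import Data.Product using (Σ; _×_; _,_; proj₁; proj₂)
  open import Data.Bool using (if_then_else_)
  open import Relation.Nullary using (Dec; yes; no; ¬?)
  open import Relation.Nullary.Decidable using (⌊_⌋)
  open import Relation.Binary.PropositionalEquality as ≡ using ()
  open Trees
  open Linear K _⋆_ e
  open Relations K _⋆_ e
  open TreeSums K _⋆_ e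

  Σsplit : Forest m → (Forest m → Forest m → Carrier) → Carrier
  Σsplit []       h = h [] []
  Σsplit (x ∷ xs) h = h [] (x ∷ xs) + Σsplit xs (λ F₁ F₂ → h (x ∷ F₁) F₂)

  Σsplit-cong : ∀ F {h h′} → (∀ F₁ F₂ → h F₁ F₂ ≈ h′ F₁ F₂) → Σsplit F h ≈ Σsplit F h′
  Σsplit-cong []       h≈h′ = h≈h′ [] []
  Σsplit-cong (x ∷ xs) h≈h′ = +-cong (h≈h′ [] (x ∷ xs)) (Σsplit-cong xs (λ F₁ F₂ → h≈h′ (x ∷ F₁) F₂))

  Σsplit-+ : ∀ F h h′ → Σsplit F (λ F₁ F₂ → h F₁ F₂ + h′ F₁ F₂) ≈ Σsplit F h + Σsplit F h′
  Σsplit-+ []       h h′ = refl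
  Σsplit-+ (x ∷ xs) h h′ = trans (+-congˡ (Σsplit-+ xs _ _)) (+-interchange _ _ _ _)

  Σsplit-*ˡ : ∀ F a h → Σsplit F (λ F₁ F₂ → a * h F₁ F₂) ≈ a * Σsplit F h
  Σsplit-*ˡ []       a h = refl
  Σsplit-*ˡ (x ∷ xs) a h = trans (+-congˡ (Σsplit-*ˡ xs a _)) (sym (distribˡ a _ _))

  Σsplit-*ʳ : ∀ F a h → Σsplit F (λ F₁ F₂ → h F₁ F₂ * a) ≈ Σsplit F h * a
  Σsplit-*ʳ F a h = trans (Σsplit-cong F (λ F₁ F₂ → *-comm _ _)) (trans (Σsplit-*ˡ F a h) (*-comm _ _))

  Σsplit-zero : ∀ F {h} → (∀ F₁ F₂ → h F₁ F₂ ≈ 0#) → Σsplit F h ≈ 0#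
  Σsplit-zero F h≈0 = trans (Σsplit-cong F (λ F₁ F₂ → trans (h≈0 F₁ F₂) (sym (zeroˡ 0#)))) (trans (Σsplit-*ˡ F 0# (λ _ _ → 0#)) (zeroˡ _))

  Σsplit-commute : ∀ {A : Set} {T : (A → Carrier) → Carrier} → IsLinear T →
    ∀ F (h : Forest m → Forest m → A → Carrier) → T (λ y → Σsplit F (λ F₁ F₂ → h F₁ F₂ y)) ≈ Σsplit F (λ F₁ F₂ → T (h F₁ F₂))
  Σsplit-commute T []       h = refl
  Σsplit-commute T (x ∷ xs) h = trans (+-hom T _ _) (+-congˡ (Σsplit-commute T xs _))

  Σsplit-assoc : ∀ F (H : Forest m → Forest m → Forest m → Carrier) →
    Σsplit F (λ F₁ F₃ → Σsplit F₁ (λ G₁ G₂ → H G₁ G₂ F₃)) ≈ Σsplit F (λ G₁ F₂ → Σsplit F₂ (λ G₂ F₃ → H G₁ G₂ F₃))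
  Σsplit-assoc []       H = refl
  Σsplit-assoc (x ∷ xs) H = begin
    H [] [] (x ∷ xs) + Σsplit xs (λ F₁ F₃ → H [] (x ∷ F₁) F₃ + Σsplit F₁ (λ G₁ G₂ → H (x ∷ G₁) G₂ F₃))
      ≈⟨ +-congˡ (Σsplit-+ xs _ _) ⟩
    H [] [] (x ∷ xs) + (Σsplit xs (λ F₁ F₃ → H [] (x ∷ F₁) F₃) + Σsplit xs (λ F₁ F₃ → Σsplit F₁ (λ G₁ G₂ → H (x ∷ G₁) G₂ F₃)))
      ≈⟨ +-assoc _ _ _ ⟨
    (H [] [] (x ∷ xs) + Σsplit xs (λ F₁ F₃ → H [] (x ∷ F₁) F₃)) + Σsplit xs (λ F₁ F₃ → Σsplit F₁ (λ G₁ G₂ → H (x ∷ G₁) G₂ F₃))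
      ≈⟨ +-congˡ (Σsplit-assoc xs (λ G₁ → H (x ∷ G₁))) ⟩
    (H [] [] (x ∷ xs) + Σsplit xs (λ F₁ F₃ → H [] (x ∷ F₁) F₃)) + Σsplit xs (λ G₁ F₂ → Σsplit F₂ (λ G₂ F₃ → H (x ∷ G₁) G₂ F₃)) ∎

  -- A child with root label r on an edge labelled p contributes to the solid schema nodeS a b (b ≠ e):
  -- itself when r ≠ e, and, when r = e, minus every factorisation a ⋆ b = p; this is how the fibre
  -- relations rewrite a unit-rooted child.
  rootWeight : (p r a b : Fin m) → Carrier
  rootWeight p r a b = 𝟙 (¬? (b ≟ e)) * (if ⌊ r ≟ e ⌋ then - 𝟙 (a ⋆ b ≟ p) else 𝟙 (p ≟ a) * 𝟙 (r ≟ b))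

  solidPart : (r p : Fin m) → Forest m → (Forest m → Carrier) → Carrier
  solidPart r p (nodeS a b G ∷ []) ψ = rootWeight p r a b * ψ G
  solidPart r p _                  ψ = 0#

  -- Ψ T F counts how T, with its unit-rooted children expanded by rootWeight, yields the forest F
  -- (coeff Y p F likewise for Y hanging from an edge labelled p); as a splitting sum over the
  -- children it is compatible with grafting.
  mutual
    coeff : Tree m → Fin m → Forest m → Carrier
    coeff leaf         p (leafS p′ ∷ []) = 𝟙 (p ≟ p′)
    coeff leaf         p _               = 0#
    coeff (node g l r) p F = solidPart (proj₁ g) p F (Ψ (node g l r)) + (𝟙 (p ≟ e) * 𝟙 (proj₁ g ≟ e)) * Ψ (node g l r) F

    Ψ : Tree m → Forest m → Carrier
    Ψ leaf                      F = 0#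
    Ψ (node (p₀ , p₁ , p₂) l r) F = Σsplit F (λ F₁ F₂ → coeff l p₁ F₁ * coeff r p₂ F₂)

  Φ : Fin m → Forest m → Tree m → Carrier
  Φ ρ F leaf               = 0#
  Φ ρ F T@(node g l r)     = 𝟙 (proj₁ g ≟ ρ) * Ψ T F

  rootWeight-fibre : ∀ z a b → Σ⋆ z (λ (x , y) → rootWeight x y a b) ≈ 0#
  rootWeight-fibre z a b with b ≟ e
  ... | yes _   = zero-hom (Σ⋆-linear z) (λ _ → zeroˡ _)
  ... | no b≢e  = begin
    Σ⋆ z (λ (x , y) → 1# * (if ⌊ y ≟ e ⌋ then - 𝟙 (a ⋆ b ≟ x) else 𝟙 (x ≟ a) * 𝟙 (y ≟ b)))
      ≈⟨ cong (Σ⋆-linear z) (λ (x , y) → trans (*-identityˡ _) (by-root x y (y ≟ e))) ⟩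
    Σ⋆ z (λ (x , y) → 𝟙 (x ≟ a) * 𝟙 (y ≟ b) - 𝟙 (y ≟ e) * 𝟙 (a ⋆ b ≟ x))
      ≈⟨ sub-hom (Σ⋆-linear z) (λ (x , y) → 𝟙 (x ≟ a) * 𝟙 (y ≟ b)) (λ (x , y) → 𝟙 (y ≟ e) * 𝟙 (a ⋆ b ≟ x)) ⟩
    Σ⋆ z (λ (x , y) → 𝟙 (x ≟ a) * 𝟙 (y ≟ b)) - Σ⋆ z (λ (x , y) → 𝟙 (y ≟ e) * 𝟙 (a ⋆ b ≟ x))
      ≈⟨ +-cong solid (-‿cong unit) ⟩
    𝟙 (a ⋆ b ≟ z) - 𝟙 (a ⋆ b ≟ z)
      ≈⟨ -‿inverseʳ _ ⟩
    0# ∎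
    where
    by-root : ∀ x y (d : Dec (y ≡ e)) → (if ⌊ d ⌋ then - 𝟙 (a ⋆ b ≟ x) else 𝟙 (x ≟ a) * 𝟙 (y ≟ b))
                                        ≈ 𝟙 (x ≟ a) * 𝟙 (y ≟ b) - 𝟙 d * 𝟙 (a ⋆ b ≟ x)
    by-root x y (yes ≡.refl) = sym (trans (+-cong (trans (*-congˡ (𝟙-no (e ≟ b) λ e≡b → b≢e (≡.sym e≡b))) (zeroʳ _))
                                                  (-‿cong (*-identityˡ _)))
                                          (+-identityˡ _))
    by-root x y (no _)       = sym (trans (+-congˡ (trans (-‿cong (zeroˡ _)) -0#≈0#)) (+-identityʳ _))
    solid : Σ⋆ z (λ (x , y) → 𝟙 (x ≟ a) * 𝟙 (y ≟ b)) ≈ 𝟙 (a ⋆ b ≟ z)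
    solid = trans (cong Σm-linear λ x → cong Σm-linear λ y → trans (*-comm _ _) (*-assoc _ _ _))
                  (δ-pair a b (λ x y → 𝟙 (x ⋆ y ≟ z)))
    unit : Σ⋆ z (λ (x , y) → 𝟙 (y ≟ e) * 𝟙 (a ⋆ b ≟ x)) ≈ 𝟙 (a ⋆ b ≟ z)
    unit = begin
      Σm (λ x → Σm (λ y → 𝟙 (x ⋆ y ≟ z) * (𝟙 (y ≟ e) * 𝟙 (a ⋆ b ≟ x))))
        ≈⟨ sumFin-commute Σm-linear m _ ⟩
      Σm (λ y → Σm (λ x → 𝟙 (x ⋆ y ≟ z) * (𝟙 (y ≟ e) * 𝟙 (a ⋆ b ≟ x))))
        ≈⟨ cong Σm-linear (λ y → cong Σm-linear λ x → *-exchange _ _ _) ⟩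
      Σm (λ y → Σm (λ x → 𝟙 (y ≟ e) * (𝟙 (x ⋆ y ≟ z) * 𝟙 (a ⋆ b ≟ x))))
        ≈⟨ δ-outer₁ e (λ y x → 𝟙 (x ⋆ y ≟ z) * 𝟙 (a ⋆ b ≟ x)) ⟩
      Σm (λ x → 𝟙 (x ⋆ e ≟ z) * 𝟙 (a ⋆ b ≟ x))
        ≈⟨ cong Σm-linear (λ x → *-congʳ (≡⇒≈ (≡.cong (λ t → 𝟙 (t ≟ z)) (⋆-identityʳ x)))) ⟩
      Σm (λ x → 𝟙 (x ≟ z) * 𝟙 (a ⋆ b ≟ x))
        ≈⟨ sumFin-δ m z _ ⟩
      𝟙 (a ⋆ b ≟ z) ∎

  unit-fibre : ∀ z → Σ⋆ z (λ (x , y) → 𝟙 (x ≟ e) * 𝟙 (y ≟ e)) ≈ 𝟙 (e ≟ z)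
  unit-fibre z = trans (cong Σm-linear λ x → cong Σm-linear λ y → trans (*-comm _ _) (*-assoc _ _ _))
                       (trans (δ-pair e e (λ x y → 𝟙 (x ⋆ y ≟ z))) (≡⇒≈ (≡.cong (λ t → 𝟙 (t ≟ z)) (⋆-identityʳ e))))

  solidPart-fibre : ∀ z F ψ → Σ⋆ z (λ (x , y) → solidPart y x F ψ) ≈ 0#
  solidPart-fibre z (nodeS a b G ∷ [])    ψ =
    trans (*ʳ-hom (Σ⋆-linear z) (ψ G) (λ (x , y) → rootWeight x y a b)) (trans (*-congʳ (rootWeight-fibre z a b)) (zeroˡ _))
  solidPart-fibre z []                    ψ = zero-hom (Σ⋆-linear z) (λ _ → refl)
  solidPart-fibre z (leafS _ ∷ _)         ψ = zero-hom (Σ⋆-linear z) (λ _ → refl)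
  solidPart-fibre z (nodeS _ _ _ ∷ _ ∷ _) ψ = zero-hom (Σ⋆-linear z) (λ _ → refl)

  coeff-fibre : ∀ z k₁ k₂ a b F →
    Σ⋆ z (λ (x , y) → coeff (node (y , k₁ , k₂) a b) x F) ≈ 𝟙 (e ≟ z) * Ψ (node (e , k₁ , k₂) a b) F
  coeff-fibre z k₁ k₂ a b F = begin
    Σ⋆ z (λ (x , y) → solidPart y x F ψ + (𝟙 (x ≟ e) * 𝟙 (y ≟ e)) * ψ F)
      ≈⟨ +-hom (Σ⋆-linear z) (λ (x , y) → solidPart y x F ψ) (λ (x , y) → (𝟙 (x ≟ e) * 𝟙 (y ≟ e)) * ψ F) ⟩
    Σ⋆ z (λ (x , y) → solidPart y x F ψ) + Σ⋆ z (λ (x , y) → (𝟙 (x ≟ e) * 𝟙 (y ≟ e)) * ψ F)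
      ≈⟨ +-cong (solidPart-fibre z F ψ) (trans (*ʳ-hom (Σ⋆-linear z) (ψ F) (λ (x , y) → 𝟙 (x ≟ e) * 𝟙 (y ≟ e))) (*-congʳ (unit-fibre z))) ⟩
    0# + 𝟙 (e ≟ z) * ψ F
      ≈⟨ +-identityˡ _ ⟩
    𝟙 (e ≟ z) * ψ F ∎
    where ψ = Ψ (node (e , k₁ , k₂) a b)

  private
    Σ⋆-Σsplitˡ : ∀ z F (c : Fin m × Fin m → Forest m → Carrier) (γ : Forest m → Carrier) →
      Σ⋆ z (λ p → Σsplit F (λ F₁ F₂ → c p F₁ * γ F₂)) ≈ Σsplit F (λ F₁ F₂ → Σ⋆ z (λ p → c p F₁) * γ F₂)
    Σ⋆-Σsplitˡ z F c γ = trans (Σsplit-commute (Σ⋆-linear z) F (λ F₁ F₂ p → c p F₁ * γ F₂))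
                               (Σsplit-cong F λ F₁ F₂ → *ʳ-hom (Σ⋆-linear z) (γ F₂) (λ p → c p F₁))

    Σ⋆-Σsplitʳ : ∀ z F (α : Forest m → Carrier) (c : Fin m × Fin m → Forest m → Carrier) →
      Σ⋆ z (λ p → Σsplit F (λ F₁ F₂ → α F₁ * c p F₂)) ≈ Σsplit F (λ F₁ F₂ → α F₁ * Σ⋆ z (λ p → c p F₂))
    Σ⋆-Σsplitʳ z F α c = trans (Σsplit-commute (Σ⋆-linear z) F (λ F₁ F₂ p → α F₁ * c p F₂))
                               (Σsplit-cong F λ F₁ F₂ → *-hom (Σ⋆-linear z) (α F₁) (λ p → c p F₂))

  -- The L-half and the R-half of a fibre produce the same double splitting sum, by associativity of splitting.
  Ψ-balanced : ∀ k a b d F → fibreSum k (λ q → Ψ (inst q a b d) F) ≈ 0#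
  Ψ-balanced (k₁ , k₂ , k₃ , k₄ , k₅ , k₆) a b d F = begin
    fibreSum (k₁ , k₂ , k₃ , k₄ , k₅ , k₆) (λ q → Ψ (inst q a b d) F)
      ≈⟨ fibreSum-decompose k₁ k₂ k₃ k₄ k₅ k₆ (λ q → Ψ (inst q a b d) F) ⟩
    𝟙 (e ≟ k₅) * Σ⋆ k₄ (λ (x , y) → Ψ (node (k₆ , x , k₃) (node (y , k₁ , k₂) a b) d) F)
    - 𝟙 (e ≟ k₄) * Σ⋆ k₅ (λ (x , y) → Ψ (node (k₆ , k₁ , x) a (node (y , k₂ , k₃) b d)) F)
      ≈⟨ +-cong (*-congˡ left) (-‿cong (*-congˡ right)) ⟩
    𝟙 (e ≟ k₅) * (𝟙 (e ≟ k₄) * Sₗ) - 𝟙 (e ≟ k₄) * (𝟙 (e ≟ k₅) * Sᵣ)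
      ≈⟨ +-congʳ (trans (*-exchange _ _ _) (*-congˡ (*-congˡ (Σsplit-assoc-coeff)))) ⟩
    𝟙 (e ≟ k₄) * (𝟙 (e ≟ k₅) * Sᵣ) - 𝟙 (e ≟ k₄) * (𝟙 (e ≟ k₅) * Sᵣ)
      ≈⟨ -‿inverseʳ _ ⟩
    0# ∎
    where
    α β γ : Forest m → Carrier
    α = coeff a k₁
    β = coeff b k₂
    γ = coeff d k₃
    Sₗ Sᵣ : Carrier
    Sₗ = Σsplit F (λ F₁ F₂ → Σsplit F₁ (λ G₁ G₂ → α G₁ * β G₂) * γ F₂)
    Sᵣ = Σsplit F (λ F₁ F₂ → α F₁ * Σsplit F₂ (λ G₁ G₂ → β G₁ * γ G₂))
    left : Σ⋆ k₄ (λ (x , y) → Ψ (node (k₆ , x , k₃) (node (y , k₁ , k₂) a b) d) F) ≈ 𝟙 (e ≟ k₄) * Sₗ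
    left = trans (Σ⋆-Σsplitˡ k₄ F (λ (x , y) → coeff (node (y , k₁ , k₂) a b) x) γ)
                 (trans (Σsplit-cong F λ F₁ F₂ → trans (*-congʳ (coeff-fibre k₄ k₁ k₂ a b F₁)) (*-assoc _ _ _)) (Σsplit-*ˡ F _ _))
    right : Σ⋆ k₅ (λ (x , y) → Ψ (node (k₆ , k₁ , x) a (node (y , k₂ , k₃) b d)) F) ≈ 𝟙 (e ≟ k₅) * Sᵣ
    right = trans (Σ⋆-Σsplitʳ k₅ F α (λ (x , y) → coeff (node (y , k₂ , k₃) b d) x))
                  (trans (Σsplit-cong F λ F₁ F₂ → trans (*-congˡ (coeff-fibre k₅ k₂ k₃ b d F₂)) (*-exchange _ _ _)) (Σsplit-*ˡ F _ _))
    Σsplit-assoc-coeff : Sₗ ≈ Sᵣ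
    Σsplit-assoc-coeff = begin
      Σsplit F (λ F₁ F₂ → Σsplit F₁ (λ G₁ G₂ → α G₁ * β G₂) * γ F₂)
        ≈⟨ Σsplit-cong F (λ F₁ F₂ → sym (Σsplit-*ʳ F₁ (γ F₂) (λ G₁ G₂ → α G₁ * β G₂))) ⟩
      Σsplit F (λ F₁ F₂ → Σsplit F₁ (λ G₁ G₂ → (α G₁ * β G₂) * γ F₂))
        ≈⟨ Σsplit-assoc F (λ G₁ G₂ F₂ → (α G₁ * β G₂) * γ F₂) ⟩
      Σsplit F (λ G₁ F′ → Σsplit F′ (λ G₂ F₂ → (α G₁ * β G₂) * γ F₂))
        ≈⟨ Σsplit-cong F (λ G₁ F′ → trans (Σsplit-cong F′ (λ G₂ F₂ → *-assoc _ _ _))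
                                          (Σsplit-*ˡ F′ (α G₁) (λ G₂ F₂ → β G₂ * γ F₂))) ⟩
      Σsplit F (λ F₁ F₂ → α F₁ * Σsplit F₂ (λ G₁ G₂ → β G₁ * γ G₂)) ∎

  Coherent : Clique3 m → Fin m → (T3 m → Tree m) → Set ℓ
  Coherent k ρ X = (∀ q → compose q ≡ k → rootLabel (X q) ≡ just ρ) × (∀ F → fibreSum k (λ q → Ψ (X q) F) ≈ 0#)

  private
    coeff-root : ∀ T ρ → rootLabel T ≡ just ρ → ∀ p F → coeff T p F ≈ solidPart ρ p F (Ψ T) + (𝟙 (p ≟ e) * 𝟙 (ρ ≟ e)) * Ψ T F
    coeff-root (node (ρ , _ , _) l r) .ρ ≡.refl p F = refl

    coeff-balanced : ∀ {k ρ X} → Coherent k ρ X → ∀ p F → fibreSum k (λ q → coeff (X q) p F) ≈ 0#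
    coeff-balanced {k} {ρ} {X} (root , balanced) p F = begin
      fibreSum k (λ q → coeff (X q) p F)
        ≈⟨ fibreSum-cong k (λ q q∈k → coeff-root (X q) ρ (root q q∈k) p F) ⟩
      fibreSum k (λ q → solidPart ρ p F (Ψ (X q)) + (𝟙 (p ≟ e) * 𝟙 (ρ ≟ e)) * Ψ (X q) F)
        ≈⟨ +-hom (fibreSum-linear k) (λ q → solidPart ρ p F (Ψ (X q))) (λ q → (𝟙 (p ≟ e) * 𝟙 (ρ ≟ e)) * Ψ (X q) F) ⟩
      fibreSum k (λ q → solidPart ρ p F (Ψ (X q))) + fibreSum k (λ q → (𝟙 (p ≟ e) * 𝟙 (ρ ≟ e)) * Ψ (X q) F)
        ≈⟨ +-cong (solid F) (trans (*-hom (fibreSum-linear k) (𝟙 (p ≟ e) * 𝟙 (ρ ≟ e)) (λ q → Ψ (X q) F))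
                                   (trans (*-congˡ (balanced F)) (zeroʳ _))) ⟩
      0# + 0#
        ≈⟨ +-identityʳ 0# ⟩
      0# ∎
      where
      solid : ∀ F → fibreSum k (λ q → solidPart ρ p F (Ψ (X q))) ≈ 0#
      solid (nodeS a b G ∷ [])    = trans (*-hom (fibreSum-linear k) (rootWeight p ρ a b) (λ q → Ψ (X q) G)) (trans (*-congˡ (balanced G)) (zeroʳ _))
      solid []                    = zero-hom (fibreSum-linear k) (λ _ → refl)
      solid (leafS _ ∷ _)         = zero-hom (fibreSum-linear k) (λ _ → refl)
      solid (nodeS _ _ _ ∷ _ ∷ _) = zero-hom (fibreSum-linear k) (λ _ → refl)

  coherent-inL : ∀ {k ρ X} → Coherent k ρ X → ∀ g r → Coherent k (proj₁ g) (λ q → node g (X q) r)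
  coherent-inL {k} {X = X} coh (g₀ , g₁ , g₂) r = (λ _ _ → ≡.refl) , λ F →
    trans (Σsplit-commute (fibreSum-linear k) F (λ F₁ F₂ q → coeff (X q) g₁ F₁ * coeff r g₂ F₂))
          (Σsplit-zero F λ F₁ F₂ → trans (*ʳ-hom (fibreSum-linear k) (coeff r g₂ F₂) (λ q → coeff (X q) g₁ F₁))
                                         (trans (*-congʳ (coeff-balanced coh g₁ F₁)) (zeroˡ _)))

  coherent-inR : ∀ {k ρ X} → Coherent k ρ X → ∀ g l → Coherent k (proj₁ g) (λ q → node g l (X q))
  coherent-inR {k} {X = X} coh (g₀ , g₁ , g₂) l = (λ _ _ → ≡.refl) , λ F →
    trans (Σsplit-commute (fibreSum-linear k) F (λ F₁ F₂ q → coeff l g₁ F₁ * coeff (X q) g₂ F₂))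
          (Σsplit-zero F λ F₁ F₂ → trans (*-hom (fibreSum-linear k) (coeff l g₁ F₁) (λ q → coeff (X q) g₂ F₂))
                                         (trans (*-congˡ (coeff-balanced coh g₂ F₂)) (zeroʳ _)))

  coherent-fill : ∀ {k ρ X} → Coherent k ρ X → ∀ C → Σ (Fin m) λ ρ′ → Coherent k ρ′ (λ q → fill C (X q))
  coherent-fill coh hole        = _ , coh
  coherent-fill coh (inL g C r) = proj₁ g , coherent-inL (proj₂ (coherent-fill coh C)) g r
  coherent-fill coh (inR g l C) = proj₁ g , coherent-inR (proj₂ (coherent-fill coh C)) g l

  coherent-inst : ∀ k a b d → Coherent k (proj₂ (proj₂ (proj₂ (proj₂ (proj₂ k))))) (λ q → inst q a b d)
  coherent-inst k a b d = root , Ψ-balanced k a b d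
    where
    root : ∀ q → compose q ≡ k → rootLabel (inst q a b d) ≡ just (proj₂ (proj₂ (proj₂ (proj₂ (proj₂ k)))))
    root (L _ _) ≡.refl = ≡.refl
    root (R _ _) ≡.refl = ≡.refl

  Φ-balanced : ∀ {k ρ X} → Coherent k ρ X → ∀ ρ′ F → fibreSum k (λ q → Φ ρ′ F (X q)) ≈ 0#
  Φ-balanced {k} {ρ} {X} (root , balanced) ρ′ F =
    trans (fibreSum-cong k (λ q q∈k → Φ-root (X q) (root q q∈k)))
          (trans (*-hom (fibreSum-linear k) (𝟙 (ρ ≟ ρ′)) (λ q → Ψ (X q) F)) (trans (*-congˡ (balanced F)) (zeroʳ _)))
    where
    Φ-root : ∀ T → rootLabel T ≡ just ρ → Φ ρ′ F T ≈ 𝟙 (ρ ≟ ρ′) * Ψ T F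
    Φ-root (node _ _ _) ≡.refl = refl

  functional : ℕ → Fin m → Forest m → Vect → Carrier
  functional n ρ F x = treeSum n n (λ T → Φ ρ F T * x T)

  functional-linear : ∀ n ρ F → IsLinear (functional n ρ F)
  functional-linear n ρ F = scale-linear (treeSum-linear n n) (Φ ρ F)

  functional-δ : ∀ n ρ F T → leaves T ≡ n → functional n ρ F (δ T) ≈ Φ ρ F T
  functional-δ n ρ F T lT = begin
    treeSum n n (λ T′ → Φ ρ F T′ * δ T T′)  ≈⟨ cong (treeSum-linear n n) (λ T′ → *-comm _ _) ⟩
    treeSum n n (λ T′ → δ T T′ * Φ ρ F T′)  ≈⟨ treeSum-δ n n T (Φ ρ F) (ℕP.≤-reflexive lT) ⟩
    𝟙 (leaves T ℕ.≟ n) * Φ ρ F T            ≈⟨ trans (*-congʳ (𝟙-yes (leaves T ℕ.≟ n) lT)) (*-identityˡ _) ⟩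
    Φ ρ F T                                 ∎

  functional-kills-ideal : ∀ n ρ F {x} → InIdeal n x → functional n ρ F x ≈ 0#
  functional-kills-ideal n ρ F = linear-kills-ideal (functional-linear n ρ F) kills-generator
    where
    kills-generator : ∀ G → functional n ρ F (IdealGen.vec G) ≈ 0#
    kills-generator G = begin
      functional n ρ F (λ T → sumT3 (λ q → w q * δ (X q) T))
        ≈⟨ sumT3-commute (functional-linear n ρ F) (λ q T → w q * δ (X q) T) ⟩
      sumT3 (λ q → functional n ρ F (λ T → w q * δ (X q) T))
        ≈⟨ cong sumT3-linear (λ q → trans (*-hom (functional-linear n ρ F) (w q) (δ (X q))) (*-congˡ (functional-δ n ρ F (X q) (arity q)))) ⟩
      sumT3 (λ q → w q * Φ ρ F (X q))
        ≈⟨ R⊥-annihilates-balanced (λ q → Φ ρ F (X q)) (λ k → Φ-balanced (proj₂ (coherent-fill (coherent-inst k a b d) ctx)) ρ F) w perp ⟩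
      0# ∎
      where
      open IdealGen G
      X : T3 m → Tree m
      X q = fill ctx (inst q a b d)

module Triangularity {c ℓ} (K : CharZeroField c ℓ) {m : ℕ} (_⋆_ : Op₂ (Fin m)) (e : Fin m)
   (⋆-identityʳ : ∀ x → x ⋆ e ≡ x) where
  open import Data.Nat using (ℕ)
  open import Data.Fin using (Fin)
  open import Relation.Binary.PropositionalEquality using (_≡_)

  open import Data.Nat as ℕ using (suc; _≤_; _<_; _≤?_)
  open import Data.Nat using () renaming (_+_ to _+ℕ_)
  import Data.Nat.Properties as ℕP
  open import Data.List using ([]; _∷_; _++_)
  open import Data.Product using (_×_; _,_; proj₁; proj₂)
  open import Data.Product.Properties using (≡-dec)
  open import Relation.Nullary using (¬_; ¬?; Dec; yes; no; contradiction)
  open import Relation.Binary.PropositionalEquality as ≡ using ()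
  open Trees
  open Linear K _⋆_ e
  open import Data.Fin using (_≟_)
  open NormalForms e
  open Functionals K _⋆_ e ⋆-identityʳ

  𝟙-solidCount : ∀ F U → ¬ solidCount F ≡ solidCount U → 𝟙 (F ≟F U) ≈ 0#
  𝟙-solidCount F U ≢ = 𝟙-no (F ≟F U) (λ F≡U → ≢ (≡.cong solidCount F≡U))

  Σsplit-cong-on : ∀ F {h h′} → (∀ F₁ F₂ → F₁ ++ F₂ ≡ F → h F₁ F₂ ≈ h′ F₁ F₂) → Σsplit F h ≈ Σsplit F h′
  Σsplit-cong-on []       h≈h′ = h≈h′ [] [] ≡.refl
  Σsplit-cong-on (x ∷ xs) h≈h′ = +-cong (h≈h′ [] (x ∷ xs) ≡.refl) (Σsplit-cong-on xs (λ F₁ F₂ eq → h≈h′ (x ∷ F₁) F₂ (≡.cong (x ∷_) eq)))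

  Σsplit-δ : ∀ F U V → Σsplit F (λ F₁ F₂ → 𝟙 (F₁ ≟F U) * 𝟙 (F₂ ≟F V)) ≈ 𝟙 (F ≟F U ++ V)
  Σsplit-δ []       []       V = *-identityˡ _
  Σsplit-δ []       (u ∷ us) V = zeroˡ _
  Σsplit-δ (x ∷ xs) []       V = trans (+-cong (*-identityˡ _) (Σsplit-zero xs (λ _ _ → zeroˡ _))) (+-identityʳ _)
  Σsplit-δ (x ∷ xs) (u ∷ us) V = begin
    0# * 𝟙 ((x ∷ xs) ≟F V) + Σsplit xs (λ F₁ F₂ → 𝟙 ((x ∷ F₁) ≟F (u ∷ us)) * 𝟙 (F₂ ≟F V))
      ≈⟨ trans (+-congʳ (zeroˡ _)) (+-identityˡ _) ⟩
    Σsplit xs (λ F₁ F₂ → 𝟙 ((x ∷ F₁) ≟F (u ∷ us)) * 𝟙 (F₂ ≟F V))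
      ≈⟨ Σsplit-cong xs (λ F₁ F₂ → trans (*-congʳ (𝟙-∷ F₁ us)) (*-assoc _ _ _)) ⟩
    Σsplit xs (λ F₁ F₂ → 𝟙 (x ≟S u) * (𝟙 (F₁ ≟F us) * 𝟙 (F₂ ≟F V)))
      ≈⟨ Σsplit-*ˡ xs _ _ ⟩
    𝟙 (x ≟S u) * Σsplit xs (λ F₁ F₂ → 𝟙 (F₁ ≟F us) * 𝟙 (F₂ ≟F V))
      ≈⟨ *-congˡ (Σsplit-δ xs us V) ⟩
    𝟙 (x ≟S u) * 𝟙 (xs ≟F us ++ V)
      ≈⟨ 𝟙-∷ xs (us ++ V) ⟨
    𝟙 ((x ∷ xs) ≟F (u ∷ us ++ V)) ∎
    where
    𝟙-∷ : ∀ F G → 𝟙 ((x ∷ F) ≟F (u ∷ G)) ≈ 𝟙 (x ≟S u) * 𝟙 (F ≟F G)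
    𝟙-∷ F G = trans (𝟙-cong ((x ∷ F) ≟F (u ∷ G)) (≡-dec _≟S_ _≟F_ (x , F) (u , G))
                            (λ { ≡.refl → ≡.refl }) (λ { ≡.refl → ≡.refl }))
                    (𝟙-pair _ (x ≟S u) (F ≟F G))

  private
    nodeS-≡ : ∀ {a b a′ b′ : Fin m} {G G′} → nodeS a b G ∷ [] ≡ nodeS a′ b′ G′ ∷ [] → a ≡ a′ × b ≡ b′ × G ≡ G′
    nodeS-≡ ≡.refl = ≡.refl , ≡.refl , ≡.refl

  𝟙-solid-schema : ∀ p r₀ a b G U → ¬ r₀ ≡ e →
    rootWeight p r₀ a b * 𝟙 (G ≟F U) ≈ 𝟙 (nodeS a b G ∷ [] ≟F nodeS p r₀ U ∷ [])
  𝟙-solid-schema p r₀ a b G U r₀≢e with r₀ ≟ e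
  ... | yes r₀≡e = contradiction r₀≡e r₀≢e
  ... | no _     = by-cases (p ≟ a) (r₀ ≟ b) (G ≟F U)
    where
    d = nodeS a b G ∷ [] ≟F nodeS p r₀ U ∷ []
    by-cases : (d₁ : Dec (p ≡ a)) (d₂ : Dec (r₀ ≡ b)) (d₃ : Dec (G ≡ U)) → 𝟙 (¬? (b ≟ e)) * (𝟙 d₁ * 𝟙 d₂) * 𝟙 d₃ ≈ 𝟙 d
    by-cases (yes ≡.refl) (yes ≡.refl) (yes ≡.refl) =
      trans (*-congʳ (trans (*-congʳ (𝟙-yes (¬? (r₀ ≟ e)) r₀≢e)) (trans (*-identityˡ _) (*-identityˡ _))))
            (trans (*-identityˡ _) (sym (𝟙-yes d ≡.refl)))
    by-cases (no p≢a) _ _ =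
      trans (trans (*-congʳ (trans (*-congˡ (zeroˡ _)) (zeroʳ _))) (zeroˡ _)) (sym (𝟙-no d λ eq → p≢a (≡.sym (proj₁ (nodeS-≡ eq)))))
    by-cases (yes _) (no r₀≢b) _ =
      trans (trans (*-congʳ (trans (*-congˡ (zeroʳ _)) (zeroʳ _))) (zeroˡ _)) (sym (𝟙-no d λ eq → r₀≢b (≡.sym (proj₁ (proj₂ (nodeS-≡ eq))))))
    by-cases (yes _) (yes _) (no G≢U) =
      trans (zeroʳ _) (sym (𝟙-no d λ eq → G≢U (proj₂ (proj₂ (nodeS-≡ eq)))))

  Hangs : Fin m → Tree m → Set
  Hangs p Y = UnitRoot Y → p ≡ e

  private
    count-singleton : ∀ a b G → solidCount (nodeS a b G ∷ []) ≡ suc (solidCount G)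
    count-singleton a b G = ≡.cong suc (ℕP.+-identityʳ (solidCount G))

    coeff-leaf : ∀ p F → coeff leaf p F ≈ 𝟙 (F ≟F leafS p ∷ [])
    coeff-leaf p (leafS p′ ∷ [])   = 𝟙-cong (p ≟ p′) (leafS p′ ∷ [] ≟F leafS p ∷ []) (λ { ≡.refl → ≡.refl }) (λ { ≡.refl → ≡.refl })
    coeff-leaf p []                  = refl
    coeff-leaf p F@(leafS _ ∷ _ ∷ _) = sym (𝟙-no (F ≟F leafS p ∷ []) λ ())
    coeff-leaf p (nodeS _ _ _ ∷ _)   = refl

    split-bound : ∀ {a b c′ d} → a +ℕ b ≤ c′ +ℕ d → ¬ b ≤ d → a < c′
    split-bound le b≰d = ℕP.≰⇒> λ c′≤a → ℕP.<⇒≱ (ℕP.+-mono-≤-< c′≤a (ℕP.≰⇒> b≰d)) le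

  mutual
    coeff-triangular : ∀ Y p → Normal Y → Hangs p Y → ∀ F → solidCount F ≤ solidCount (branch Y p) →
                       coeff Y p F ≈ 𝟙 (F ≟F branch Y p)
    coeff-triangular leaf p _ _ F _ = coeff-leaf p F
    coeff-triangular (node g@(r₀ , q₁ , q₂) l r) p n hangs F le with r₀ ≟ e
    ... | no r₀≢e = trans (+-congˡ (trans (*-congʳ (zeroʳ _)) (zeroˡ _))) (trans (+-identityʳ _) (solid F le))
      where
      Fₙ = forest (node g l r)
      solid : ∀ F → solidCount F ≤ solidCount (nodeS p r₀ Fₙ ∷ []) → solidPart r₀ p F (Ψ (node g l r)) ≈ 𝟙 (F ≟F nodeS p r₀ Fₙ ∷ [])
      solid (nodeS a b G ∷ [])    le = trans (*-congˡ (Ψ-triangular g l r n G G≤Fₙ)) (𝟙-solid-schema p r₀ a b G Fₙ r₀≢e)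
        where G≤Fₙ = ℕP.≤-pred (≡.subst₂ _≤_ (count-singleton a b G) (count-singleton p r₀ Fₙ) le)
      solid []                      _ = refl
      solid (leafS _ ∷ _)           _ = refl
      solid F@(nodeS _ _ _ ∷ _ ∷ _) _ = sym (𝟙-no (F ≟F nodeS p r₀ Fₙ ∷ []) λ ())
    ... | yes ≡.refl with hangs ≡.refl
    ...   | ≡.refl = begin
      solidPart e e F (Ψ (node g l r)) + (𝟙 (e ≟ e) * 1#) * Ψ (node g l r) F
        ≈⟨ +-cong (solid F le) (trans (*-congʳ (trans (*-identityʳ _) (𝟙-yes (e ≟ e) ≡.refl))) (*-identityˡ _)) ⟩
      0# + Ψ (node g l r) F
        ≈⟨ trans (+-identityˡ _) (Ψ-triangular g l r n F le) ⟩
      𝟙 (F ≟F forest (node g l r)) ∎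
      where
      Fₙ = forest (node g l r)
      solid : ∀ F → solidCount F ≤ solidCount Fₙ → solidPart e e F (Ψ (node g l r)) ≈ 0#
      solid (nodeS a b G ∷ [])    le = trans (*-congˡ (trans (Ψ-triangular g l r n G (ℕP.<⇒≤ G<Fₙ)) (𝟙-solidCount G Fₙ (ℕP.<⇒≢ G<Fₙ)))) (zeroʳ _)
        where G<Fₙ = ℕP.<-≤-trans (ℕP.≤-reflexive (≡.sym (count-singleton a b G))) le
      solid []                    _ = refl
      solid (leafS _ ∷ _)         _ = refl
      solid (nodeS _ _ _ ∷ _ ∷ _) _ = refl

    Ψ-triangular : ∀ g l r → Normal (node g l r) → ∀ F → solidCount F ≤ solidCount (forest (node g l r)) →
                   Ψ (node g l r) F ≈ 𝟙 (F ≟F forest (node g l r))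
    Ψ-triangular (p₀ , p₁ , p₂) l r (node ¬uₗ hangsᵣ nₗ nᵣ) F le =
      trans (Σsplit-cong-on F product) (Σsplit-δ F U V)
      where
      U = branch l p₁
      V = branch r p₂
      product : ∀ F₁ F₂ → F₁ ++ F₂ ≡ F → coeff l p₁ F₁ * coeff r p₂ F₂ ≈ 𝟙 (F₁ ≟F U) * 𝟙 (F₂ ≟F V)
      product F₁ F₂ split = by-bounds (solidCount F₁ ≤? solidCount U) (solidCount F₂ ≤? solidCount V)
        where
        bound : solidCount F₁ +ℕ solidCount F₂ ≤ solidCount U +ℕ solidCount V
        bound = ≡.subst₂ _≤_ (≡.trans (≡.cong solidCount (≡.sym split)) (solidCount-++ F₁ F₂)) (solidCount-++ U V) le
        triₗ : solidCount F₁ ≤ solidCount U → coeff l p₁ F₁ ≈ 𝟙 (F₁ ≟F U)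
        triₗ = coeff-triangular l p₁ nₗ (λ u → contradiction u ¬uₗ) F₁
        triᵣ : solidCount F₂ ≤ solidCount V → coeff r p₂ F₂ ≈ 𝟙 (F₂ ≟F V)
        triᵣ = coeff-triangular r p₂ nᵣ hangsᵣ F₂
        by-bounds : Dec (solidCount F₁ ≤ solidCount U) → Dec (solidCount F₂ ≤ solidCount V) →
                    coeff l p₁ F₁ * coeff r p₂ F₂ ≈ 𝟙 (F₁ ≟F U) * 𝟙 (F₂ ≟F V)
        by-bounds (yes F₁≤U) (yes F₂≤V) = *-cong (triₗ F₁≤U) (triᵣ F₂≤V)
        by-bounds (yes F₁≤U) (no F₂≰V)  = trans (*-congʳ (trans (triₗ F₁≤U) F₁≢U)) (trans (zeroˡ _) (sym (trans (*-congʳ F₁≢U) (zeroˡ _))))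
          where
          F₁<U = split-bound bound F₂≰V
          F₁≢U = 𝟙-solidCount F₁ U (ℕP.<⇒≢ F₁<U)
        by-bounds (no F₁≰U)  _          = trans (*-congˡ (trans (triᵣ (ℕP.<⇒≤ F₂<V)) F₂≢V)) (trans (zeroʳ _) (sym (trans (*-congˡ F₂≢V) (zeroʳ _))))
          where
          F₂<V = split-bound (≡.subst₂ _≤_ (ℕP.+-comm (solidCount F₁) _) (ℕP.+-comm (solidCount U) _) bound) F₁≰U
          F₂≢V = 𝟙-solidCount F₂ V (ℕP.<⇒≢ F₂<V)

module Independence {c ℓ} (K : CharZeroField c ℓ) {m : ℕ} (_⋆_ : Op₂ (Fin m)) (e : Fin m)
   (⋆-identityʳ : ∀ x → x ⋆ e ≡ x) (n k : ℕ) (basis : Fin k → Tree m)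
   (basis-normal : ∀ i → NormalForms.Normal e (basis i))
   (basis-arity : ∀ i → leaves (basis i) ≡ n)
   (basis-injective : ∀ {i j} → basis i ≡ basis j → i ≡ j) where
  open import Data.Nat using (ℕ)
  open import Data.Fin using (Fin)
  open import Relation.Binary.PropositionalEquality using (_≡_)

  open import Data.Nat using (suc; _≤_; _<_; _≤?_)
  import Data.Nat.Properties as ℕP
  open import Data.Fin using (_≟_)
  open import Data.Product using (proj₁)
  open import Relation.Nullary using (¬_; Dec; yes; no)
  open import Relation.Binary.PropositionalEquality as ≡ using ()
  open Trees
  open Linear K _⋆_ e
  open NormalForms e
  open Functionals K _⋆_ e ⋆-identityʳ
  open Triangularity K _⋆_ e ⋆-identityʳ

  v : Fin k → Vect
  v i = δ (basis i)

  functional-comb : ∀ ρ F κ → functional n ρ F (comb κ v) ≈ sumFin k (λ j → κ j * Φ ρ F (basis j))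
  functional-comb ρ F κ = trans (sumFin-commute (functional-linear n ρ F) k (λ j T → κ j * v j T))
    (cong (sumFin-linear k) λ j → trans (*-hom (functional-linear n ρ F) (κ j) (v j)) (*-congˡ (functional-δ n ρ F (basis j) (basis-arity j))))

  private
    fill-inst≢leaf : ∀ C q (a b d : Tree m) → ¬ fill C (inst q a b d) ≡ leaf
    fill-inst≢leaf hole (L _ _) a b d ()
    fill-inst≢leaf hole (R _ _) a b d ()
    fill-inst≢leaf (inL _ _ _) q a b d ()
    fill-inst≢leaf (inR _ _ _) q a b d ()

  ideal-at-leaf : ∀ {x} → InIdeal n x → x leaf ≈ 0#
  ideal-at-leaf = linear-kills-ideal (eval-linear leaf) λ G → let open IdealGen G in
    zero-hom sumT3-linear {f = λ q → w q * δ (fill ctx (inst q a b d)) leaf} λ q →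
      trans (*-congˡ (𝟙-no (fill ctx (inst q a b d) ≟T leaf) (fill-inst≢leaf ctx q a b d))) (zeroʳ _)

  Φ-basis : ∀ {i gᵢ lᵢ rᵢ} → basis i ≡ node gᵢ lᵢ rᵢ → ∀ j → solidCount (forest (node gᵢ lᵢ rᵢ)) ≤ solidCount (forest (basis j)) →
            Φ (proj₁ gᵢ) (forest (node gᵢ lᵢ rᵢ)) (basis j) ≈ 𝟙 (j ≟ i)
  Φ-basis {i} {gᵢ} {lᵢ} {rᵢ} bᵢ≡ j Fᵢ≤Fⱼ with basis j in bⱼ≡
  ... | leaf = sym (𝟙-no (j ≟ i) (≢i bⱼ≡ λ ()))
    where
    ≢i : ∀ {T} → basis j ≡ T → ¬ T ≡ node gᵢ lᵢ rᵢ → ¬ j ≡ i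
    ≢i bⱼ≡T T≢ ≡.refl = T≢ (≡.trans (≡.sym bⱼ≡T) bᵢ≡)
  ... | node gⱼ lⱼ rⱼ =
    trans (*-congˡ (Ψ-triangular gⱼ lⱼ rⱼ (normal bⱼ≡) Fᵢ Fᵢ≤Fⱼ)) (by-cases (proj₁ gⱼ ≟ ρ) (Fᵢ ≟F forest (node gⱼ lⱼ rⱼ)))
    where
    ρ = proj₁ gᵢ
    Fᵢ = forest (node gᵢ lᵢ rᵢ)
    normal : ∀ {i g l r} → basis i ≡ node g l r → Normal (node g l r)
    normal {i} b≡ = ≡.subst Normal b≡ (basis-normal i)
    ≢i : ¬ node gⱼ lⱼ rⱼ ≡ node gᵢ lᵢ rᵢ → ¬ j ≡ i
    ≢i T≢ ≡.refl = T≢ (≡.trans (≡.sym bⱼ≡) bᵢ≡)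
    by-cases : (d₁ : Dec (proj₁ gⱼ ≡ ρ)) (d₂ : Dec (Fᵢ ≡ forest (node gⱼ lⱼ rⱼ))) → 𝟙 d₁ * 𝟙 d₂ ≈ 𝟙 (j ≟ i)
    by-cases (yes root≡) (yes Fᵢ≡Fⱼ) = trans (*-identityˡ 1#) (sym (𝟙-yes (j ≟ i) (basis-injective same-basis)))
      where
      same-basis : basis j ≡ basis i
      same-basis = ≡.trans bⱼ≡ (≡.trans (≡.sym (decode-forest (normal bⱼ≡)))
                   (≡.trans (≡.cong₂ decode root≡ (≡.sym Fᵢ≡Fⱼ)) (≡.trans (decode-forest (normal bᵢ≡)) (≡.sym bᵢ≡))))
    by-cases (no root≢)  _          = trans (zeroˡ _) (sym (𝟙-no (j ≟ i) (≢i λ eq → root≢ (≡.cong proj₁ (proj₁ (node-inj eq))))))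
    by-cases (yes _)     (no Fᵢ≢Fⱼ) = trans (zeroʳ _) (sym (𝟙-no (j ≟ i) (≢i λ eq → Fᵢ≢Fⱼ (≡.cong forest (≡.sym eq)))))

  module _ (κ : Fin k → Carrier) (κ∈I : InIdeal n (comb κ v)) where

    private
      extract : ∀ i (φ : Tree m → Carrier) → (∀ j → κ j * φ (basis j) ≈ 𝟙 (j ≟ i) * κ j) →
                sumFin k (λ j → κ j * φ (basis j)) ≈ 0# → κ i ≈ 0#
      extract i φ term sum≈0 = begin
        κ i                                       ≈⟨ sumFin-δ k i κ ⟨
        sumFin k (λ j → 𝟙 (j ≟ i) * κ j)          ≈⟨ cong (sumFin-linear k) term ⟨
        sumFin k (λ j → κ j * φ (basis j))        ≈⟨ sum≈0 ⟩
        0#                                        ∎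

      leaf-coefficient : ∀ i → basis i ≡ leaf → κ i ≈ 0#
      leaf-coefficient i bᵢ≡leaf = extract i (λ T → δ T leaf) term (ideal-at-leaf κ∈I)
        where
        term : ∀ j → κ j * δ (basis j) leaf ≈ 𝟙 (j ≟ i) * κ j
        term j = trans (*-comm _ _) (*-congʳ (𝟙-cong (basis j ≟T leaf) (j ≟ i)
                   (λ bⱼ≡leaf → basis-injective (≡.trans bⱼ≡leaf (≡.sym bᵢ≡leaf)))
                   (λ { ≡.refl → bᵢ≡leaf })))

    independent : ∀ i → κ i ≈ 0#
    independent i = by-count (suc (solidCount (forest (basis i)))) i (ℕP.n<1+n _)
      where
      by-count : ∀ s i → solidCount (forest (basis i)) < s → κ i ≈ 0#
      by-count (suc s) i count< with basis i in bᵢ≡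
      ... | leaf = leaf-coefficient i bᵢ≡
      ... | node gᵢ lᵢ rᵢ = extract i (Φ ρ Fᵢ) term (trans (sym (functional-comb ρ Fᵢ κ)) (functional-kills-ideal n ρ Fᵢ κ∈I))
        where
        ρ = proj₁ gᵢ
        Fᵢ = forest (node gᵢ lᵢ rᵢ)
        term : ∀ j → κ j * Φ ρ Fᵢ (basis j) ≈ 𝟙 (j ≟ i) * κ j
        term j with solidCount Fᵢ ≤? solidCount (forest (basis j))
        ... | yes Fᵢ≤Fⱼ = trans (*-congˡ (Φ-basis bᵢ≡ j Fᵢ≤Fⱼ)) (*-comm _ _)
        ... | no Fᵢ≰Fⱼ = trans (*-congʳ κⱼ≈0) (trans (zeroˡ _) (sym (trans (*-congˡ κⱼ≈0) (zeroʳ _))))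
          where
          κⱼ≈0 : κ j ≈ 0#
          κⱼ≈0 = by-count s j (ℕP.<-≤-trans (ℕP.≰⇒> Fᵢ≰Fⱼ) (ℕP.≤-pred count<))

module Enumeration {m′ : ℕ} (e : Fin (suc m′)) where
  open import Data.Nat using (ℕ; suc)
  open import Data.Fin using (Fin)
  open import Relation.Binary.PropositionalEquality using (_≡_)

  open import Data.Nat using (zero; _+_; _∸_; _≤_; s≤s; z≤n)
  import Data.Nat.Properties as ℕP
  import Data.Maybe.Properties as MaybeP
  open import Data.Fin using (toℕ; fromℕ<; punchIn; punchOut)
  import Data.Fin.Properties as FinP
  open import Data.Maybe using (just)
  open import Data.Sum using (inj₁; inj₂)
  open import Data.Product using (Σ; _×_; _,_; proj₁; proj₂)
  open import Data.Unit using (tt)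
  open import Relation.Nullary using (¬_; Dec; yes; no; contradiction)
  open import Relation.Binary.PropositionalEquality as ≡ using (refl; cong; cong₂)
  open Trees
  open FiniteSets
  open Codes m′
  open import Function.Bundles using (Inverse)
  open NormalForms e

  private
    m = suc m′

  mutual
    rooted : ∀ fuel n → Fin m → El (Rooted fuel n) → Tree m
    rooted (suc fuel) n ρ (i , p₁ , inj₁ (p₂ , l , r)) = node (ρ , p₁ , p₂) (nonUnit fuel (toℕ i) l) (nonUnit fuel (n ∸ toℕ i) r)
    rooted (suc fuel) n ρ (i , p₁ , inj₂ (l , r))      = node (ρ , p₁ , e) (nonUnit fuel (toℕ i) l) (rooted fuel (n ∸ toℕ i) e r)

    nonUnit : ∀ fuel n → El (NonUnit fuel n) → Tree m
    nonUnit fuel n (inj₁ _)       = leaf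
    nonUnit fuel n (inj₂ (j , c)) = rooted fuel n (punchIn e j) c

  normal : ∀ n → El (Normals n) → Tree m
  normal n (inj₁ c) = nonUnit n n c
  normal n (inj₂ c) = rooted n n e c

  rooted-root : ∀ fuel n ρ c → rootLabel (rooted fuel n ρ c) ≡ just ρ
  rooted-root (suc fuel) n ρ (_ , _ , inj₁ _) = refl
  rooted-root (suc fuel) n ρ (_ , _ , inj₂ _) = refl

  private
    split-leaves : ∀ n (i : Fin (suc n)) → toℕ i + (n ∸ toℕ i) ≡ n
    split-leaves n i = ℕP.m+[n∸m]≡n (ℕP.≤-pred (FinP.toℕ<n i))

  mutual
    rooted-wf : ∀ fuel n ρ c → Normal (rooted fuel n ρ c) × leaves (rooted fuel n ρ c) ≡ n
    rooted-wf (suc fuel) n ρ (i , p₁ , inj₁ (p₂ , l , r))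
      with nonUnit-wf fuel (toℕ i) l | nonUnit-wf fuel (n ∸ toℕ i) r
    ... | nₗ , ¬uₗ , #l | nᵣ , ¬uᵣ , #r =
      node ¬uₗ (λ uᵣ → contradiction uᵣ ¬uᵣ) nₗ nᵣ , ≡.trans (cong₂ _+_ #l #r) (split-leaves n i)
    rooted-wf (suc fuel) n ρ (i , p₁ , inj₂ (l , r))
      with nonUnit-wf fuel (toℕ i) l | rooted-wf fuel (n ∸ toℕ i) e r
    ... | nₗ , ¬uₗ , #l | nᵣ , #r =
      node ¬uₗ (λ _ → refl) nₗ nᵣ , ≡.trans (cong₂ _+_ #l #r) (split-leaves n i)

    nonUnit-wf : ∀ fuel n c → Normal (nonUnit fuel n c) × ¬ UnitRoot (nonUnit fuel n c) × leaves (nonUnit fuel n c) ≡ n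
    nonUnit-wf fuel 1             (inj₁ _) = leaf , (λ ()) , refl
    nonUnit-wf fuel (suc (suc _)) (inj₁ ())
    nonUnit-wf fuel n (inj₂ (j , c)) =
      proj₁ w , (λ u → FinP.punchInᵢ≢i e j (MaybeP.just-injective (≡.trans (≡.sym (rooted-root fuel n (punchIn e j) c)) u))) , proj₂ w
      where w = rooted-wf fuel n (punchIn e j) c

  normal-wf : ∀ n c → Normal (normal n c) × leaves (normal n c) ≡ n
  normal-wf n (inj₁ c) = let w = nonUnit-wf n n c in proj₁ w , proj₂ (proj₂ w)
  normal-wf n (inj₂ c) = rooted-wf n n e c

  private
    leafSet-irrelevant : ∀ n (x y : El (leafSet n)) → x ≡ y
    leafSet-irrelevant 1             tt tt = refl
    leafSet-irrelevant (suc (suc _)) ()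

  mutual
    rooted-injective : ∀ fuel n ρ c c′ → rooted fuel n ρ c ≡ rooted fuel n ρ c′ → c ≡ c′
    rooted-injective (suc fuel) n ρ (i , p₁ , inj₁ (p₂ , l , r)) (i′ , p₁′ , inj₁ (p₂′ , l′ , r′)) eq
      with node-inj eq
    ... | refl , eqₗ , eqᵣ
      with FinP.toℕ-injective (≡.trans (≡.sym (nonUnit-leaves fuel (toℕ i) l)) (≡.trans (cong leaves eqₗ) (nonUnit-leaves fuel (toℕ i′) l′)))
    ...   | refl with nonUnit-injective fuel (toℕ i) l l′ eqₗ | nonUnit-injective fuel (n ∸ toℕ i) r r′ eqᵣ
    ...     | refl | refl = refl
    rooted-injective (suc fuel) n ρ (i , p₁ , inj₂ (l , r)) (i′ , p₁′ , inj₂ (l′ , r′)) eq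
      with node-inj eq
    ... | refl , eqₗ , eqᵣ
      with FinP.toℕ-injective (≡.trans (≡.sym (nonUnit-leaves fuel (toℕ i) l)) (≡.trans (cong leaves eqₗ) (nonUnit-leaves fuel (toℕ i′) l′)))
    ...   | refl with nonUnit-injective fuel (toℕ i) l l′ eqₗ | rooted-injective fuel (n ∸ toℕ i) e r r′ eqᵣ
    ...     | refl | refl = refl
    rooted-injective (suc fuel) n ρ (i , _ , inj₁ (_ , _ , r)) (i′ , _ , inj₂ (_ , r′)) eq =
      contradiction (≡.subst UnitRoot (≡.sym (proj₂ (proj₂ (node-inj eq)))) (rooted-root fuel _ e r′)) (nonUnit-¬unit fuel _ r)
    rooted-injective (suc fuel) n ρ (i , _ , inj₂ (_ , r)) (i′ , _ , inj₁ (_ , _ , r′)) eq =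
      contradiction (≡.subst UnitRoot (proj₂ (proj₂ (node-inj eq))) (rooted-root fuel _ e r)) (nonUnit-¬unit fuel _ r′)

    nonUnit-injective : ∀ fuel n c c′ → nonUnit fuel n c ≡ nonUnit fuel n c′ → c ≡ c′
    nonUnit-injective fuel n (inj₁ x) (inj₁ x′) _ = cong inj₁ (leafSet-irrelevant n x x′)
    nonUnit-injective (suc fuel) n (inj₂ (j , _ , _ , inj₁ _)) (inj₁ _) ()
    nonUnit-injective (suc fuel) n (inj₂ (j , _ , _ , inj₂ _)) (inj₁ _) ()
    nonUnit-injective (suc fuel) n (inj₁ _) (inj₂ (j , _ , _ , inj₁ _)) ()
    nonUnit-injective (suc fuel) n (inj₁ _) (inj₂ (j , _ , _ , inj₂ _)) ()
    nonUnit-injective fuel n (inj₂ (j , c)) (inj₂ (j′ , c′)) eq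
      with FinP.punchIn-injective e j j′
             (MaybeP.just-injective (≡.trans (≡.sym (rooted-root fuel n _ c)) (≡.trans (cong rootLabel eq) (rooted-root fuel n _ c′))))
    ... | refl with rooted-injective fuel n (punchIn e j) c c′ eq
    ...   | refl = refl

    nonUnit-leaves : ∀ fuel n c → leaves (nonUnit fuel n c) ≡ n
    nonUnit-leaves fuel n c = proj₂ (proj₂ (nonUnit-wf fuel n c))

    nonUnit-¬unit : ∀ fuel n c → ¬ UnitRoot (nonUnit fuel n c)
    nonUnit-¬unit fuel n c = proj₁ (proj₂ (nonUnit-wf fuel n c))

  normal-injective : ∀ n c c′ → normal n c ≡ normal n c′ → c ≡ c′
  normal-injective n (inj₁ c) (inj₁ c′) eq = cong inj₁ (nonUnit-injective n n c c′ eq)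
  normal-injective n (inj₂ c) (inj₂ c′) eq = cong inj₂ (rooted-injective n n e c c′ eq)
  normal-injective n (inj₁ c) (inj₂ c′) eq = contradiction (≡.subst UnitRoot (≡.sym eq) (rooted-root n n e c′)) (nonUnit-¬unit n n c)
  normal-injective n (inj₂ c) (inj₁ c′) eq = contradiction (≡.subst UnitRoot eq (rooted-root n n e c)) (nonUnit-¬unit n n c′)

  private
    unit-root-node : ∀ {T} → UnitRoot T → Σ (Fin m) λ q₁ → Σ (Fin m) λ q₂ → Σ (Tree m) λ a → Σ (Tree m) λ b → T ≡ node (e , q₁ , q₂) a b
    unit-root-node {node (.e , q₁ , q₂) a b} refl = q₁ , q₂ , a , b , refl

    non-unit-root : ∀ {ρ} → ¬ just ρ ≡ just e → ¬ e ≡ ρ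
    non-unit-root ¬u refl = ¬u refl

  mutual
    rooted-surjective : ∀ fuel n {ρ p₁ p₂ l r} → Normal (node (ρ , p₁ , p₂) l r) → leaves l + leaves r ≡ n → leaves l + leaves r ≤ fuel →
                        Σ (El (Rooted fuel n)) λ c → rooted fuel n ρ c ≡ node (ρ , p₁ , p₂) l r
    rooted-surjective zero n {l = l} {r} _ _ le = contradiction le (ℕP.<⇒≱ (ℕP.<-≤-trans (s≤s z≤n) (ℕP.+-mono-≤ (leaves≥1 l) (leaves≥1 r))))
    rooted-surjective (suc fuel) n {ρ} {p₁} {p₂} {l} {r} (node ¬uₗ hangsᵣ nₗ nᵣ) #T le = by-right (unitRoot? r)
      where
      i = fromℕ< (s≤s (≡.subst (leaves l ≤_) #T (ℕP.m≤m+n _ _)))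
      #l : toℕ i ≡ leaves l
      #l = FinP.toℕ-fromℕ< _
      #r : n ∸ toℕ i ≡ leaves r
      #r = ≡.trans (cong (n ∸_) #l) (≡.trans (cong (_∸ leaves l) (≡.sym #T)) (ℕP.m+n∸m≡n (leaves l) (leaves r)))
      r≤fuel : leaves r ≤ fuel
      r≤fuel = ℕP.≤-pred (ℕP.<-≤-trans (ℕP.m<n+m (leaves r) (leaves≥1 l)) le)
      left : Σ (El (NonUnit fuel (toℕ i))) λ c → nonUnit fuel (toℕ i) c ≡ l
      left = nonUnit-surjective fuel (toℕ i) l nₗ ¬uₗ (≡.sym #l) (ℕP.≤-pred (ℕP.<-≤-trans (ℕP.m<m+n (leaves l) (leaves≥1 r)) le))
      by-right : Dec (UnitRoot r) → Σ (El (Rooted (suc fuel) n)) λ c → rooted (suc fuel) n ρ c ≡ node (ρ , p₁ , p₂) l r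
      by-right (no ¬uᵣ) =
        let cᵣ , eqᵣ = nonUnit-surjective fuel (n ∸ toℕ i) r nᵣ ¬uᵣ (≡.sym #r) r≤fuel
        in (i , p₁ , inj₁ (p₂ , proj₁ left , cᵣ)) , cong₂ (node (ρ , p₁ , p₂)) (proj₂ left) eqᵣ
      by-right (yes uᵣ) =
        let q₁ , q₂ , a , b , r≡ = unit-root-node uᵣ
            cᵣ , eqᵣ = rooted-surjective fuel (n ∸ toℕ i) (≡.subst Normal r≡ nᵣ)
                         (≡.trans (≡.sym (cong leaves r≡)) (≡.sym #r)) (≡.subst (_≤ fuel) (cong leaves r≡) r≤fuel)
        in (i , p₁ , inj₂ (proj₁ left , cᵣ)) ,
           ≡.trans (cong₂ (node (ρ , p₁ , e)) (proj₂ left) (≡.trans eqᵣ (≡.sym r≡)))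
                   (cong (λ p → node (ρ , p₁ , p) l r) (≡.sym (hangsᵣ uᵣ)))

    nonUnit-surjective : ∀ fuel n T → Normal T → ¬ UnitRoot T → leaves T ≡ n → leaves T ≤ fuel →
                         Σ (El (NonUnit fuel n)) λ c → nonUnit fuel n c ≡ T
    nonUnit-surjective fuel .1 leaf _ _ refl _ = inj₁ tt , refl
    nonUnit-surjective fuel n (node (ρ , p₁ , p₂) l r) nT ¬u #T le =
      let c , eq = rooted-surjective fuel n nT #T le
      in inj₂ (punchOut (non-unit-root ¬u) , c) ,
         ≡.trans (cong (λ ρ′ → rooted fuel n ρ′ c) (FinP.punchIn-punchOut (non-unit-root ¬u))) eq

  normal-surjective : ∀ n T → Normal T → leaves T ≡ n → Σ (El (Normals n)) λ c → normal n c ≡ T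
  normal-surjective n T nT #T with unitRoot? T
  ... | no ¬u = let c , eq = nonUnit-surjective n n T nT ¬u #T (ℕP.≤-reflexive #T) in inj₁ c , eq
  ... | yes u =
    let q₁ , q₂ , a , b , T≡ = unit-root-node u
        c , eq = rooted-surjective n n (≡.subst Normal T≡ nT) (≡.trans (≡.sym (cong leaves T≡)) #T)
                                   (≡.subst (_≤ n) (cong leaves T≡) (ℕP.≤-reflexive #T))
    in inj₂ c , ≡.trans eq (≡.sym T≡)

  basis : ∀ n → Fin (size (Normals n)) → Tree m
  basis n j = normal n (Inverse.to (index (Normals n)) j)

  basis-normal : ∀ n j → Normal (basis n j)
  basis-normal n j = proj₁ (normal-wf n (Inverse.to (index (Normals n)) j))

  basis-arity : ∀ n j → leaves (basis n j) ≡ n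
  basis-arity n j = proj₂ (normal-wf n (Inverse.to (index (Normals n)) j))

  basis-injective : ∀ n {i j} → basis n i ≡ basis n j → i ≡ j
  basis-injective n {i} {j} eq = ≡.trans (≡.sym (Inverse.strictlyInverseʳ ι i))
    (≡.trans (cong (Inverse.from ι) (normal-injective n (Inverse.to ι i) (Inverse.to ι j) eq)) (Inverse.strictlyInverseʳ ι j))
    where ι = index (Normals n)

  basis-complete : ∀ n T → Normal T → leaves T ≡ n → Σ (Fin (size (Normals n))) λ j → basis n j ≡ T
  basis-complete n T nT #T =
    let c , eq = normal-surjective n T nT #T
    in Inverse.from ι c , ≡.trans (cong (normal n) (Inverse.strictlyInverseˡ ι c)) eq
    where ι = index (Normals n)

module Counting (m′ : ℕ) where
  open import Data.Nat using (ℕ)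

  open import Data.Nat using (zero; suc; _+_; _*_; _∸_; _≤_; _<_; s≤s; z≤n)
  import Data.Nat.Properties as ℕP
  import Data.Fin.Properties as FinP
  open import Data.Product using (_×_; _,_)
  open import Relation.Nullary using (yes; no)
  open import Relation.Binary.PropositionalEquality as ≡ using (_≡_; refl; cong; cong₂)
  open import Algebra.Properties.Semiring.Sum ℕP.+-*-semiring using (sum-cong-≗)
  open FiniteSets
  open Codes m′

  private
    m = suc m′

  rootedCount nonUnitCount : (fuel n : ℕ) → ℕ
  rootedCount  fuel n = size (Rooted fuel n)
  nonUnitCount fuel n = size (NonUnit fuel n)

  -- A node with root label ρ and n leaves: edge label p₁, a left child with j leaves and either an
  -- edge label p₂ with a right child without unit root, or p₂ = e with a right child rooted at e.
  splitTerm : (ℓ a : ℕ → ℕ) (n j : ℕ) → ℕ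
  splitTerm ℓ a n j = m * (m * (ℓ j * ℓ (n ∸ j)) + ℓ j * a (n ∸ j))

  private
    m*0 : ∀ x → m * (m * 0 + x * 0) ≡ 0
    m*0 x = ≡.trans (cong (λ z → m * (m * 0 + z)) (ℕP.*-zeroʳ x)) (≡.trans (cong (m *_) (≡.trans (ℕP.+-identityʳ _) (ℕP.*-zeroʳ m))) (ℕP.*-zeroʳ m))

  splitTerm-first : ∀ ℓ a n → ℓ 0 ≡ 0 → splitTerm ℓ a n 0 ≡ 0
  splitTerm-first ℓ a n ℓ₀ rewrite ℓ₀ = m*0 0

  splitTerm-last : ∀ ℓ a n → ℓ 0 ≡ 0 → a 0 ≡ 0 → splitTerm ℓ a n n ≡ 0
  splitTerm-last ℓ a n ℓ₀ a₀ rewrite ℕP.n∸n≡0 n | ℓ₀ | a₀ = ≡.trans (cong (λ z → m * (m * z + ℓ n * 0)) (ℕP.*-zeroʳ (ℓ n))) (m*0 (ℓ n))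

  splitTerm-stable : ∀ ℓ a ℓ′ a′ n j → j ≤ n → ℓ 0 ≡ 0 → ℓ′ 0 ≡ 0 → a 0 ≡ 0 → a′ 0 ≡ 0 →
    (0 < j → j < n → ℓ j ≡ ℓ′ j × ℓ (n ∸ j) ≡ ℓ′ (n ∸ j) × a (n ∸ j) ≡ a′ (n ∸ j)) →
    splitTerm ℓ a n j ≡ splitTerm ℓ′ a′ n j
  splitTerm-stable ℓ a ℓ′ a′ n zero _ ℓ₀ ℓ′₀ _ _ _ = ≡.trans (splitTerm-first ℓ a n ℓ₀) (≡.sym (splitTerm-first ℓ′ a′ n ℓ′₀))
  splitTerm-stable ℓ a ℓ′ a′ n (suc j) j≤n ℓ₀ ℓ′₀ a₀ a′₀ inner with suc j ℕP.≟ n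
  ... | yes refl = ≡.trans (splitTerm-last ℓ a n ℓ₀ a₀) (≡.sym (splitTerm-last ℓ′ a′ n ℓ′₀ a′₀))
  ... | no j≢n with inner (s≤s z≤n) (ℕP.≤∧≢⇒< j≤n j≢n)
  ...   | e₁ , e₂ , e₃ = cong₂ (λ x y → m * (m * x + y)) (cong₂ _*_ e₁ e₂) (cong₂ _*_ e₁ e₃)

  mutual
    rootedCount-0 : ∀ fuel → rootedCount fuel 0 ≡ 0
    rootedCount-0 zero       = refl
    rootedCount-0 (suc fuel) = ≡.trans (ℕP.+-identityʳ _) (splitTerm-first (nonUnitCount fuel) (rootedCount fuel) 0 (nonUnitCount-0 fuel))

    nonUnitCount-0 : ∀ fuel → nonUnitCount fuel 0 ≡ 0
    nonUnitCount-0 fuel = ≡.trans (cong (m′ *_) (rootedCount-0 fuel)) (ℕP.*-zeroʳ m′)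

  private
    inner-bounds : ∀ {n f j} → n ≤ suc f → 0 < j → j < n → j ≤ f × n ∸ j ≤ f
    inner-bounds {n} n≤f 0<j j<n = ℕP.≤-pred (ℕP.<-≤-trans j<n n≤f) , ℕP.≤-trans (ℕP.∸-monoʳ-≤ n 0<j) (ℕP.∸-monoˡ-≤ 1 n≤f)

  mutual
    rootedCount-fuel : ∀ f f′ n → n ≤ f → n ≤ f′ → rootedCount f n ≡ rootedCount f′ n
    rootedCount-fuel zero    f′       .zero z≤n _   = ≡.sym (rootedCount-0 f′)
    rootedCount-fuel (suc f) zero     .zero _   z≤n = rootedCount-0 (suc f)
    rootedCount-fuel (suc f) (suc f′) n     n≤f n≤f′ = sum-cong-≗ λ i →
      splitTerm-stable (nonUnitCount f) (rootedCount f) (nonUnitCount f′) (rootedCount f′) n (toℕ i) (ℕP.≤-pred (FinP.toℕ<n i))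
                       (nonUnitCount-0 f) (nonUnitCount-0 f′) (rootedCount-0 f) (rootedCount-0 f′)
        λ 0<j j<n → let j≤f , r≤f = inner-bounds n≤f 0<j j<n ; j≤f′ , r≤f′ = inner-bounds n≤f′ 0<j j<n in
          nonUnitCount-fuel f f′ (toℕ i) j≤f j≤f′ , nonUnitCount-fuel f f′ _ r≤f r≤f′ , rootedCount-fuel f f′ _ r≤f r≤f′

    nonUnitCount-fuel : ∀ f f′ n → n ≤ f → n ≤ f′ → nonUnitCount f n ≡ nonUnitCount f′ n
    nonUnitCount-fuel f f′ n n≤f n≤f′ = cong (λ z → size (leafSet n) + m′ * z) (rootedCount-fuel f f′ n n≤f n≤f′)

  ℓ a : ℕ → ℕ
  ℓ n = nonUnitCount n n
  a n = rootedCount n n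

  a-recurrence : ∀ n → a (suc n) ≡ sum (λ (i : Fin (suc (suc n))) → splitTerm ℓ a (suc n) (toℕ i))
  a-recurrence n = sum-cong-≗ λ i →
    splitTerm-stable (nonUnitCount n) (rootedCount n) ℓ a (suc n) (toℕ i) (ℕP.≤-pred (FinP.toℕ<n i))
                     (nonUnitCount-0 n) (nonUnitCount-0 0) (rootedCount-0 n) (rootedCount-0 0)
      λ 0<j j<n → let j≤n , r≤n = inner-bounds ℕP.≤-refl 0<j j<n in
        nonUnitCount-fuel n _ _ j≤n ℕP.≤-refl , nonUnitCount-fuel n _ _ r≤n ℕP.≤-refl , rootedCount-fuel n _ _ r≤n ℕP.≤-refl

module HilbertSeries (m′ : ℕ) (ℓ a : ℕ → ℕ) (a-0 : a 0 ≡ 0)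
   (ℓ-def : ∀ n → ℓ n ≡ FiniteSets.size (Codes.leafSet m′ n) ℕ.+ m′ ℕ.* a n)
   (a-rec : ∀ n → a (suc n) ≡ FiniteSets.sum (λ (i : Fin (suc (suc n))) → Counting.splitTerm m′ ℓ a (suc n) (toℕ i))) where
  open import Data.Nat as ℕ using (ℕ; suc)
  open import Relation.Binary.PropositionalEquality using (_≡_)

  open import Data.Nat using (zero)
  import Data.Nat.Properties as ℕP
  open import Algebra.Properties.Semiring.Sum ℕP.+-*-semiring using (sum; *-distribˡ-sum)
  open FiniteSets using (size)
  open import Defs using (module Hilbert)
  open import Data.Integer as ℤ using (ℤ; +_; _+_; _*_; _-_)
  import Data.Integer.Properties as ℤP
  open import Data.Integer.Tactic.RingSolver using (solve-∀)
  open import Data.List using (foldr; applyUpTo)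
  import Data.List.Properties as List
  open import Relation.Binary.PropositionalEquality as ≡ using (refl; cong; cong₂)
  open ≡.≡-Reasoning

  open Counting m′ using (splitTerm)
  open Hilbert (suc m′) (λ n → ℓ n ℕ.+ a n)

  S : (ℕ → ℤ) → ℕ → ℤ
  S h k = foldr _+_ (+ 0) (applyUpTo h k)

  S-cong : ∀ k {f g : ℕ → ℤ} → (∀ i → f i ≡ g i) → S f k ≡ S g k
  S-cong zero    f≗g = refl
  S-cong (suc k) f≗g = cong₂ _+_ (f≗g 0) (S-cong k (λ i → f≗g (suc i)))

  S-zero : ∀ k {f : ℕ → ℤ} → (∀ i → f i ≡ + 0) → S f k ≡ + 0
  S-zero zero    f≗0 = refl
  S-zero (suc k) f≗0 = cong₂ _+_ (f≗0 0) (S-zero k (λ i → f≗0 (suc i)))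

  sum≡S : ∀ k (t : ℕ → ℕ) → + sum (λ (i : Fin k) → t (toℕ i)) ≡ S (λ i → + t i) k
  sum≡S zero    t = refl
  sum≡S (suc k) t = ≡.trans (ℤP.pos-+ (t 0) _) (cong (_+_ (+ t 0)) (sum≡S k (λ i → t (suc i))))

  conv : (ℕ → ℤ) → (ℕ → ℤ) → ℕ → ℤ
  conv f g n = S (λ i → f i * g (n ℕ.∸ i)) (suc n)

  δ₁ δ₂ : ℕ → ℤ
  δ₁ 1 = + 1
  δ₁ _ = + 0
  δ₂ 2 = + 1
  δ₂ _ = + 0

  shift : (ℕ → ℤ) → ℕ → ℤ
  shift g zero    = + 0
  shift g (suc n) = g n

  conv-δ₁ˡ : ∀ g n → conv δ₁ g n ≡ shift g n
  conv-δ₁ˡ g zero    = ≡.trans (ℤP.+-identityʳ _) (ℤP.*-zeroˡ (g 0))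
  conv-δ₁ˡ g (suc n) = begin
    + 0 * g (suc n) + (+ 1 * g n + S (λ i → + 0 * g (n ℕ.∸ suc i)) n)
      ≡⟨ cong₂ _+_ (ℤP.*-zeroˡ (g (suc n))) (cong₂ _+_ (ℤP.*-identityˡ (g n)) (S-zero n (λ i → ℤP.*-zeroˡ (g (n ℕ.∸ suc i))))) ⟩
    + 0 + (g n + + 0)
      ≡⟨ ≡.trans (ℤP.+-identityˡ _) (ℤP.+-identityʳ _) ⟩
    g n ∎

  conv-δ₁ʳ : ∀ g n → conv g δ₁ n ≡ shift g n
  conv-δ₁ʳ g zero          = ≡.trans (ℤP.+-identityʳ _) (ℤP.*-zeroʳ (g 0))
  conv-δ₁ʳ g (suc zero)    = ≡.trans (cong₂ _+_ (ℤP.*-identityʳ (g 0)) (≡.trans (ℤP.+-identityʳ _) (ℤP.*-zeroʳ (g 1)))) (ℤP.+-identityʳ _)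
  conv-δ₁ʳ g (suc (suc n)) = ≡.trans (cong₂ _+_ (ℤP.*-zeroʳ (g 0)) (conv-δ₁ʳ (λ i → g (suc i)) (suc n))) (ℤP.+-identityˡ _)

  shift-δ₁ : ∀ n → shift δ₁ n ≡ δ₂ n
  shift-δ₁ zero                = refl
  shift-δ₁ (suc zero)          = refl
  shift-δ₁ (suc (suc zero))    = refl
  shift-δ₁ (suc (suc (suc n))) = refl

  H²≡conv : ∀ n → H² n ≡ conv H H n
  H²≡conv n = cong (foldr _+_ (+ 0)) (List.map-applyUpTo (λ i → i) (λ i → H i * H (n ℕ.∸ i)) (suc n))

  private
    aℤ ℓℤ : ℕ → ℤ
    aℤ n = + a n
    ℓℤ n = + ℓ n

    leafSet≡δ₁ : ∀ n → + size (Codes.leafSet m′ n) ≡ δ₁ n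
    leafSet≡δ₁ zero          = refl
    leafSet≡δ₁ (suc zero)    = refl
    leafSet≡δ₁ (suc (suc n)) = refl

    mz≡1+m′ : mz ≡ + 1 + + m′
    mz≡1+m′ = ℤP.pos-+ 1 m′

    m′≡mz-1 : + m′ ≡ mz - + 1
    m′≡mz-1 = ≡.trans (cancel (+ m′)) (cong (_- + 1) (≡.sym mz≡1+m′))
      where
      cancel : ∀ y → y ≡ (+ 1 + y) - + 1
      cancel = solve-∀

    H≡ℓ+a : ∀ n → H n ≡ ℓℤ n + aℤ n
    H≡ℓ+a zero    = ≡.sym (≡.trans (cong₂ (λ x y → + x + + y) (≡.trans (ℓ-def 0) (≡.trans (cong (m′ ℕ.*_) a-0) (ℕP.*-zeroʳ m′))) a-0) refl)
    H≡ℓ+a (suc n) = ℤP.pos-+ (ℓ (suc n)) (a (suc n))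

  ℓℤ≡ : ∀ n → ℓℤ n ≡ δ₁ n + (mz - + 1) * aℤ n
  ℓℤ≡ n = begin
    + ℓ n                                            ≡⟨ cong +_ (ℓ-def n) ⟩
    + (size (Codes.leafSet m′ n) ℕ.+ m′ ℕ.* a n) ≡⟨ ℤP.pos-+ (size (Codes.leafSet m′ n)) (m′ ℕ.* a n) ⟩
    + size (Codes.leafSet m′ n) + + (m′ ℕ.* a n)  ≡⟨ cong₂ _+_ (leafSet≡δ₁ n) (ℤP.pos-* m′ (a n)) ⟩
    δ₁ n + + m′ * aℤ n                                ≡⟨ cong (λ z → δ₁ n + z * aℤ n) m′≡mz-1 ⟩
    δ₁ n + (mz - + 1) * aℤ n                          ∎

  H≡ : ∀ n → H n ≡ δ₁ n + mz * aℤ n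
  H≡ n = ≡.trans (H≡ℓ+a n) (≡.trans (cong (_+ aℤ n) (ℓℤ≡ n)) (collect mz (δ₁ n) (aℤ n)))
    where
    collect : ∀ μ d x → d + (μ - + 1) * x + x ≡ d + μ * x
    collect = solve-∀

  P Q : ℕ → ℤ
  P i = δ₁ i + (mz - + 1) * H i
  Q j = (mz - + 1) * δ₁ j + (mz * mz - mz + + 1) * H j

  -- m · splitTerm factors as (m ℓᵢ) · m (m ℓⱼ + aⱼ) = P i · Q j, so H − t is the Cauchy product of P and Q.
  splitTerm≡PQ : ∀ n j → + (suc m′ ℕ.* splitTerm ℓ a n j) ≡ P j * Q (n ℕ.∸ j)
  splitTerm≡PQ n j = begin
    + (m ℕ.* (m ℕ.* (m ℕ.* (ℓ j ℕ.* ℓ k) ℕ.+ ℓ j ℕ.* a k)))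
      ≡⟨ ≡.trans (ℤP.pos-* m _) (cong (mz *_) (≡.trans (ℤP.pos-* m _) (cong (mz *_) (≡.trans (ℤP.pos-+ (m ℕ.* (ℓ j ℕ.* ℓ k)) _)
           (cong₂ _+_ (≡.trans (ℤP.pos-* m _) (cong (mz *_) (ℤP.pos-* (ℓ j) (ℓ k)))) (ℤP.pos-* (ℓ j) (a k))))))) ⟩
    mz * (mz * (mz * (ℓℤ j * ℓℤ k) + ℓℤ j * aℤ k))
      ≡⟨ cong₂ (λ u v → mz * (mz * (mz * (u * v) + u * aℤ k))) (ℓℤ≡ j) (ℓℤ≡ k) ⟩
    mz * (mz * (mz * ((δ₁ j + (mz - + 1) * aℤ j) * (δ₁ k + (mz - + 1) * aℤ k)) + (δ₁ j + (mz - + 1) * aℤ j) * aℤ k))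
      ≡⟨ factor mz (δ₁ j) (δ₁ k) (aℤ j) (aℤ k) ⟩
    (δ₁ j + (mz - + 1) * (δ₁ j + mz * aℤ j)) * ((mz - + 1) * δ₁ k + (mz * mz - mz + + 1) * (δ₁ k + mz * aℤ k))
      ≡⟨ cong₂ (λ u v → (δ₁ j + (mz - + 1) * u) * ((mz - + 1) * δ₁ k + (mz * mz - mz + + 1) * v)) (≡.sym (H≡ j)) (≡.sym (H≡ k)) ⟩
    P j * Q k ∎
    where
    m = suc m′
    k = n ℕ.∸ j
    factor : ∀ μ d d′ x y → μ * (μ * (μ * ((d + (μ - + 1) * x) * (d′ + (μ - + 1) * y)) + (d + (μ - + 1) * x) * y))
                            ≡ (d + (μ - + 1) * (d + μ * x)) * ((μ - + 1) * d′ + (μ * μ - μ + + 1) * (d′ + μ * y))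
    factor = solve-∀

  private
    ℓ-0 : ℓ 0 ≡ 0
    ℓ-0 = ≡.trans (ℓ-def 0) (≡.trans (cong (m′ ℕ.*_) a-0) (ℕP.*-zeroʳ m′))

  mz*aℤ≡conv : ∀ n → mz * aℤ n ≡ conv P Q n
  mz*aℤ≡conv zero = begin
    mz * + a 0                                 ≡⟨ ≡.trans (cong (λ z → mz * + z) a-0) (ℤP.*-zeroʳ mz) ⟩
    + 0                                        ≡⟨ cong +_ (ℕP.*-zeroʳ (suc m′)) ⟨
    + (suc m′ ℕ.* 0)                           ≡⟨ cong (λ z → + (suc m′ ℕ.* z)) (Counting.splitTerm-first m′ ℓ a 0 ℓ-0) ⟨
    + (suc m′ ℕ.* splitTerm ℓ a 0 0)           ≡⟨ splitTerm≡PQ 0 0 ⟩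
    P 0 * Q 0                                  ≡⟨ ℤP.+-identityʳ _ ⟨
    conv P Q 0                                 ∎
  mz*aℤ≡conv (suc n) = begin
    mz * + a (suc n)                           ≡⟨ ℤP.pos-* (suc m′) (a (suc n)) ⟨
    + (suc m′ ℕ.* a (suc n))                   ≡⟨ cong (λ z → + (suc m′ ℕ.* z)) (a-rec n) ⟩
    + (suc m′ ℕ.* sum (λ (i : Fin (suc (suc n))) → t (toℕ i))) ≡⟨ cong +_ (*-distribˡ-sum (suc m′) (λ (i : Fin (suc (suc n))) → t (toℕ i))) ⟩
    + sum (λ (i : Fin (suc (suc n))) → suc m′ ℕ.* t (toℕ i))   ≡⟨ sum≡S (suc (suc n)) (λ j → suc m′ ℕ.* t j) ⟩
    S (λ j → + (suc m′ ℕ.* t j)) (suc (suc n)) ≡⟨ S-cong (suc (suc n)) (splitTerm≡PQ (suc n)) ⟩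
    conv P Q (suc n)                           ∎
    where
    t : ℕ → ℕ
    t = splitTerm ℓ a (suc n)

  S-combine : ∀ k (x y z w : ℤ) (f g h u : ℕ → ℤ) →
              S (λ i → x * f i + y * g i + z * h i + w * u i) k ≡ x * S f k + y * S g k + z * S h k + w * S u k
  S-combine zero    x y z w f g h u = vanish x y z w
    where
    vanish : ∀ x y z w → + 0 ≡ x * + 0 + y * + 0 + z * + 0 + w * + 0
    vanish = solve-∀
  S-combine (suc k) x y z w f g h u =
    ≡.trans (cong (_+_ (x * f 0 + y * g 0 + z * h 0 + w * u 0)) (S-combine k x y z w _ _ _ _)) (regroup x y z w (f 0) (g 0) (h 0) (u 0) _ _ _ _)
    where
    regroup : ∀ x y z w a b c d a′ b′ c′ d′ →
              x * a + y * b + z * c + w * d + (x * a′ + y * b′ + z * c′ + w * d′) ≡ x * (a + a′) + y * (b + b′) + z * (c + c′) + w * (d + d′)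
    regroup = solve-∀

  private
    c₁ c₂ : ℤ
    c₁ = mz - + 1
    c₂ = mz * mz - mz + + 1

    shift≡tH : ∀ n → shift H n ≡ tH n
    shift≡tH zero    = refl
    shift≡tH (suc n) = refl

  conv-PQ : ∀ n → conv P Q n ≡ c₁ * δ₂ n + c₂ * tH n + c₁ * c₁ * tH n + c₁ * c₂ * H² n
  conv-PQ n = begin
    S (λ i → P i * Q (n ℕ.∸ i)) (suc n)
      ≡⟨ S-cong (suc n) (λ i → expand c₁ c₂ (δ₁ i) (δ₁ (n ℕ.∸ i)) (H i) (H (n ℕ.∸ i))) ⟩
    S (λ i → c₁ * (δ₁ i * δ₁ (n ℕ.∸ i)) + c₂ * (δ₁ i * H (n ℕ.∸ i)) + c₁ * c₁ * (H i * δ₁ (n ℕ.∸ i)) + c₁ * c₂ * (H i * H (n ℕ.∸ i))) (suc n)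
      ≡⟨ S-combine (suc n) c₁ c₂ (c₁ * c₁) (c₁ * c₂) (λ i → δ₁ i * δ₁ (n ℕ.∸ i)) (λ i → δ₁ i * H (n ℕ.∸ i))
                                                      (λ i → H i * δ₁ (n ℕ.∸ i)) (λ i → H i * H (n ℕ.∸ i)) ⟩
    c₁ * conv δ₁ δ₁ n + c₂ * conv δ₁ H n + c₁ * c₁ * conv H δ₁ n + c₁ * c₂ * conv H H n
      ≡⟨ cong₂ _+_ (cong₂ _+_ (cong₂ _+_ (cong (c₁ *_) (≡.trans (conv-δ₁ˡ δ₁ n) (shift-δ₁ n)))
                                        (cong (c₂ *_) (≡.trans (conv-δ₁ˡ H n) (shift≡tH n))))
                             (cong (c₁ * c₁ *_) (≡.trans (conv-δ₁ʳ H n) (shift≡tH n))))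
                   (cong (c₁ * c₂ *_) (≡.sym (H²≡conv n))) ⟩
    c₁ * δ₂ n + c₂ * tH n + c₁ * c₁ * tH n + c₁ * c₂ * H² n ∎
    where
    expand : ∀ x y d d′ h h′ → (d + x * h) * (x * d′ + y * h′) ≡ x * (d * d′) + y * (d * h′) + x * x * (h * d′) + x * y * (h * h′)
    expand = solve-∀

  private
    tc≡ : ∀ n → tc n ≡ δ₁ n + c₁ * δ₂ n
    tc≡ zero                = ≡.sym (≡.trans (ℤP.+-identityˡ _) (ℤP.*-zeroʳ c₁))
    tc≡ (suc zero)          = ≡.sym (≡.trans (cong (_+_ (+ 1)) (ℤP.*-zeroʳ c₁)) (ℤP.+-identityʳ (+ 1)))
    tc≡ (suc (suc zero))    = ≡.sym (≡.trans (ℤP.+-identityˡ _) (ℤP.*-identityʳ _))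
    tc≡ (suc (suc (suc n))) = ≡.sym (≡.trans (ℤP.+-identityˡ _) (ℤP.*-zeroʳ c₁))

  hilbert : HilbertEq
  hilbert n = begin
    coeff n
      ≡⟨ cong₂ (λ u v → u + ((+ 2 * mz * mz - + 3 * mz + + 2) * tH n - v) + (mz * mz * mz - + 2 * mz * mz + + 2 * mz - + 1) * H² n)
               (tc≡ n) H≡δ₁+conv ⟩
    δ₁ n + c₁ * δ₂ n + ((+ 2 * mz * mz - + 3 * mz + + 2) * tH n - (δ₁ n + (c₁ * δ₂ n + c₂ * tH n + c₁ * c₁ * tH n + c₁ * c₂ * H² n)))
      + (mz * mz * mz - + 2 * mz * mz + + 2 * mz - + 1) * H² n
      ≡⟨ cancel mz (δ₁ n) (δ₂ n) (tH n) (H² n) ⟩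
    + 0 ∎
    where
    H≡δ₁+conv : H n ≡ δ₁ n + (c₁ * δ₂ n + c₂ * tH n + c₁ * c₁ * tH n + c₁ * c₂ * H² n)
    H≡δ₁+conv = ≡.trans (H≡ n) (cong (_+_ (δ₁ n)) (≡.trans (mz*aℤ≡conv n) (conv-PQ n)))
    cancel : ∀ μ d d₂ x y → d + (μ - + 1) * d₂ + ((+ 2 * μ * μ - + 3 * μ + + 2) * x
                            - (d + ((μ - + 1) * d₂ + (μ * μ - μ + + 1) * x + (μ - + 1) * (μ - + 1) * x + (μ - + 1) * (μ * μ - μ + + 1) * y)))
                            + (μ * μ * μ - + 2 * μ * μ + + 2 * μ - + 1) * y ≡ + 0
    cancel = solve-∀

open FiniteSets using (size)

module _ {c ℓ} (K : CharZeroField c ℓ) {m′ : ℕ} (_⋆_ : Op₂ (Fin (suc m′))) (e : Fin (suc m′))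
         (⋆-identityʳ : ∀ x → x ⋆ e ≡ x) (n : ℕ) where
  open Codes m′
  open Enumeration e
  open Linear K _⋆_ e

  normal-trees-basis : Koszul.IsDim K _⋆_ e n (size (Normals n))
  normal-trees-basis = δ ∘ basis n , vanish , independent , span
    where
    open Spanning K _⋆_ e ⋆-identityʳ n _ (basis n) (basis-complete n) using (span)
    open Independence K _⋆_ e ⋆-identityʳ n _ (basis n) (basis-normal n) (basis-arity n) (basis-injective n) using (independent)
    vanish : ∀ i T → ¬ leaves T ≡ n → δ (basis n i) T ≈ 0#
    vanish i T #T≢n = 𝟙-no (basis n i ≟T T) λ bᵢ≡T → #T≢n (≡.trans (≡.cong leaves (≡.sym bᵢ≡T)) (basis-arity n i))

proposition4p3 : ∀ {c ℓ} (K : CharZeroField c ℓ) (m : ℕ) (_⋆_ : Op₂ (Fin m)) (e : Fin m)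
    → IsUnitalMagma _≡_ _⋆_ e
    → Σ (ℕ → ℕ) λ d
      → (∀ n → 1 ≤ n → Koszul.IsDim K _⋆_ e n (d n))
      × Hilbert.HilbertEq m d
proposition4p3 K zero    _⋆_ () unital
proposition4p3 K (suc m′) _⋆_ e unital =
  (λ n → size (Codes.Normals m′ n)) ,
  (λ n _ → normal-trees-basis K _⋆_ e (IsUnitalMagma.identityʳ unital) n) ,
  HilbertSeries.hilbert m′ ℓ a (rootedCount-0 0) (λ _ → ≡.refl) a-recurrence
  where open Counting m′
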